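{- Let $\mathbb{N}=\{0,1,2,\ldots\}$, $J=\{(2n+1)2^{2k}-1 \mid n,k\in\mathbb{N}\}$ and $K=\mathbb{N}\setminus J=\{(2n+1)2^{2k+1}-1\mid n,k\in\mathbb{N}\}$. For every integer $m\ge 1$, $$\nu(\mathbb{N}|_m,0,K)+\nu(\mathbb{N}|_m,1,K)\equiv 1 \pmod 2,\qquad \nu(\mathbb{N}|_{2m-1},1,J)\equiv 1\pmod 2,\qquad \nu(\mathbb{N}|_{2m},0,J)+\nu(\mathbb{N}|_{2m},2,J)\equiv 1\pmod 2.$$
   Context: For a set $A$ of integers and integer $m\ge 0$, $A|_m$ denotes the set of the $m$ smallest elements of $A$. For a set $B$ of integers, a transposition $(c,d)$ (with $c\ne d$) is called a $B$-transposition if $c+d\in B$ and $c+d$ is odd. For a finite set $A$, a set $B$, and an integer $f\ge 0$, $\nu(A,f,B)$ denotes the number of involutions $\sigma$ of $A$ (permutations with $\sigma=\sigma^{ -1}$) that have exactly $f$ fixed points and all of whose transpositions (2-cycles) are $B$-transpositions. -}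

module Defs where

open import Data.Nat using (>-nonZero; ℕ; zero; suc; _+_; _*_; _∸_; _^_; _≤_; _<_; z≤n; s≤s; _%_)
open import Data.Nat.Properties
open import Data.Fin using (Fin; toℕ)
open import Data.Fin.Properties using (all?)
open import Data.Vec using (Vec; []; _∷_; lookup)
open import Data.List using (List; []; _∷_; length; filter; map; concatMap; allFin)
open import Data.Sum using (inj₁; inj₂)
open import Data.Product using (Σ; ∃; ∃-syntax; _×_; _,_)
open import Relation.Nullary using (Dec; yes; no; ¬_)
open import Relation.Nullary.Decidable using (_×-dec_; _→-dec_; map′)
open import Relation.Unary using (Decidable)
open import Relation.Binary.PropositionalEquality using (_≡_; _≢_; refl; sym; subst; cong)
import Data.Fin as F
import Data.Empty

-- The sets J and K (x + 1 = ... is x = ... - 1, the right side being ≥ 1)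

J : ℕ → Set
J x = ∃[ n ] ∃[ k ] x + 1 ≡ (2 * n + 1) * 2 ^ (2 * k)

K : ℕ → Set
K x = ∃[ n ] ∃[ k ] x + 1 ≡ (2 * n + 1) * 2 ^ (2 * k + 1)

private
  boundedDec : (Q : ℕ → Set) → Decidable Q → ∀ b → Dec (∃[ n ] (n < b × Q n))
  boundedDec Q Q? zero = no λ { (n , () , _) }
  boundedDec Q Q? (suc b) with Q? b | boundedDec Q Q? b
  ... | yes q | _ = yes (b , ≤-refl , q)
  ... | no _ | yes (n , n<b , q) = yes (n , m≤n⇒m≤1+n n<b , q)
  ... | no ¬q | no ¬r = no λ { (n , n<sb , q) → helper n n<sb q }
    where
    helper : ∀ n → n < suc b → Q n → Data.Empty.⊥
    helper n n<sb q with m≤n⇒m<n∨m≡n (≤-pred n<sb)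
    ... | inj₁ n<b = ¬r (n , n<b , q)
    ... | inj₂ refl = ¬q q

  k<2^k : ∀ k → k < 2 ^ k
  k<2^k zero = s≤s z≤n
  k<2^k (suc k) = ≤-trans (s≤s (k<2^k k)) (≤-trans (≤-reflexive (+-comm 1 (2 ^ k))) (+-monoʳ-≤ (2 ^ k) {1} {2 ^ k + 0} (≤-trans (m^n>0 2 k) (m≤m+n (2 ^ k) 0))))

  genDec : (e : ℕ → ℕ) → (∀ k → k ≤ e k) → ∀ x →
           Dec (∃[ n ] ∃[ k ] x + 1 ≡ (2 * n + 1) * 2 ^ e k)
  genDec e ke x =
    map′ (λ { (n , _ , k , _ , p) → n , k , p })
         (λ { (n , k , p) → n , nb n k p , k , kb n k p , p })
         (boundedDec _ (λ n → boundedDec _ (λ k → x + 1 ≟ (2 * n + 1) * 2 ^ e k) (suc (x + 1))) (suc (x + 1)))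
    where
    nb : ∀ n k → x + 1 ≡ (2 * n + 1) * 2 ^ e k → n < suc (x + 1)
    nb n k p = s≤s (≤-trans (≤-trans (m≤m+n n (n + 0 + 1)) (≤-reflexive (sym (+-assoc n (n + 0) 1))))
                 (≤-trans (m≤m*n (2 * n + 1) (2 ^ e k) {{m^n≢0 2 (e k)}}) (≤-reflexive (sym p))))
    kb : ∀ n k → x + 1 ≡ (2 * n + 1) * 2 ^ e k → k < suc (x + 1)
    kb n k p = ≤-trans (k<2^k k) (≤-trans (^-monoʳ-≤ 2 (ke k))
                 (≤-trans (m≤n*m (2 ^ e k) (2 * n + 1) {{>-nonZero (≤-trans (s≤s z≤n) (m≤n+m 1 (2 * n)))}}) (≤-trans (≤-reflexive (sym p)) (m≤n⇒m≤1+n ≤-refl))))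

J? : Decidable J
J? = genDec (λ k → 2 * k) (λ k → m≤m+n k (k + 0))

K? : Decidable K
K? = genDec (λ k → 2 * k + 1) (λ k → ≤-trans (m≤m+n k (k + 0)) (m≤m+n (2 * k) 1))

allVecs : ∀ {A : Set} → List A → ∀ k → List (Vec A k)
allVecs xs zero = [] ∷ []
allVecs xs (suc k) = concatMap (λ x → map (x ∷_) (allVecs xs k)) xs

-- Involutions of N|_m = {0,…,m-1}, identified with Fin m via toℕ.

module _ {m : ℕ} (σ : Fin m → Fin m) where

  IsInvolution : Set
  IsInvolution = ∀ i → σ (σ i) ≡ i

  fixedPoints : ℕ
  fixedPoints = length (filter (λ i → σ i F.≟ i) (allFin m))

  AllBTransp : (B : ℕ → Set) → Set
  AllBTransp B = ∀ i → σ i ≢ i → B (toℕ i + toℕ (σ i)) × (toℕ i + toℕ (σ i)) % 2 ≡ 1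

module _ (B : ℕ → Set) (B? : Decidable B) (f : ℕ) where

  Good : ∀ {m} → Vec (Fin m) m → Set
  Good v = IsInvolution (lookup v) × fixedPoints (lookup v) ≡ f × AllBTransp (lookup v) B

  Good? : ∀ {m} → Decidable (Good {m})
  Good? v = all? (λ i → lookup v (lookup v i) F.≟ i)
      ×-dec (fixedPoints (lookup v) ≟ f)
      ×-dec all? (λ i → (¬? (lookup v i F.≟ i)) →-dec (B? _ ×-dec (_ ≟ 1)))
    where
    open import Relation.Nullary.Decidable using (¬?)

ν : ℕ → ℕ → (B : ℕ → Set) → Decidable B → ℕ
ν m f B B? = length (filter (Good? B B? f) (allVecs (allFin m) m))

-- A transposition (c d) of {0, …, n − 1} with c + d odd and c + d ∈ B is an edge of a graph on {0, …, n − 1}, and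
-- the involutions counted by ν are its matchings, their fixed points the unmatched vertices. Taken modulo 2 and
-- indexed by the number of unmatched vertices, these counts form a polynomial over GF(2): disjoint unions multiply,
-- and adding all edges between two disjoint sets P and Q only adds the matchings with one vertex of P and one of Q
-- deleted, because matchings using two of the new edges cancel in pairs.
--
-- A J-edge c + d has c + d ≡ 3 (mod 4), so it stays inside one of the residue classes {0, 3} and {1, 2} modulo 4,
-- and halving the vertices of a class turns its J-edges into the K-edges of an initial segment of ℕ. Likewise the
-- K-graph is a pair of halved J-graphs plus the complete bipartite graphs between the residues 0, 1 and 2, 3. All
-- these graphs are bipartite between even and odd vertices, which pins down the coefficients with at most two
-- unmatched vertices, and a strong induction on n proves the parities for K and for J together.

module Submission where

open import Data.Bool using (Bool; true; false; _xor_; _∧_; _∨_; not; if_then_else_; T?)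
open import Data.Bool.Properties
  using ( ¬-not; ∧-zeroʳ; ∧-identityˡ; ∧-identityʳ; ∧-assoc; ∧-comm; ∧-idem; ∧-abs-∨; ∧-distribˡ-xor; ∧-distribʳ-xor
        ; ∨-zeroʳ; xor-assoc; xor-comm; xor-same; xor-identityʳ; xor-inverseʳ
        ; not-involutive; not-injective; not-distribˡ-xor; not-distribʳ-xor )
  renaming (_≟_ to _≟𝔹_)
open import Data.Bool.Solver using (module xor-∧-Solver; module ∨-∧-Solver)
open import Data.Empty using (⊥; ⊥-elim)
open import Data.Fin using (Fin; toℕ; _≟_)
open import Data.Fin.Permutation.Components using (transpose)
open import Data.Fin.Properties using (toℕ-injective; all?)
open import Data.List using (List; []; _∷_; [_]; _++_; length; map; filter; filterᵇ; concatMap; cartesianProductWith; upTo; applyUpTo; tabulate; allFin)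
open import Data.List.Membership.Propositional using (_∈_)
open import Data.List.Membership.Propositional.Properties using (∈-map⁺; ∈-cartesianProductWith⁺; ∈-allFin)
open import Data.List.Membership.Propositional.Properties.WithK using (unique∧set⇒bag)
open import Data.List.Properties using (length-filter; filter-++; upTo-∷ʳ; map-upTo; map-tabulate; map-++; length-++; ++-identityʳ)
open import Data.List.Relation.Binary.BagAndSetEquality using (∼bag⇒↭)
open import Data.List.Relation.Binary.Permutation.Propositional as ↭ using (_↭_)
open import Data.List.Relation.Unary.All using ([]; _∷_) renaming (lookup to All-lookup)
open import Data.List.Relation.Unary.AllPairs using ([]; _∷_)
open import Data.List.Relation.Unary.Any using (here; there)
open import Data.List.Relation.Unary.Unique.Propositional using (Unique)
open import Data.List.Relation.Unary.Unique.Propositional.Properties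
  using () renaming (map⁺ to Unique-map⁺; cartesianProductWith⁺ to Unique-cartesianProductWith⁺; allFin⁺ to Unique-allFin⁺)
open import Data.Nat using (ℕ; zero; suc; _+_; _*_; _^_; _∸_; _%_; _≤_; _<_; z≤n; s≤s; _≡ᵇ_; ⌊_/2⌋)
open import Data.Nat.DivMod using ([m+n]%n≡m%n)
open import Data.Nat.Induction using (<-rec)
open import Data.Nat.Properties
  using ( ≤-refl; ≤-trans; ≤-reflexive; +-monoʳ-≤; +-suc; +-comm; +-assoc; +-identityʳ; +-cancelʳ-≡; *-identityʳ; *-suc
        ; *-distribˡ-+; suc-injective; n≡⌊n+n/2⌋; ⌊n/2⌋<n )
  renaming (_≟_ to _≟ℕ_)
open import Data.Nat.Tactic.RingSolver using (solve-∀)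
open import Data.Product using (_×_; _,_; proj₁; proj₂; ∃-syntax)
open import Data.Sum using (_⊎_; inj₁; inj₂)
open import Data.Vec as Vec using (Vec; []; _∷_; lookup)
open import Data.Vec.Properties using (∷-injective; lookup∘tabulate; tabulate∘lookup; tabulate-cong)
open import Function using (_∘_; id)
open import Function.Bundles using (mk⇔)
open import Relation.Binary.PropositionalEquality using (_≡_; _≢_; refl; sym; trans; cong; cong₂; subst; module ≡-Reasoning)
open import Relation.Nullary using (Dec; yes; no)
open import Relation.Nullary.Decidable using (⌊_⌋; _×-dec_; _→-dec_; ¬?; dec-true; dec-false)
open import Relation.Unary using (Decidable)
open import Defs

-- Parity sums and lists of natural numbers

odd : ℕ → Bool
odd zero = false
odd (suc n) = not (odd n)

xor-interchange : ∀ a b c d → (a xor b) xor (c xor d) ≡ (a xor c) xor (b xor d)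
xor-interchange = solve 4 (λ a b c d → (a :+ b) :+ (c :+ d) := (a :+ c) :+ (b :+ d)) refl
  where open xor-∧-Solver

xor-exchange : ∀ a b c d → a xor b ≡ c xor d → a xor c ≡ b xor d
xor-exchange a b c d h =
  trans (solve 3 (λ a b c → a :+ c := (a :+ b) :+ (b :+ c)) refl a b c)
    (trans (cong (_xor (b xor c)) h) (solve 3 (λ b c d → (c :+ d) :+ (b :+ c) := b :+ d) refl b c d))
  where open xor-∧-Solver

∧-leftComm : ∀ a b c → a ∧ (b ∧ c) ≡ b ∧ (a ∧ c)
∧-leftComm true b c = refl
∧-leftComm false b c = sym (∧-zeroʳ b)

∧-guard : ∀ b {x y} → (b ≡ true → x ≡ y) → b ∧ x ≡ b ∧ y
∧-guard true h = h refl
∧-guard false h = refl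

∧-true : ∀ {a b} → a ∧ b ≡ true → a ≡ true × b ≡ true
∧-true {true} {true} _ = refl , refl

not≡true : ∀ {a} → not a ≡ true → a ≡ false
not≡true {false} _ = refl

xor≡false⇒≡ : ∀ {a b} → a xor b ≡ false → a ≡ b
xor≡false⇒≡ {false} e = sym e
xor≡false⇒≡ {true} {true} _ = refl

xor-true : ∀ {a b} → a xor b ≡ true → a ≡ true ⊎ b ≡ true
xor-true {true} _ = inj₁ refl
xor-true {false} e = inj₂ e

⌊⌋-true : ∀ {P : Set} (p : Dec P) → ⌊ p ⌋ ≡ true → P
⌊⌋-true (yes p) _ = p

⌊_⌋-yes : ∀ {P : Set} (p : Dec P) → P → ⌊ p ⌋ ≡ true
⌊ yes _ ⌋-yes _ = refl
⌊ no ¬p ⌋-yes p = ⊥-elim (¬p p)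

⌊_⌋-no : ∀ {P : Set} (p : Dec P) → (P → ⊥) → ⌊ p ⌋ ≡ false
⌊ yes p ⌋-no ¬p = ⊥-elim (¬p p)
⌊ no _ ⌋-no _ = refl

⌊⌋-cong : ∀ {P Q : Set} (p : Dec P) (q : Dec Q) → (P → Q) → (Q → P) → ⌊ p ⌋ ≡ ⌊ q ⌋
⌊⌋-cong (yes p) q to from = sym (⌊ q ⌋-yes (to p))
⌊⌋-cong (no ¬p) q to from = sym (⌊ q ⌋-no (λ q′ → ¬p (from q′)))

∧-⌊⌋-cong : ∀ {P Q : Set} a (p : Dec P) b (q : Dec Q) →
            (a ≡ true → P → b ≡ true × Q) → (b ≡ true → Q → a ≡ true × P) → a ∧ ⌊ p ⌋ ≡ b ∧ ⌊ q ⌋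
∧-⌊⌋-cong false p false q to from = refl
∧-⌊⌋-cong true (no ¬p) false q to from = refl
∧-⌊⌋-cong true (yes p) false q to from with () ← proj₁ (to refl p)
∧-⌊⌋-cong false p true (yes q) to from with () ← proj₁ (from refl q)
∧-⌊⌋-cong false p true (no ¬q) to from = refl
∧-⌊⌋-cong true (yes p) true (yes q) to from = refl
∧-⌊⌋-cong true (yes p) true (no ¬q) to from = ⊥-elim (¬q (proj₂ (to refl p)))
∧-⌊⌋-cong true (no ¬p) true (yes q) to from = ⊥-elim (¬p (proj₂ (from refl q)))
∧-⌊⌋-cong true (no ¬p) true (no ¬q) to from = refl

⨁ : {A : Set} → List A → (A → Bool) → Bool
⨁ [] g = false
⨁ (x ∷ xs) g = g x xor ⨁ xs g

⨁-cong : ∀ {A : Set} (xs : List A) {g h} → (∀ x → g x ≡ h x) → ⨁ xs g ≡ ⨁ xs h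
⨁-cong [] e = refl
⨁-cong (x ∷ xs) e = cong₂ _xor_ (e x) (⨁-cong xs e)

⨁-false : ∀ {A : Set} (xs : List A) → ⨁ xs (λ _ → false) ≡ false
⨁-false [] = refl
⨁-false (x ∷ xs) = ⨁-false xs

⨁-xor : ∀ {A : Set} (xs : List A) g h → ⨁ xs (λ x → g x xor h x) ≡ ⨁ xs g xor ⨁ xs h
⨁-xor [] g h = refl
⨁-xor (x ∷ xs) g h = trans (cong ((g x xor h x) xor_) (⨁-xor xs g h)) (xor-interchange (g x) (h x) _ _)

∧-distribˡ-⨁ : ∀ {A : Set} b (xs : List A) g → b ∧ ⨁ xs g ≡ ⨁ xs (λ x → b ∧ g x)
∧-distribˡ-⨁ b [] g = ∧-zeroʳ b
∧-distribˡ-⨁ b (x ∷ xs) g = trans (∧-distribˡ-xor b (g x) (⨁ xs g)) (cong ((b ∧ g x) xor_) (∧-distribˡ-⨁ b xs g))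

⨁-comm : ∀ {A B : Set} (xs : List A) (ys : List B) (g : A → B → Bool) → ⨁ xs (λ x → ⨁ ys (g x)) ≡ ⨁ ys (λ y → ⨁ xs (λ x → g x y))
⨁-comm [] ys g = sym (⨁-false ys)
⨁-comm (x ∷ xs) ys g = trans (cong (⨁ ys (g x) xor_) (⨁-comm xs ys g)) (sym (⨁-xor ys (g x) (λ y → ⨁ xs (λ x′ → g x′ y))))

⨁-map : ∀ {A B : Set} (ψ : A → B) (xs : List A) g → ⨁ (map ψ xs) g ≡ ⨁ xs (g ∘ ψ)
⨁-map ψ [] g = refl
⨁-map ψ (x ∷ xs) g = cong (g (ψ x) xor_) (⨁-map ψ xs g)

⨁-filterᵇ : ∀ {A : Set} p (xs : List A) g → ⨁ (filterᵇ p xs) g ≡ ⨁ xs (λ x → p x ∧ g x)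
⨁-filterᵇ p [] g = refl
⨁-filterᵇ p (x ∷ xs) g with p x
... | true = cong (g x xor_) (⨁-filterᵇ p xs g)
... | false = ⨁-filterᵇ p xs g

filterᵇ-comm : ∀ {A : Set} p q (xs : List A) → filterᵇ p (filterᵇ q xs) ≡ filterᵇ q (filterᵇ p xs)
filterᵇ-comm p q [] = refl
filterᵇ-comm p q (x ∷ xs) with q x in qx | p x in px
... | true | true rewrite qx | px = cong (x ∷_) (filterᵇ-comm p q xs)
... | true | false rewrite px = filterᵇ-comm p q xs
... | false | true rewrite qx = filterᵇ-comm p q xs
... | false | false = filterᵇ-comm p q xs

≡ᵇ-refl : ∀ x → (x ≡ᵇ x) ≡ true
≡ᵇ-refl zero = refl
≡ᵇ-refl (suc x) = ≡ᵇ-refl x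

≡ᵇ-sym : ∀ x y → (x ≡ᵇ y) ≡ (y ≡ᵇ x)
≡ᵇ-sym zero zero = refl
≡ᵇ-sym zero (suc y) = refl
≡ᵇ-sym (suc x) zero = refl
≡ᵇ-sym (suc x) (suc y) = ≡ᵇ-sym x y

≡ᵇ⇒≡ : ∀ x y → (x ≡ᵇ y) ≡ true → x ≡ y
≡ᵇ⇒≡ zero zero _ = refl
≡ᵇ⇒≡ (suc x) (suc y) e = cong suc (≡ᵇ⇒≡ x y e)

≢⇒≡ᵇ-false : ∀ x y → x ≢ y → (x ≡ᵇ y) ≡ false
≢⇒≡ᵇ-false x y x≢y with x ≡ᵇ y in e
... | false = refl
... | true with () ← x≢y (≡ᵇ⇒≡ x y e)

infix 4 _∈ᵇ_

_∈ᵇ_ : ℕ → List ℕ → Bool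
x ∈ᵇ [] = false
x ∈ᵇ (z ∷ xs) = (z ≡ᵇ x) ∨ (x ∈ᵇ xs)

∈ᵇ-here : ∀ x xs → (x ∈ᵇ x ∷ xs) ≡ true
∈ᵇ-here x xs = cong (_∨ (x ∈ᵇ xs)) (≡ᵇ-refl x)

∈ᵇ-there : ∀ z {x} xs → (x ∈ᵇ xs) ≡ true → (x ∈ᵇ z ∷ xs) ≡ true
∈ᵇ-there z {x} xs x∈xs = trans (cong ((z ≡ᵇ x) ∨_) x∈xs) (∨-zeroʳ _)

∈⇒∈ᵇ : ∀ {x xs} → x ∈ xs → (x ∈ᵇ xs) ≡ true
∈⇒∈ᵇ {x} {z ∷ xs} (here refl) = ∈ᵇ-here x xs
∈⇒∈ᵇ {x} {z ∷ xs} (there x∈) = ∈ᵇ-there z xs (∈⇒∈ᵇ x∈)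

∈ᵇ-∉ᵇ⇒≢ : ∀ {x y} xs → (x ∈ᵇ xs) ≡ false → (y ∈ᵇ xs) ≡ true → (x ≡ᵇ y) ≡ false
∈ᵇ-∉ᵇ⇒≢ {x} {y} xs x∉ y∈ = ≢⇒≡ᵇ-false x y x≢y
  where
  x≢y : x ≢ y
  x≢y refl with () ← trans (sym x∉) y∈

∈ᵇ-filterᵇ : ∀ p x xs → (x ∈ᵇ filterᵇ p xs) ≡ p x ∧ (x ∈ᵇ xs)
∈ᵇ-filterᵇ p x [] = sym (∧-zeroʳ (p x))
∈ᵇ-filterᵇ p x (z ∷ xs) with z ≡ᵇ x in e
... | true with ≡ᵇ⇒≡ z x e
...   | refl with p z in pz
...     | true rewrite e = refl
...     | false = trans (∈ᵇ-filterᵇ p z xs) (cong (_∧ (z ∈ᵇ xs)) pz)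
∈ᵇ-filterᵇ p x (z ∷ xs) | false with p z
... | true rewrite e = ∈ᵇ-filterᵇ p x xs
... | false = ∈ᵇ-filterᵇ p x xs

data Distinct : List ℕ → Set where
  [] : Distinct []
  _∷_ : ∀ {x xs} → (x ∈ᵇ xs) ≡ false → Distinct xs → Distinct (x ∷ xs)

Allᵇ : (ℕ → Bool) → List ℕ → Set
Allᵇ D xs = ∀ z → (z ∈ᵇ xs) ≡ true → D z ≡ true

∈ᵇ-filterᵇ⁻ : ∀ p {x} xs → (x ∈ᵇ filterᵇ p xs) ≡ true → p x ≡ true × (x ∈ᵇ xs) ≡ true
∈ᵇ-filterᵇ⁻ p {x} xs x∈ = ∧-true (trans (sym (∈ᵇ-filterᵇ p x xs)) x∈)

∈ᵇ-filterᵇ⁺ : ∀ p {x} xs → p x ≡ true → (x ∈ᵇ xs) ≡ true → (x ∈ᵇ filterᵇ p xs) ≡ true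
∈ᵇ-filterᵇ⁺ p {x} xs px x∈ = trans (∈ᵇ-filterᵇ p x xs) (cong₂ _∧_ px x∈)

∉ᵇ-filterᵇ-rejected : ∀ p {x} xs → p x ≡ false → (x ∈ᵇ filterᵇ p xs) ≡ false
∉ᵇ-filterᵇ-rejected p {x} xs px = trans (∈ᵇ-filterᵇ p x xs) (cong (_∧ (x ∈ᵇ xs)) px)

∉ᵇ-filterᵇ : ∀ p {x} xs → (x ∈ᵇ xs) ≡ false → (x ∈ᵇ filterᵇ p xs) ≡ false
∉ᵇ-filterᵇ p {x} xs x∉ = trans (∈ᵇ-filterᵇ p x xs) (trans (cong (p x ∧_) x∉) (∧-zeroʳ (p x)))

Distinct-filterᵇ : ∀ p {xs} → Distinct xs → Distinct (filterᵇ p xs)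
Distinct-filterᵇ p [] = []
Distinct-filterᵇ p {x ∷ xs} (x∉ ∷ d) with p x
... | true = ∉ᵇ-filterᵇ p xs x∉ ∷ Distinct-filterᵇ p d
... | false = Distinct-filterᵇ p d

Allᵇ-filterᵇ : ∀ D p xs → Allᵇ D xs → Allᵇ D (filterᵇ p xs)
Allᵇ-filterᵇ D p xs all z z∈ = all z (proj₂ (∈ᵇ-filterᵇ⁻ p xs z∈))

Allᵇ-filterᵇ-self : ∀ p xs → Allᵇ p (filterᵇ p xs)
Allᵇ-filterᵇ-self p xs z z∈ = proj₁ (∈ᵇ-filterᵇ⁻ p xs z∈)

Allᵇ-head : ∀ D x xs → Allᵇ D (x ∷ xs) → D x ≡ true
Allᵇ-head D x xs all = all x (∈ᵇ-here x xs)

Allᵇ-tail : ∀ D x xs → Allᵇ D (x ∷ xs) → Allᵇ D xs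
Allᵇ-tail D x xs all z z∈ = all z (∈ᵇ-there x xs z∈)

⨁-cong-∈ᵇ : ∀ xs {g h} → (∀ x → (x ∈ᵇ xs) ≡ true → g x ≡ h x) → ⨁ xs g ≡ ⨁ xs h
⨁-cong-∈ᵇ [] e = refl
⨁-cong-∈ᵇ (x ∷ xs) e = cong₂ _xor_ (e x (∈ᵇ-here x xs)) (⨁-cong-∈ᵇ xs (λ z z∈ → e z (∈ᵇ-there x xs z∈)))

⨁-true : ∀ xs g → ⨁ xs g ≡ true → ∃[ x ] (x ∈ᵇ xs) ≡ true × g x ≡ true
⨁-true (x ∷ xs) g s with g x in gx
... | true = x , ∈ᵇ-here x xs , gx
... | false with ⨁-true xs g s
...   | z , z∈ , gz = z , ∈ᵇ-there x xs z∈ , gz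

⨁-≡ᵇ : ∀ w zs → Distinct zs → ⨁ zs (w ≡ᵇ_) ≡ (w ∈ᵇ zs)
⨁-≡ᵇ w [] [] = refl
⨁-≡ᵇ w (z ∷ zs) (z∉ ∷ d) with w ≡ᵇ z in e
... | true with ≡ᵇ⇒≡ w z e
...   | refl rewrite ≡ᵇ-refl w | ⨁-≡ᵇ w zs d | z∉ = refl
⨁-≡ᵇ w (z ∷ zs) (z∉ ∷ d) | false rewrite ≡ᵇ-sym z w | e = ⨁-≡ᵇ w zs d

remove : ℕ → List ℕ → List ℕ
remove y = filterᵇ (λ z → not (z ≡ᵇ y))

length-remove : ∀ y xs → length (remove y xs) ≤ length xs
length-remove y = length-filter (T? ∘ λ z → not (z ≡ᵇ y))

remove-comm : ∀ a b xs → remove a (remove b xs) ≡ remove b (remove a xs)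
remove-comm a b = filterᵇ-comm _ _

remove-∉ᵇ : ∀ y xs → (y ∈ᵇ xs) ≡ false → remove y xs ≡ xs
remove-∉ᵇ y [] _ = refl
remove-∉ᵇ y (z ∷ xs) y∉ with z ≡ᵇ y in e
... | false = cong (z ∷_) (remove-∉ᵇ y xs y∉)
... | true with () ← y∉

remove-head : ∀ x xs → remove x (x ∷ xs) ≡ remove x xs
remove-head x xs rewrite ≡ᵇ-refl x = refl

remove-∷ : ∀ x z xs → (z ≡ᵇ x) ≡ false → remove x (z ∷ xs) ≡ z ∷ remove x xs
remove-∷ x z xs e rewrite e = refl

∈ᵇ-remove : ∀ x y xs → (x ∈ᵇ remove y xs) ≡ not (x ≡ᵇ y) ∧ (x ∈ᵇ xs)
∈ᵇ-remove x y xs = ∈ᵇ-filterᵇ _ x xs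

count : (ℕ → Bool) → List ℕ → ℕ
count p xs = length (filterᵇ p xs)

count-accept : ∀ p {x} xs → p x ≡ true → count p (x ∷ xs) ≡ suc (count p xs)
count-accept p xs px rewrite px = refl

count-reject : ∀ p {x} xs → p x ≡ false → count p (x ∷ xs) ≡ count p xs
count-reject p xs px rewrite px = refl

count-remove-∉ : ∀ p y xs → p y ≡ false → count p (remove y xs) ≡ count p xs
count-remove-∉ p y xs py =
  cong length (trans (filterᵇ-comm p _ xs) (remove-∉ᵇ y (filterᵇ p xs) (∉ᵇ-filterᵇ-rejected p xs py)))

suc-length-remove : ∀ y xs → Distinct xs → (y ∈ᵇ xs) ≡ true → suc (length (remove y xs)) ≡ length xs
suc-length-remove y (z ∷ xs) (z∉ ∷ d) y∈ with z ≡ᵇ y in e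
... | true rewrite ≡ᵇ⇒≡ z y e = cong suc (cong length (remove-∉ᵇ y xs z∉))
... | false = cong suc (suc-length-remove y xs d y∈)

count-remove-∈ : ∀ p y xs → Distinct xs → (y ∈ᵇ xs) ≡ true → p y ≡ true → suc (count p (remove y xs)) ≡ count p xs
count-remove-∈ p y xs d y∈ py = trans (cong (λ M → suc (length M)) (filterᵇ-comm p _ xs))
  (suc-length-remove y (filterᵇ p xs) (Distinct-filterᵇ p d) (∈ᵇ-filterᵇ⁺ p xs py y∈))

tabulate-∘toℕ : ∀ {C : Set} n (h : ℕ → C) → tabulate {n = n} (h ∘ toℕ) ≡ applyUpTo h n
tabulate-∘toℕ zero h = refl
tabulate-∘toℕ (suc n) h = cong (h 0 ∷_) (tabulate-∘toℕ n (h ∘ suc))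

map-toℕ-allFin : ∀ n → map toℕ (allFin n) ≡ upTo n
map-toℕ-allFin n = trans (map-tabulate id toℕ) (tabulate-∘toℕ n id)

∈ᵇ-map-suc : ∀ x xs → (suc x ∈ᵇ map suc xs) ≡ (x ∈ᵇ xs)
∈ᵇ-map-suc x [] = refl
∈ᵇ-map-suc x (z ∷ xs) = cong ((z ≡ᵇ x) ∨_) (∈ᵇ-map-suc x xs)

0∉ᵇmap-suc : ∀ xs → (0 ∈ᵇ map suc xs) ≡ false
0∉ᵇmap-suc [] = refl
0∉ᵇmap-suc (z ∷ xs) = 0∉ᵇmap-suc xs

Distinct-map-suc : ∀ {xs} → Distinct xs → Distinct (map suc xs)
Distinct-map-suc [] = []
Distinct-map-suc {x ∷ xs} (x∉ ∷ d) = trans (∈ᵇ-map-suc x xs) x∉ ∷ Distinct-map-suc d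

Distinct-upTo : ∀ n → Distinct (upTo n)
Distinct-upTo zero = []
Distinct-upTo (suc n) rewrite sym (map-upTo suc n) = 0∉ᵇmap-suc (upTo n) ∷ Distinct-map-suc (Distinct-upTo n)

-- Matchings counted modulo 2

Series : Set
Series = ℕ → Bool

𝟙 : Series
𝟙 f = f ≡ᵇ 0

z·_ : Series → Series
(z· h) zero = false
(z· h) (suc f) = h f

infixl 7 _⊛_

_⊛_ : Series → Series → Series
(F ⊛ G) zero = F 0 ∧ G 0
(F ⊛ G) (suc f) = (F 0 ∧ G (suc f)) xor ((F ∘ suc) ⊛ G) f

z·-cong : ∀ {h h′} → (∀ g → h g ≡ h′ g) → ∀ f → (z· h) f ≡ (z· h′) f
z·-cong e zero = refl
z·-cong e (suc f) = e f

z·-xor : ∀ a b f → (z· (λ g → a g xor b g)) f ≡ (z· a) f xor (z· b) f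
z·-xor a b zero = refl
z·-xor a b (suc f) = refl

z·-∧ : ∀ b a f → (z· (λ g → b ∧ a g)) f ≡ b ∧ (z· a) f
z·-∧ b a zero = sym (∧-zeroʳ b)
z·-∧ b a (suc f) = refl

z·-⨁ : ∀ {A : Set} (xs : List A) (h : A → Series) f → (z· (λ g → ⨁ xs (λ u → h u g))) f ≡ ⨁ xs (λ u → (z· h u) f)
z·-⨁ xs h zero = sym (⨁-false xs)
z·-⨁ xs h (suc f) = refl

⊛-cong : ∀ {F F′ G G′} → (∀ k → F k ≡ F′ k) → (∀ k → G k ≡ G′ k) → ∀ f → (F ⊛ G) f ≡ (F′ ⊛ G′) f
⊛-cong eF eG zero = cong₂ _∧_ (eF 0) (eG 0)
⊛-cong eF eG (suc f) = cong₂ _xor_ (cong₂ _∧_ (eF 0) (eG (suc f))) (⊛-cong (eF ∘ suc) eG f)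

⊛-zeroˡ : ∀ G f → ((λ _ → false) ⊛ G) f ≡ false
⊛-zeroˡ G zero = refl
⊛-zeroˡ G (suc f) = ⊛-zeroˡ G f

⊛-zeroʳ : ∀ F f → (F ⊛ (λ _ → false)) f ≡ false
⊛-zeroʳ F zero = ∧-zeroʳ (F 0)
⊛-zeroʳ F (suc f) rewrite ∧-zeroʳ (F 0) = ⊛-zeroʳ (F ∘ suc) f

⊛-distribʳ-xor : ∀ F F′ G f → ((λ k → F k xor F′ k) ⊛ G) f ≡ (F ⊛ G) f xor (F′ ⊛ G) f
⊛-distribʳ-xor F F′ G zero = ∧-distribʳ-xor (G 0) (F 0) (F′ 0)
⊛-distribʳ-xor F F′ G (suc f)
  rewrite ⊛-distribʳ-xor (F ∘ suc) (F′ ∘ suc) G f | ∧-distribʳ-xor (G (suc f)) (F 0) (F′ 0) =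
  xor-interchange (F 0 ∧ G (suc f)) (F′ 0 ∧ G (suc f)) _ _

⊛-distribˡ-xor : ∀ F G G′ f → (F ⊛ (λ k → G k xor G′ k)) f ≡ (F ⊛ G) f xor (F ⊛ G′) f
⊛-distribˡ-xor F G G′ zero = ∧-distribˡ-xor (F 0) (G 0) (G′ 0)
⊛-distribˡ-xor F G G′ (suc f)
  rewrite ⊛-distribˡ-xor (F ∘ suc) G G′ f | ∧-distribˡ-xor (F 0) (G (suc f)) (G′ (suc f)) =
  xor-interchange (F 0 ∧ G (suc f)) (F 0 ∧ G′ (suc f)) _ _

∧-⊛ˡ : ∀ b F G f → ((λ k → b ∧ F k) ⊛ G) f ≡ b ∧ (F ⊛ G) f
∧-⊛ˡ b F G zero = ∧-assoc b (F 0) (G 0)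
∧-⊛ˡ b F G (suc f) rewrite ∧-⊛ˡ b (F ∘ suc) G f | ∧-assoc b (F 0) (G (suc f)) =
  sym (∧-distribˡ-xor b _ _)

∧-⊛ʳ : ∀ b F G f → (F ⊛ (λ k → b ∧ G k)) f ≡ b ∧ (F ⊛ G) f
∧-⊛ʳ b F G zero = ∧-leftComm (F 0) b (G 0)
∧-⊛ʳ b F G (suc f) rewrite ∧-⊛ʳ b (F ∘ suc) G f | ∧-leftComm (F 0) b (G (suc f)) =
  sym (∧-distribˡ-xor b _ _)

⨁-⊛ˡ : ∀ {A : Set} (xs : List A) (h : A → Series) G f → ((λ k → ⨁ xs (λ u → h u k)) ⊛ G) f ≡ ⨁ xs (λ u → (h u ⊛ G) f)
⨁-⊛ˡ [] h G f = ⊛-zeroˡ G f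
⨁-⊛ˡ (u ∷ xs) h G f = trans (⊛-distribʳ-xor (h u) _ G f) (cong ((h u ⊛ G) f xor_) (⨁-⊛ˡ xs h G f))

⨁-⊛ʳ : ∀ {A : Set} (xs : List A) F (h : A → Series) f → (F ⊛ (λ k → ⨁ xs (λ u → h u k))) f ≡ ⨁ xs (λ u → (F ⊛ h u) f)
⨁-⊛ʳ [] F h f = ⊛-zeroʳ F f
⨁-⊛ʳ (u ∷ xs) F h f = trans (⊛-distribˡ-xor F (h u) _ f) (cong ((F ⊛ h u) f xor_) (⨁-⊛ʳ xs F h f))

z·-⊛ˡ : ∀ F G f → ((z· F) ⊛ G) f ≡ (z· (F ⊛ G)) f
z·-⊛ˡ F G zero = refl
z·-⊛ˡ F G (suc f) = refl

z·-⊛ʳ : ∀ F G f → (F ⊛ (z· G)) f ≡ (z· (F ⊛ G)) f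
z·-⊛ʳ F G zero = ∧-zeroʳ (F 0)
z·-⊛ʳ F G (suc zero) rewrite ∧-zeroʳ (F 1) = xor-identityʳ _
z·-⊛ʳ F G (suc (suc f)) = cong ((F 0 ∧ G (suc f)) xor_) (z·-⊛ʳ (F ∘ suc) G (suc f))

𝟙⊛𝟙 : ∀ f → (𝟙 ⊛ 𝟙) f ≡ 𝟙 f
𝟙⊛𝟙 zero = refl
𝟙⊛𝟙 (suc f) = ⊛-zeroˡ 𝟙 f

Graph : Set
Graph = ℕ → ℕ → Bool

matchingsᶠ : ℕ → Graph → List ℕ → Series
matchingsᶠ n E [] = 𝟙
matchingsᶠ zero E (x ∷ xs) f = false
matchingsᶠ (suc n) E (x ∷ xs) f =
  (z· matchingsᶠ n E xs) f xor ⨁ xs (λ y → E x y ∧ matchingsᶠ n E (remove y xs) f)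

matchingsᶠ-fuel : ∀ n n′ E xs f → length xs ≤ n → length xs ≤ n′ → matchingsᶠ n E xs f ≡ matchingsᶠ n′ E xs f
matchingsᶠ-fuel n n′ E [] f _ _ = refl
matchingsᶠ-fuel (suc n) (suc n′) E (x ∷ xs) f (s≤s a) (s≤s b) =
  cong₂ _xor_ (z·-cong (λ g → matchingsᶠ-fuel n n′ E xs g a b) f)
    (⨁-cong xs (λ y → cong (E x y ∧_)
      (matchingsᶠ-fuel n n′ E (remove y xs) f (≤-trans (length-remove y xs) a) (≤-trans (length-remove y xs) b))))

opaque
  matchings : Graph → List ℕ → Series
  matchings E xs = matchingsᶠ (length xs) E xs

  matchings-[] : ∀ E f → matchings E [] f ≡ 𝟙 f
  matchings-[] E f = refl

  matchings-∷ : ∀ E x xs f →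
    matchings E (x ∷ xs) f ≡ (z· matchings E xs) f xor ⨁ xs (λ y → E x y ∧ matchings E (remove y xs) f)
  matchings-∷ E x xs f = cong ((z· matchings E xs) f xor_)
    (⨁-cong xs (λ y → cong (E x y ∧_)
      (matchingsᶠ-fuel (length xs) (length (remove y xs)) E (remove y xs) f (length-remove y xs) ≤-refl)))

matchings-cong : ∀ {E E′} → (∀ x y → E x y ≡ E′ x y) → ∀ xs f → matchings E xs f ≡ matchings E′ xs f
matchings-cong {E} {E′} e xs f = go (length xs) xs f ≤-refl
  where
  go : ∀ n xs f → length xs ≤ n → matchings E xs f ≡ matchings E′ xs f
  go n [] f _ = trans (matchings-[] E f) (sym (matchings-[] E′ f))
  go (suc n) (x ∷ xs) f (s≤s le) rewrite matchings-∷ E x xs f | matchings-∷ E′ x xs f =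
    cong₂ _xor_ (z·-cong (λ g → go n xs g le) f)
      (⨁-cong xs (λ y → cong₂ _∧_ (e x y) (go n (remove y xs) f (≤-trans (length-remove y xs) le))))

module _ (D : ℕ → Bool) (ψ : ℕ → ℕ) (ψ-inj : ∀ a b → D a ≡ true → D b ≡ true → ψ a ≡ ψ b → a ≡ b) where

  ≡ᵇ-relabel : ∀ z y → D z ≡ true → D y ≡ true → (ψ z ≡ᵇ ψ y) ≡ (z ≡ᵇ y)
  ≡ᵇ-relabel z y dz dy with z ≡ᵇ y in e
  ... | true rewrite ≡ᵇ⇒≡ z y e = ≡ᵇ-refl (ψ y)
  ... | false with ψ z ≡ᵇ ψ y in e′
  ...   | false = refl
  ...   | true with ψ-inj z y dz dy (≡ᵇ⇒≡ _ _ e′)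
  ...     | refl with () ← trans (sym e) (≡ᵇ-refl z)

  remove-map : ∀ y xs → D y ≡ true → Allᵇ D xs → remove (ψ y) (map ψ xs) ≡ map ψ (remove y xs)
  remove-map y [] dy all = refl
  remove-map y (z ∷ xs) dy all
    with ψ z ≡ᵇ ψ y | z ≡ᵇ y | ≡ᵇ-relabel z y (Allᵇ-head D z xs all) dy
  ... | true | .true | refl = remove-map y xs dy (Allᵇ-tail D z xs all)
  ... | false | .false | refl = cong (ψ z ∷_) (remove-map y xs dy (Allᵇ-tail D z xs all))

  matchings-relabel : ∀ E E′ → (∀ x y → D x ≡ true → D y ≡ true → E x y ≡ E′ (ψ x) (ψ y)) →
                      ∀ xs f → Allᵇ D xs → matchings E xs f ≡ matchings E′ (map ψ xs) f
  matchings-relabel E E′ hE xs f all = go (length xs) xs f ≤-refl all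
    where
    go : ∀ n xs f → length xs ≤ n → Allᵇ D xs → matchings E xs f ≡ matchings E′ (map ψ xs) f
    go n [] f _ _ = trans (matchings-[] E f) (sym (matchings-[] E′ f))
    go (suc n) (x ∷ xs) f (s≤s le) all
      rewrite matchings-∷ E x xs f | matchings-∷ E′ (ψ x) (map ψ xs) f
            | ⨁-map ψ xs (λ y′ → E′ (ψ x) y′ ∧ matchings E′ (remove y′ (map ψ xs)) f) =
      cong₂ _xor_ (z·-cong (λ g → go n xs g le (Allᵇ-tail D x xs all)) f)
        (⨁-cong-∈ᵇ xs (λ y y∈ → cong₂ _∧_ (hE x y (Allᵇ-head D x xs all) (Allᵇ-tail D x xs all y y∈))
           (trans (go n (remove y xs) f (≤-trans (length-remove y xs) le) (Allᵇ-filterᵇ D _ xs (Allᵇ-tail D x xs all)))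
                  (cong (λ M → matchings E′ M f) (sym (remove-map y xs (Allᵇ-tail D x xs all y y∈) (Allᵇ-tail D x xs all)))))))

-- Without edges between the two sides, a matching is a pair of matchings, one on each side.
matchings-split : ∀ E (p : ℕ → Bool) → (∀ x y → p x ≡ not (p y) → E x y ≡ false) →
                  ∀ xs f → matchings E xs f ≡ (matchings E (filterᵇ p xs) ⊛ matchings E (filterᵇ (not ∘ p) xs)) f
matchings-split E p across xs f = go (length xs) xs f ≤-refl
  where
  open ≡-Reasoning
  M : List ℕ → Series
  M = matchings E
  go : ∀ n xs f → length xs ≤ n → M xs f ≡ (M (filterᵇ p xs) ⊛ M (filterᵇ (not ∘ p) xs)) f
  go n [] f _ = trans (matchings-[] E f) (trans (sym (𝟙⊛𝟙 f))
    (⊛-cong (λ k → sym (matchings-[] E k)) (λ k → sym (matchings-[] E k)) f))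
  go (suc n) (x ∷ xs) f (s≤s le) with p x in px
  ... | true = begin
      M (x ∷ xs) f
        ≡⟨ matchings-∷ E x xs f ⟩
      (z· M xs) f xor ⨁ xs (λ y → E x y ∧ M (remove y xs) f)
        ≡⟨ cong₂ _xor_ (z·-cong (λ g → go n xs g le) f) (⨁-cong xs term) ⟩
      (z· (M A ⊛ M B)) f xor ⨁ xs (λ y → p y ∧ ((λ k → E x y ∧ M (remove y A) k) ⊛ M B) f)
        ≡⟨ cong₂ _xor_ (sym (z·-⊛ˡ (M A) (M B) f))
             (trans (sym (⨁-filterᵇ p xs _)) (sym (⨁-⊛ˡ A (λ y k → E x y ∧ M (remove y A) k) (M B) f))) ⟩
      (z· M A ⊛ M B) f xor ((λ k → ⨁ A (λ y → E x y ∧ M (remove y A) k)) ⊛ M B) f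
        ≡⟨ sym (⊛-distribʳ-xor _ _ (M B) f) ⟩
      ((λ k → (z· M A) k xor ⨁ A (λ y → E x y ∧ M (remove y A) k)) ⊛ M B) f
        ≡⟨ ⊛-cong (λ k → sym (matchings-∷ E x A k)) (λ k → refl) f ⟩
      (M (x ∷ A) ⊛ M B) f ∎
    where
    A = filterᵇ p xs
    B = filterᵇ (not ∘ p) xs
    term : ∀ y → (E x y ∧ M (remove y xs) f) ≡ (p y ∧ ((λ k → E x y ∧ M (remove y A) k) ⊛ M B) f)
    term y with p y in py
    ... | false rewrite across x y (trans px (cong not (sym py))) = refl
    ... | true rewrite ∧-⊛ˡ (E x y) (M (remove y A)) (M B) f =
      cong (E x y ∧_) (trans (go n (remove y xs) f (≤-trans (length-remove y xs) le))
        (cong₂ (λ P Q → (M P ⊛ M Q) f) (filterᵇ-comm p _ xs)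
           (trans (filterᵇ-comm (not ∘ p) _ xs)
              (remove-∉ᵇ y B (∉ᵇ-filterᵇ-rejected (not ∘ p) xs (cong not py))))))
  ... | false = begin
      M (x ∷ xs) f
        ≡⟨ matchings-∷ E x xs f ⟩
      (z· M xs) f xor ⨁ xs (λ y → E x y ∧ M (remove y xs) f)
        ≡⟨ cong₂ _xor_ (z·-cong (λ g → go n xs g le) f) (⨁-cong xs term) ⟩
      (z· (M A ⊛ M B)) f xor ⨁ xs (λ y → not (p y) ∧ (M A ⊛ (λ k → E x y ∧ M (remove y B) k)) f)
        ≡⟨ cong₂ _xor_ (sym (z·-⊛ʳ (M A) (M B) f))
             (trans (sym (⨁-filterᵇ (not ∘ p) xs _)) (sym (⨁-⊛ʳ B (M A) (λ y k → E x y ∧ M (remove y B) k) f))) ⟩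
      (M A ⊛ z· M B) f xor (M A ⊛ (λ k → ⨁ B (λ y → E x y ∧ M (remove y B) k))) f
        ≡⟨ sym (⊛-distribˡ-xor (M A) _ _ f) ⟩
      (M A ⊛ (λ k → (z· M B) k xor ⨁ B (λ y → E x y ∧ M (remove y B) k))) f
        ≡⟨ ⊛-cong (λ k → refl) (λ k → sym (matchings-∷ E x B k)) f ⟩
      (M A ⊛ M (x ∷ B)) f ∎
    where
    A = filterᵇ p xs
    B = filterᵇ (not ∘ p) xs
    term : ∀ y → (E x y ∧ M (remove y xs) f) ≡ (not (p y) ∧ (M A ⊛ (λ k → E x y ∧ M (remove y B) k)) f)
    term y with p y in py
    ... | true rewrite across x y (trans px (cong not (sym py))) = refl
    ... | false rewrite ∧-⊛ʳ (E x y) (M A) (M (remove y B)) f =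
      cong (E x y ∧_) (trans (go n (remove y xs) f (≤-trans (length-remove y xs) le))
        (cong₂ (λ P Q → (M P ⊛ M Q) f)
           (trans (filterᵇ-comm p _ xs) (remove-∉ᵇ y A (∉ᵇ-filterᵇ-rejected p xs py)))
           (filterᵇ-comm (not ∘ p) _ xs)))

-- Adding a complete bipartite graph

⨁²-symmetric : ∀ xs (G : ℕ → ℕ → Bool) → (∀ y w → G y w ≡ G w y) → (∀ y → G y y ≡ false) →
               ⨁ xs (λ y → ⨁ xs (G y)) ≡ false
⨁²-symmetric [] G sym-G diag = refl
⨁²-symmetric (x ∷ xs) G sym-G diag
  rewrite diag x | ⨁-xor xs (λ y → G y x) (λ y → ⨁ xs (G y)) | ⨁²-symmetric xs G sym-G diag
        | ⨁-cong xs (λ y → sym-G y x) = trans (cong (⨁ xs (G x) xor_) (xor-identityʳ (⨁ xs (G x)))) (xor-same (⨁ xs (G x)))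

⨁-remove : ∀ y xs g → ⨁ (remove y xs) g ≡ ⨁ xs (λ u → not (u ≡ᵇ y) ∧ g u)
⨁-remove y xs g = ⨁-filterᵇ _ xs g

⨁-∧-remove-comm : ∀ xs (a b : ℕ → Bool) (h : ℕ → ℕ → Bool) →
  ⨁ xs (λ u → a u ∧ ⨁ (remove u xs) (λ y → b y ∧ h u y)) ≡ ⨁ xs (λ y → b y ∧ ⨁ (remove y xs) (λ u → a u ∧ h u y))
⨁-∧-remove-comm xs a b h =
  trans (⨁-cong xs (λ u → trans (cong (a u ∧_) (⨁-remove u xs _)) (∧-distribˡ-⨁ (a u) xs _)))
  (trans (⨁-comm xs xs _)
  (sym (⨁-cong xs (λ y → trans (cong (b y ∧_) (⨁-remove y xs _)) (trans (∧-distribˡ-⨁ (b y) xs _)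
     (⨁-cong xs (λ u → trans (cong (λ z → b y ∧ (not z ∧ (a u ∧ h u y))) (≡ᵇ-sym u y))
       (solve 4 (λ a n b h → a :* (n :* (b :* h)) := b :* (n :* (a :* h))) refl (b y) (not (y ≡ᵇ u)) (a u) (h u y)))))))))
  where open xor-∧-Solver

remove-comm₃ : ∀ a b c xs → remove a (remove b (remove c xs)) ≡ remove c (remove b (remove a xs))
remove-comm₃ a b c xs =
  trans (remove-comm a b (remove c xs)) (trans (cong (remove b) (remove-comm a c xs)) (remove-comm b c (remove a xs)))

biclique : (ℕ → Bool) → (ℕ → Bool) → Graph
biclique P Q u w = (P u ∧ Q w) xor (Q u ∧ P w)

matchings∖₁ : Graph → (ℕ → Bool) → List ℕ → Series
matchings∖₁ E P xs f = ⨁ xs (λ u → P u ∧ matchings E (remove u xs) f)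

matchings∖₂ : Graph → (ℕ → Bool) → (ℕ → Bool) → List ℕ → Series
matchings∖₂ E P Q xs f = ⨁ xs (λ u → P u ∧ ⨁ xs (λ w → Q w ∧ matchings E (remove w (remove u xs)) f))

module _ (E : Graph) (P Q : ℕ → Bool) (disjoint : ∀ u → P u ∧ Q u ≡ false) where

  private
    M : List ℕ → Series
    M = matchings E

    R : List ℕ → Series
    R = matchings∖₂ E P Q

    ∧-distribˡ-⨁₃ : ∀ a b c (xs : List ℕ) (g : ℕ → Bool) → a ∧ (b ∧ (c ∧ ⨁ xs g)) ≡ ⨁ xs (λ w → a ∧ (b ∧ (c ∧ g w)))
    ∧-distribˡ-⨁₃ a b c xs g =
      trans (cong (λ z → a ∧ (b ∧ z)) (∧-distribˡ-⨁ c xs g))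
        (trans (cong (a ∧_) (∧-distribˡ-⨁ b xs _)) (∧-distribˡ-⨁ a xs _))

  P-Q-≢ : ∀ u y → P u ≡ true → Q y ≡ true → (u ≡ᵇ y) ≡ false
  P-Q-≢ u y pu qy with u ≡ᵇ y in e
  ... | false = refl
  ... | true rewrite ≡ᵇ⇒≡ u y e = trans (sym (cong₂ _∧_ pu qy)) (disjoint y)

  matchings∖₂-remove : ∀ xs y f → R (remove y xs) f ≡
    ⨁ xs (λ u → not (u ≡ᵇ y) ∧ (P u ∧ ⨁ xs (λ w → not (w ≡ᵇ y) ∧ (Q w ∧ M (remove w (remove u (remove y xs))) f))))
  matchings∖₂-remove xs y f =
    trans (⨁-remove y xs _) (⨁-cong xs (λ u → cong (λ z → not (u ≡ᵇ y) ∧ (P u ∧ z)) (⨁-remove y xs _)))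

  -- Matchings using two biclique edges cancel in pairs, by exchanging their Q-ends.
  ⨁-Q-matchings∖₂ : ∀ xs f → ⨁ xs (λ y → Q y ∧ R (remove y xs) f) ≡ false
  ⨁-Q-matchings∖₂ xs f = begin
      ⨁ xs (λ y → Q y ∧ R (remove y xs) f)
        ≡⟨ ⨁-cong xs (λ y → trans (cong (Q y ∧_) (matchings∖₂-remove xs y f)) (trans (∧-distribˡ-⨁ (Q y) xs _)
             (⨁-cong xs (λ u → ∧-distribˡ-⨁₃ (Q y) (not (u ≡ᵇ y)) (P u) xs _)))) ⟩
      ⨁ xs (λ y → ⨁ xs (λ u → ⨁ xs (λ w → H y u w)))
        ≡⟨ ⨁-comm xs xs (λ y u → ⨁ xs (λ w → H y u w)) ⟩
      ⨁ xs (λ u → ⨁ xs (λ y → ⨁ xs (λ w → H y u w)))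
        ≡⟨ ⨁-cong xs (λ u → trans (⨁-cong xs (λ y → ⨁-cong xs (λ w → H≡H′ y u w)))
              (⨁²-symmetric xs (λ y w → H′ y u w) (λ y w → H′-sym y u w) (λ y → H′-diag y u))) ⟩
      ⨁ xs (λ _ → false)
        ≡⟨ ⨁-false xs ⟩
      false ∎
    where
    open ≡-Reasoning
    H H′ : ℕ → ℕ → ℕ → Bool
    H y u w = Q y ∧ (not (u ≡ᵇ y) ∧ (P u ∧ (not (w ≡ᵇ y) ∧ (Q w ∧ M (remove w (remove u (remove y xs))) f))))
    H′ y u w = Q y ∧ (P u ∧ (not (w ≡ᵇ y) ∧ (Q w ∧ M (remove w (remove u (remove y xs))) f)))
    H≡H′ : ∀ y u w → H y u w ≡ H′ y u w
    H≡H′ y u w with Q y in qy | P u in pu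
    ... | true | true rewrite P-Q-≢ u y pu qy = refl
    ... | true | false = ∧-zeroʳ _
    ... | false | _ = refl
    H′-sym : ∀ y u w → H′ y u w ≡ H′ w u y
    H′-sym y u w rewrite ≡ᵇ-sym w y | remove-comm₃ w u y xs =
      solve 5 (λ qy pu b qw c → qy :* (pu :* (b :* (qw :* c))) := qw :* (pu :* (b :* (qy :* c)))) refl
        (Q y) (P u) (not (y ≡ᵇ w)) (Q w) _
      where open xor-∧-Solver
    H′-diag : ∀ y u → H′ y u y ≡ false
    H′-diag y u rewrite ≡ᵇ-refl y | ∧-zeroʳ (P u) = ∧-zeroʳ (Q y)

  ⨁-P-matchings∖₂ : ∀ xs f → ⨁ xs (λ y → P y ∧ R (remove y xs) f) ≡ false
  ⨁-P-matchings∖₂ xs f = begin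
      ⨁ xs (λ y → P y ∧ R (remove y xs) f)
        ≡⟨ ⨁-cong xs (λ y → trans (cong (P y ∧_) (matchings∖₂-remove xs y f)) (∧-distribˡ-⨁ (P y) xs _)) ⟩
      ⨁ xs (λ y → ⨁ xs (λ u → G y u))
        ≡⟨ ⨁-cong xs (λ y → ⨁-cong xs (λ u → G≡G′ y u)) ⟩
      ⨁ xs (λ y → ⨁ xs (λ u → G′ y u))
        ≡⟨ ⨁²-symmetric xs G′ G′-sym G′-diag ⟩
      false ∎
    where
    open ≡-Reasoning
    W : ℕ → ℕ → Bool
    W y u = ⨁ xs (λ w → Q w ∧ M (remove w (remove u (remove y xs))) f)
    G G′ : ℕ → ℕ → Bool
    G y u = P y ∧ (not (u ≡ᵇ y) ∧ (P u ∧ ⨁ xs (λ w → not (w ≡ᵇ y) ∧ (Q w ∧ M (remove w (remove u (remove y xs))) f))))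
    G′ y u = P y ∧ (not (u ≡ᵇ y) ∧ (P u ∧ W y u))
    G≡G′ : ∀ y u → G y u ≡ G′ y u
    G≡G′ y u = ∧-guard (P y) (λ py → cong (λ z → not (u ≡ᵇ y) ∧ (P u ∧ z)) (⨁-cong xs (λ w → Q-≢ w py)))
      where
      Q-≢ : ∀ w → P y ≡ true → not (w ≡ᵇ y) ∧ (Q w ∧ M (remove w (remove u (remove y xs))) f) ≡
                                Q w ∧ M (remove w (remove u (remove y xs))) f
      Q-≢ w py with Q w in qw
      ... | false = ∧-zeroʳ _
      ... | true rewrite ≡ᵇ-sym w y | P-Q-≢ y w py qw = refl
    G′-sym : ∀ y u → G′ y u ≡ G′ u y
    G′-sym y u rewrite remove-comm u y xs | ≡ᵇ-sym u y =
      solve 4 (λ py b pu w → py :* (b :* (pu :* w)) := pu :* (b :* (py :* w))) refl (P y) (not (y ≡ᵇ u)) (P u) (W u y)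
      where open xor-∧-Solver
    G′-diag : ∀ y → G′ y y ≡ false
    G′-diag y rewrite ≡ᵇ-refl y = ∧-zeroʳ (P y)

  private
    S : ℕ → List ℕ → Series
    S x xs f = ⨁ xs (λ y → E x y ∧ R (remove y xs) f)

  ⨁²-matchings-∷ : ∀ x xs f →
    ⨁ xs (λ u → P u ∧ ⨁ xs (λ w → Q w ∧ ⨁ (remove w (remove u xs)) (λ y → E x y ∧ M (remove y (remove w (remove u xs))) f)))
    ≡ S x xs f
  ⨁²-matchings-∷ x xs f = begin
      ⨁ xs (λ u → P u ∧ ⨁ xs (λ w → Q w ∧ ⨁ (remove w (remove u xs)) (λ y → E x y ∧ M (remove y (remove w (remove u xs))) f)))
        ≡⟨ ⨁-cong xs (λ u → trans (cong (P u ∧_) (⨁-cong xs (λ w → cong (Q w ∧_)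
               (trans (⨁-remove w (remove u xs) _) (⨁-remove u xs _)))))
             (trans (∧-distribˡ-⨁ (P u) xs _) (⨁-cong xs (λ w →
               trans (cong (P u ∧_) (∧-distribˡ-⨁ (Q w) xs _)) (∧-distribˡ-⨁ (P u) xs _))))) ⟩
      ⨁ xs (λ u → ⨁ xs (λ w → ⨁ xs (λ y → F u w y)))
        ≡⟨ ⨁-cong xs (λ u → ⨁-comm xs xs (λ w y → F u w y)) ⟩
      ⨁ xs (λ u → ⨁ xs (λ y → ⨁ xs (λ w → F u w y)))
        ≡⟨ ⨁-comm xs xs (λ u y → ⨁ xs (λ w → F u w y)) ⟩
      ⨁ xs (λ y → ⨁ xs (λ u → ⨁ xs (λ w → F u w y)))
        ≡⟨ ⨁-cong xs (λ y → ⨁-cong xs (λ u → ⨁-cong xs (λ w → F≡F′ u w y))) ⟩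
      ⨁ xs (λ y → ⨁ xs (λ u → ⨁ xs (λ w → F′ y u w)))
        ≡⟨ sym (⨁-cong xs (λ y → trans (cong (E x y ∧_) (matchings∖₂-remove xs y f)) (trans (∧-distribˡ-⨁ (E x y) xs _)
             (⨁-cong xs (λ u → ∧-distribˡ-⨁₃ (E x y) (not (u ≡ᵇ y)) (P u) xs _))))) ⟩
      S x xs f ∎
    where
    open ≡-Reasoning
    F F′ : ℕ → ℕ → ℕ → Bool
    F u w y = P u ∧ (Q w ∧ (not (y ≡ᵇ u) ∧ (not (y ≡ᵇ w) ∧ (E x y ∧ M (remove y (remove w (remove u xs))) f))))
    F′ y u w = E x y ∧ (not (u ≡ᵇ y) ∧ (P u ∧ (not (w ≡ᵇ y) ∧ (Q w ∧ M (remove w (remove u (remove y xs))) f))))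
    F≡F′ : ∀ u w y → F u w y ≡ F′ y u w
    F≡F′ u w y rewrite remove-comm₃ y w u xs | remove-comm u w (remove y xs) | ≡ᵇ-sym y u | ≡ᵇ-sym y w =
      solve 6 (λ pu qw nu nw e c → pu :* (qw :* (nu :* (nw :* (e :* c)))) := e :* (nu :* (pu :* (nw :* (qw :* c))))) refl
        (P u) (Q w) (not (u ≡ᵇ y)) (not (w ≡ᵇ y)) (E x y) _
      where open xor-∧-Solver

  matchings∖₂-∷ : ∀ x xs f → (x ∈ᵇ xs) ≡ false →
    R (x ∷ xs) f ≡ (P x ∧ matchings∖₁ E Q xs f) xor ((Q x ∧ matchings∖₁ E P xs f) xor ((z· R xs) f xor S x xs f))
  matchings∖₂-∷ x xs f x∉ =
    cong₂ _xor_ first (trans rest (cong (λ z → (Q x ∧ matchings∖₁ E P xs f) xor ((z· R xs) f xor z)) (⨁²-matchings-∷ x xs f)))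
    where
    open ≡-Reasoning
    remove-x : remove x (x ∷ xs) ≡ xs
    remove-x = trans (remove-head x xs) (remove-∉ᵇ x xs x∉)
    first : P x ∧ ⨁ (x ∷ xs) (λ w → Q w ∧ M (remove w (remove x (x ∷ xs))) f) ≡ P x ∧ matchings∖₁ E Q xs f
    first rewrite remove-x with P x in px
    ... | false = refl
    ... | true rewrite trans (sym (cong (_∧ Q x) px)) (disjoint x) = refl
    term : ∀ u → (u ∈ᵇ xs) ≡ true →
      P u ∧ ⨁ (x ∷ xs) (λ w → Q w ∧ M (remove w (remove u (x ∷ xs))) f) ≡
      (Q x ∧ (P u ∧ M (remove u xs) f)) xor
      ((P u ∧ ⨁ xs (λ w → Q w ∧ (z· M (remove w (remove u xs))) f)) xor
       (P u ∧ ⨁ xs (λ w → Q w ∧ ⨁ (remove w (remove u xs)) (λ y → E x y ∧ M (remove y (remove w (remove u xs))) f))))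
    term u u∈ = begin
      P u ∧ ⨁ (x ∷ xs) (λ w → Q w ∧ M (remove w (remove u (x ∷ xs))) f)
        ≡⟨ cong (λ L → P u ∧ ⨁ (x ∷ xs) (λ w → Q w ∧ M (remove w L) f)) (remove-∷ u x xs (∈ᵇ-∉ᵇ⇒≢ xs x∉ u∈)) ⟩
      P u ∧ ((Q x ∧ M (remove x (x ∷ remove u xs)) f) xor ⨁ xs (λ w → Q w ∧ M (remove w (x ∷ remove u xs)) f))
        ≡⟨ cong (P u ∧_) (cong₂ _xor_
              (cong (λ L → Q x ∧ M L f) (trans (remove-head x (remove u xs)) (remove-∉ᵇ x (remove u xs) (∉ᵇ-filterᵇ _ xs x∉))))
              (⨁-cong-∈ᵇ xs (λ w w∈ → trans (cong (λ L → Q w ∧ M L f) (remove-∷ w x (remove u xs) (∈ᵇ-∉ᵇ⇒≢ xs x∉ w∈)))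
                 (trans (cong (Q w ∧_) (matchings-∷ E x (remove w (remove u xs)) f)) (∧-distribˡ-xor (Q w) _ _))))) ⟩
      P u ∧ ((Q x ∧ M (remove u xs) f) xor ⨁ xs (λ w → (Q w ∧ (z· M (remove w (remove u xs))) f) xor
                 (Q w ∧ ⨁ (remove w (remove u xs)) (λ y → E x y ∧ M (remove y (remove w (remove u xs))) f))))
        ≡⟨ cong (λ z → P u ∧ ((Q x ∧ M (remove u xs) f) xor z)) (⨁-xor xs _ _) ⟩
      P u ∧ ((Q x ∧ M (remove u xs) f) xor (⨁ xs (λ w → Q w ∧ (z· M (remove w (remove u xs))) f)
                 xor ⨁ xs (λ w → Q w ∧ ⨁ (remove w (remove u xs)) (λ y → E x y ∧ M (remove y (remove w (remove u xs))) f))))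
        ≡⟨ solve 5 (λ p q c a b → p :* ((q :* c) :+ (a :+ b)) := (q :* (p :* c)) :+ ((p :* a) :+ (p :* b))) refl
             (P u) (Q x) _ _ _ ⟩
      _ ∎
      where open xor-∧-Solver
    z·R : ⨁ xs (λ u → P u ∧ ⨁ xs (λ w → Q w ∧ (z· M (remove w (remove u xs))) f)) ≡ (z· R xs) f
    z·R = sym (trans (z·-⨁ xs (λ u g → P u ∧ ⨁ xs (λ w → Q w ∧ M (remove w (remove u xs)) g)) f)
            (⨁-cong xs (λ u → trans (z·-∧ (P u) _ f) (cong (P u ∧_)
              (trans (z·-⨁ xs (λ w g → Q w ∧ M (remove w (remove u xs)) g) f) (⨁-cong xs (λ w → z·-∧ (Q w) _ f)))))))
    rest : ⨁ xs (λ u → P u ∧ ⨁ (x ∷ xs) (λ w → Q w ∧ M (remove w (remove u (x ∷ xs))) f)) ≡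
           (Q x ∧ matchings∖₁ E P xs f) xor ((z· R xs) f xor
             ⨁ xs (λ u → P u ∧ ⨁ xs (λ w → Q w ∧ ⨁ (remove w (remove u xs)) (λ y → E x y ∧ M (remove y (remove w (remove u xs))) f))))
    rest = trans (⨁-cong-∈ᵇ xs term)
      (trans (⨁-xor xs _ _) (cong₂ _xor_ (sym (∧-distribˡ-⨁ (Q x) xs _)) (trans (⨁-xor xs _ _) (cong₂ _xor_ z·R refl))))

  matchings-biclique : ∀ xs f → Distinct xs →
    matchings (λ u w → E u w xor biclique P Q u w) xs f ≡ M xs f xor R xs f
  matchings-biclique xs f d = go (length xs) xs f ≤-refl d
    where
    open ≡-Reasoning
    E′ : Graph
    E′ u w = E u w xor biclique P Q u w
    go : ∀ n xs f → length xs ≤ n → Distinct xs → matchings E′ xs f ≡ M xs f xor R xs f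
    go n [] f _ _ = trans (matchings-[] E′ f) (trans (sym (matchings-[] E f)) (sym (xor-identityʳ _)))
    go (suc n) (x ∷ xs) f (s≤s le) (x∉ ∷ d) = begin
      matchings E′ (x ∷ xs) f
        ≡⟨ matchings-∷ E′ x xs f ⟩
      (z· matchings E′ xs) f xor ⨁ xs (λ y → E′ x y ∧ matchings E′ (remove y xs) f)
        ≡⟨ cong₂ _xor_ (trans (z·-cong (λ g → go n xs g le d) f) (z·-xor (M xs) (R xs) f))
             (⨁-cong xs (λ y → trans (cong (E′ x y ∧_) (go n (remove y xs) f (≤-trans (length-remove y xs) le) (Distinct-filterᵇ _ d)))
                (expand (E x y) (biclique P Q x y) _ _))) ⟩
      ((z· M xs) f xor (z· R xs) f) xor ⨁ xs (λ y → (E x y ∧ M (remove y xs) f) xor ((E x y ∧ R (remove y xs) f) xor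
            ((biclique P Q x y ∧ M (remove y xs) f) xor (biclique P Q x y ∧ R (remove y xs) f))))
        ≡⟨ cong (((z· M xs) f xor (z· R xs) f) xor_)
             (trans (⨁-xor xs _ _) (cong (⨁ xs (λ y → E x y ∧ M (remove y xs) f) xor_)
               (trans (⨁-xor xs _ _) (cong (S x xs f xor_) (trans (⨁-xor xs _ _) (cong₂ _xor_ one-edge two-edges)))))) ⟩
      ((z· M xs) f xor (z· R xs) f) xor (⨁ xs (λ y → E x y ∧ M (remove y xs) f) xor (S x xs f xor
            (((P x ∧ matchings∖₁ E Q xs f) xor (Q x ∧ matchings∖₁ E P xs f)) xor false)))
        ≡⟨ regroup ((z· M xs) f) ((z· R xs) f) (⨁ xs (λ y → E x y ∧ M (remove y xs) f)) (S x xs f)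
             (P x ∧ matchings∖₁ E Q xs f) (Q x ∧ matchings∖₁ E P xs f) ⟩
      ((z· M xs) f xor ⨁ xs (λ y → E x y ∧ M (remove y xs) f)) xor ((P x ∧ matchings∖₁ E Q xs f) xor
            ((Q x ∧ matchings∖₁ E P xs f) xor ((z· R xs) f xor S x xs f)))
        ≡⟨ cong₂ _xor_ (sym (matchings-∷ E x xs f)) (sym (matchings∖₂-∷ x xs f x∉)) ⟩
      M (x ∷ xs) f xor R (x ∷ xs) f ∎
      where
      open xor-∧-Solver
      expand : ∀ e k c r → (e xor k) ∧ (c xor r) ≡ (e ∧ c) xor ((e ∧ r) xor ((k ∧ c) xor (k ∧ r)))
      expand = solve 4 (λ e k c r → (e :+ k) :* (c :+ r) := (e :* c) :+ ((e :* r) :+ ((k :* c) :+ (k :* r)))) refl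
      regroup : ∀ zm zr em s a b → (zm xor zr) xor (em xor (s xor ((a xor b) xor false))) ≡ (zm xor em) xor (a xor (b xor (zr xor s)))
      regroup = solve 6 (λ zm zr em s a b →
        (zm :+ zr) :+ (em :+ (s :+ ((a :+ b) :+ con false))) := (zm :+ em) :+ (a :+ (b :+ (zr :+ s)))) refl
      split-biclique : ∀ (g : ℕ → Bool) → ⨁ xs (λ y → biclique P Q x y ∧ g y) ≡
                       (P x ∧ ⨁ xs (λ y → Q y ∧ g y)) xor (Q x ∧ ⨁ xs (λ y → P y ∧ g y))
      split-biclique g = trans (⨁-cong xs (λ y →
          solve 5 (λ p q p′ q′ c → ((p :* q′) :+ (q :* p′)) :* c := (p :* (q′ :* c)) :+ (q :* (p′ :* c))) refl
            (P x) (Q x) (P y) (Q y) (g y)))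
        (trans (⨁-xor xs _ _) (cong₂ _xor_ (sym (∧-distribˡ-⨁ (P x) xs _)) (sym (∧-distribˡ-⨁ (Q x) xs _))))
      one-edge : ⨁ xs (λ y → biclique P Q x y ∧ M (remove y xs) f) ≡ (P x ∧ matchings∖₁ E Q xs f) xor (Q x ∧ matchings∖₁ E P xs f)
      one-edge = split-biclique (λ y → M (remove y xs) f)
      two-edges : ⨁ xs (λ y → biclique P Q x y ∧ R (remove y xs) f) ≡ false
      two-edges = trans (split-biclique (λ y → R (remove y xs) f))
        (cong₂ _xor_ (trans (cong (P x ∧_) (⨁-Q-matchings∖₂ xs f)) (∧-zeroʳ (P x)))
                     (trans (cong (Q x ∧_) (⨁-P-matchings∖₂ xs f)) (∧-zeroʳ (Q x))))

⨁²-swap : ∀ xs (a b : ℕ → Bool) (h : ℕ → ℕ → Bool) →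
          ⨁ xs (λ u → a u ∧ ⨁ xs (λ w → b w ∧ h u w)) ≡ ⨁ xs (λ w → b w ∧ ⨁ xs (λ u → a u ∧ h u w))
⨁²-swap xs a b h =
  trans (⨁-cong xs (λ u → trans (∧-distribˡ-⨁ (a u) xs _) (⨁-cong xs (λ w → ∧-leftComm (a u) (b w) (h u w)))))
    (trans (⨁-comm xs xs (λ u w → b w ∧ (a u ∧ h u w))) (sym (⨁-cong xs (λ w → ∧-distribˡ-⨁ (b w) xs _))))

matchings∖₂-comm : ∀ E P Q xs f → matchings∖₂ E P Q xs f ≡ matchings∖₂ E Q P xs f
matchings∖₂-comm E P Q xs f =
  trans (⨁²-swap xs P Q (λ u w → matchings E (remove w (remove u xs)) f))
    (⨁-cong xs (λ w → cong (Q w ∧_) (⨁-cong xs (λ u → cong (λ L → P u ∧ matchings E L f) (remove-comm w u xs)))))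

module _ (D : ℕ → Bool) (ψ : ℕ → ℕ) (ψ-inj : ∀ a b → D a ≡ true → D b ≡ true → ψ a ≡ ψ b → a ≡ b)
         (E E′ : Graph) (E≡E′ : ∀ x y → D x ≡ true → D y ≡ true → E x y ≡ E′ (ψ x) (ψ y)) where

  matchings-remove-relabel : ∀ xs u f → Allᵇ D xs → D u ≡ true →
                             matchings E (remove u xs) f ≡ matchings E′ (remove (ψ u) (map ψ xs)) f
  matchings-remove-relabel xs u f all Du =
    trans (matchings-relabel D ψ ψ-inj E E′ E≡E′ (remove u xs) f (Allᵇ-filterᵇ D _ xs all))
      (cong (λ L → matchings E′ L f) (sym (remove-map D ψ ψ-inj u xs Du all)))

  matchings∖₁-relabel : ∀ xs (P P′ : ℕ → Bool) f → Allᵇ D xs → (∀ u → D u ≡ true → P u ≡ P′ (ψ u)) →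
                        matchings∖₁ E P xs f ≡ matchings∖₁ E′ P′ (map ψ xs) f
  matchings∖₁-relabel xs P P′ f all P≡P′ =
    trans (⨁-cong-∈ᵇ xs (λ u u∈ → cong₂ _∧_ (P≡P′ u (all u u∈)) (matchings-remove-relabel xs u f all (all u u∈))))
      (sym (⨁-map ψ xs (λ u′ → P′ u′ ∧ matchings E′ (remove u′ (map ψ xs)) f)))

  matchings∖₂-relabel : ∀ xs (P P′ Q Q′ : ℕ → Bool) f → Allᵇ D xs →
                        (∀ u → D u ≡ true → P u ≡ P′ (ψ u)) → (∀ u → D u ≡ true → Q u ≡ Q′ (ψ u)) →
                        matchings∖₂ E P Q xs f ≡ matchings∖₂ E′ P′ Q′ (map ψ xs) f
  matchings∖₂-relabel xs P P′ Q Q′ f all P≡P′ Q≡Q′ =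
    trans (⨁-cong-∈ᵇ xs (λ u u∈ → cong₂ _∧_ (P≡P′ u (all u u∈))
             (trans (⨁-cong-∈ᵇ xs (λ w w∈ → cong₂ _∧_ (Q≡Q′ w (all w w∈))
                (trans (matchings-remove-relabel (remove u xs) w f (Allᵇ-filterᵇ D _ xs all) (all w w∈))
                  (cong (λ L → matchings E′ (remove (ψ w) L) f) (sym (remove-map D ψ ψ-inj u xs (all u u∈) all))))))
               (sym (⨁-map ψ xs (λ w′ → Q′ w′ ∧ matchings E′ (remove w′ (remove (ψ u) (map ψ xs))) f))))))
      (sym (⨁-map ψ xs (λ u′ → P′ u′ ∧ ⨁ (map ψ xs) (λ w′ → Q′ w′ ∧ matchings E′ (remove w′ (remove u′ (map ψ xs))) f))))

-- Bipartite graphs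

Series² : Set
Series² = ℕ → ℕ → Bool

antidiagonal : Series² → Series
antidiagonal g zero = g 0 0
antidiagonal g (suc f) = g 0 (suc f) xor antidiagonal (λ i j → g (suc i) j) f

z·on : Bool → Series² → Series²
z·on true G i j = (z· (λ i′ → G i′ j)) i
z·on false G i j = (z· G i) j

z·on-cong : ∀ b {G G′} → (∀ i j → G i j ≡ G′ i j) → ∀ i j → z·on b G i j ≡ z·on b G′ i j
z·on-cong true e i j = z·-cong (λ g → e g j) i
z·on-cong false e i j = z·-cong (λ g → e i g) j

-- Matchings counted by the numbers i and j of unmatched vertices satisfying X and violating X.
bimatchingsᶠ : ℕ → Graph → (ℕ → Bool) → List ℕ → Series²
bimatchingsᶠ n E X [] i j = 𝟙 i ∧ 𝟙 j
bimatchingsᶠ zero E X (x ∷ xs) i j = false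
bimatchingsᶠ (suc n) E X (x ∷ xs) i j =
  z·on (X x) (bimatchingsᶠ n E X xs) i j xor ⨁ xs (λ y → E x y ∧ bimatchingsᶠ n E X (remove y xs) i j)

bimatchingsᶠ-fuel : ∀ n n′ E X xs i j → length xs ≤ n → length xs ≤ n′ →
                    bimatchingsᶠ n E X xs i j ≡ bimatchingsᶠ n′ E X xs i j
bimatchingsᶠ-fuel n n′ E X [] i j _ _ = refl
bimatchingsᶠ-fuel (suc n) (suc n′) E X (x ∷ xs) i j (s≤s a) (s≤s b) =
  cong₂ _xor_ (z·on-cong (X x) (λ i j → bimatchingsᶠ-fuel n n′ E X xs i j a b) i j)
    (⨁-cong xs (λ y → cong (E x y ∧_) (bimatchingsᶠ-fuel n n′ E X (remove y xs) i j
      (≤-trans (length-remove y xs) a) (≤-trans (length-remove y xs) b))))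

opaque
  bimatchings : Graph → (ℕ → Bool) → List ℕ → Series²
  bimatchings E X xs = bimatchingsᶠ (length xs) E X xs

  bimatchings-[] : ∀ E X i j → bimatchings E X [] i j ≡ (𝟙 i ∧ 𝟙 j)
  bimatchings-[] E X i j = refl

  bimatchings-∷ : ∀ E X x xs i j → bimatchings E X (x ∷ xs) i j ≡
    z·on (X x) (bimatchings E X xs) i j xor ⨁ xs (λ y → E x y ∧ bimatchings E X (remove y xs) i j)
  bimatchings-∷ E X x xs i j = cong (z·on (X x) (bimatchings E X xs) i j xor_)
    (⨁-cong xs (λ y → cong (E x y ∧_) (bimatchingsᶠ-fuel (length xs) (length (remove y xs)) E X (remove y xs) i j
      (length-remove y xs) ≤-refl)))

antidiagonal-cong : ∀ {g g′} → (∀ i j → g i j ≡ g′ i j) → ∀ f → antidiagonal g f ≡ antidiagonal g′ f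
antidiagonal-cong e zero = e 0 0
antidiagonal-cong e (suc f) = cong₂ _xor_ (e 0 (suc f)) (antidiagonal-cong (λ i j → e (suc i) j) f)

antidiagonal-xor : ∀ g h f → antidiagonal (λ i j → g i j xor h i j) f ≡ antidiagonal g f xor antidiagonal h f
antidiagonal-xor g h zero = refl
antidiagonal-xor g h (suc f) rewrite antidiagonal-xor (λ i j → g (suc i) j) (λ i j → h (suc i) j) f =
  xor-interchange (g 0 (suc f)) (h 0 (suc f)) _ _

antidiagonal-false : ∀ f → antidiagonal (λ _ _ → false) f ≡ false
antidiagonal-false zero = refl
antidiagonal-false (suc f) = antidiagonal-false f

antidiagonal-∧ : ∀ b g f → antidiagonal (λ i j → b ∧ g i j) f ≡ b ∧ antidiagonal g f
antidiagonal-∧ b g zero = refl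
antidiagonal-∧ b g (suc f) rewrite antidiagonal-∧ b (λ i j → g (suc i) j) f = sym (∧-distribˡ-xor b _ _)

antidiagonal-⨁ : ∀ xs (h : ℕ → Series²) f →
                 antidiagonal (λ i j → ⨁ xs (λ y → h y i j)) f ≡ ⨁ xs (λ y → antidiagonal (h y) f)
antidiagonal-⨁ [] h f = antidiagonal-false f
antidiagonal-⨁ (y ∷ xs) h f =
  trans (antidiagonal-xor (h y) _ f) (cong (antidiagonal (h y) f xor_) (antidiagonal-⨁ xs h f))

antidiagonal-z·on : ∀ b G f → antidiagonal (z·on b G) f ≡ (z· antidiagonal G) f
antidiagonal-z·on true G zero = refl
antidiagonal-z·on true G (suc f) = refl
antidiagonal-z·on false G f = go G f
  where
  go : ∀ G f → antidiagonal (λ i j → (z· G i) j) f ≡ (z· antidiagonal G) f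
  go G zero = refl
  go G (suc zero) = xor-identityʳ _
  go G (suc (suc f)) = cong (G 0 (suc f) xor_) (go (λ i j → G (suc i) j) (suc f))

antidiagonal-𝟙 : ∀ f → antidiagonal (λ i j → 𝟙 i ∧ 𝟙 j) f ≡ 𝟙 f
antidiagonal-𝟙 zero = refl
antidiagonal-𝟙 (suc f) = antidiagonal-false f

matchings-antidiagonal : ∀ E X xs f → matchings E xs f ≡ antidiagonal (bimatchings E X xs) f
matchings-antidiagonal E X xs f = go (length xs) xs f ≤-refl
  where
  go : ∀ n xs f → length xs ≤ n → matchings E xs f ≡ antidiagonal (bimatchings E X xs) f
  go n [] f _ = trans (matchings-[] E f) (trans (sym (antidiagonal-𝟙 f))
    (antidiagonal-cong (λ i j → sym (bimatchings-[] E X i j)) f))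
  go (suc n) (x ∷ xs) f (s≤s le) =
    trans (matchings-∷ E x xs f)
      (trans (cong₂ _xor_ (trans (z·-cong (λ g → go n xs g le) f) (sym (antidiagonal-z·on (X x) (bimatchings E X xs) f)))
                (trans (⨁-cong xs (λ y → trans (cong (E x y ∧_) (go n (remove y xs) f (≤-trans (length-remove y xs) le)))
                          (sym (antidiagonal-∧ (E x y) _ f))))
                  (sym (antidiagonal-⨁ xs (λ y i j → E x y ∧ bimatchings E X (remove y xs) i j) f))))
        (trans (sym (antidiagonal-xor _ _ f)) (antidiagonal-cong (λ i j → sym (bimatchings-∷ E X x xs i j)) f)))

z·on-⨁ : ∀ xs (a : ℕ → Bool) (G : ℕ → Series²) b i j →
  ⨁ xs (λ u → a u ∧ z·on b (G u) i j) ≡ z·on b (λ i′ j′ → ⨁ xs (λ u → a u ∧ G u i′ j′)) i j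
z·on-⨁ xs a G true i j = sym (trans (z·-⨁ xs (λ u i′ → a u ∧ G u i′ j) i) (⨁-cong xs (λ u → z·-∧ (a u) _ i)))
z·on-⨁ xs a G false i j = sym (trans (z·-⨁ xs (λ u j′ → a u ∧ G u i j′) j) (⨁-cong xs (λ u → z·-∧ (a u) _ j)))

xor-z·-odd : ∀ i (G : Series) → G i xor (z· (λ i′ → odd (suc i′) ∧ G (suc i′))) i ≡ odd (suc i) ∧ G i
xor-z·-odd zero G = xor-identityʳ _
xor-z·-odd (suc i) G = solve 2 (λ o c → c :+ (o :* c) := (con true :+ o) :* c) refl (odd (suc i)) (G (suc i))
  where open xor-∧-Solver

-- Deleting an X-vertex in all possible ways: every matching with i + 1 unmatched X-vertices arises i + 1 times.
⨁-bimatchings-remove : ∀ E X xs i j → Distinct xs →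
  ⨁ xs (λ u → X u ∧ bimatchings E X (remove u xs) i j) ≡ odd (suc i) ∧ bimatchings E X xs (suc i) j
⨁-bimatchings-remove E X xs i j d = go (length xs) xs i j ≤-refl d
  where
  open ≡-Reasoning
  B : List ℕ → Series²
  B = bimatchings E X
  go : ∀ n xs i j → length xs ≤ n → Distinct xs →
       ⨁ xs (λ u → X u ∧ B (remove u xs) i j) ≡ odd (suc i) ∧ B xs (suc i) j
  go n [] i j _ _ = sym (trans (cong (odd (suc i) ∧_) (bimatchings-[] E X (suc i) j)) (∧-zeroʳ (odd (suc i))))
  go (suc n) (x ∷ xs) i j (s≤s le) (x∉ ∷ d) = begin
      (X x ∧ B (remove x (x ∷ xs)) i j) xor ⨁ xs (λ u → X u ∧ B (remove u (x ∷ xs)) i j)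
        ≡⟨ cong₂ _xor_ (cong (λ L → X x ∧ B L i j) (trans (remove-head x xs) (remove-∉ᵇ x xs x∉)))
             (⨁-cong-∈ᵇ xs (λ u u∈ → trans (cong (λ L → X u ∧ B L i j) (remove-∷ u x xs (∈ᵇ-∉ᵇ⇒≢ xs x∉ u∈)))
                (trans (cong (X u ∧_) (bimatchings-∷ E X x (remove u xs) i j)) (∧-distribˡ-xor (X u) _ _)))) ⟩
      (X x ∧ B xs i j) xor ⨁ xs (λ u → (X u ∧ z·on (X x) (B (remove u xs)) i j) xor
           (X u ∧ ⨁ (remove u xs) (λ y → E x y ∧ B (remove y (remove u xs)) i j)))
        ≡⟨ cong ((X x ∧ B xs i j) xor_) (trans (⨁-xor xs _ _) (cong₂ _xor_ shifted matched)) ⟩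
      (X x ∧ B xs i j) xor (z·on (X x) (λ i′ j′ → odd (suc i′) ∧ B xs (suc i′) j′) i j xor
           ⨁ xs (λ y → E x y ∧ (odd (suc i) ∧ B (remove y xs) (suc i) j)))
        ≡⟨ solve 3 (λ a b c → a :+ (b :+ c) := (a :+ b) :+ c) refl (X x ∧ B xs i j) _ _ ⟩
      ((X x ∧ B xs i j) xor z·on (X x) (λ i′ j′ → odd (suc i′) ∧ B xs (suc i′) j′) i j) xor
           ⨁ xs (λ y → E x y ∧ (odd (suc i) ∧ B (remove y xs) (suc i) j))
        ≡⟨ cong₂ _xor_ (unmatched-x (X x) refl)
             (trans (⨁-cong xs (λ y → ∧-leftComm (E x y) (odd (suc i)) _)) (sym (∧-distribˡ-⨁ (odd (suc i)) xs _))) ⟩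
      (odd (suc i) ∧ z·on (X x) (B xs) (suc i) j) xor (odd (suc i) ∧ ⨁ xs (λ y → E x y ∧ B (remove y xs) (suc i) j))
        ≡⟨ sym (∧-distribˡ-xor (odd (suc i)) _ _) ⟩
      odd (suc i) ∧ (z·on (X x) (B xs) (suc i) j xor ⨁ xs (λ y → E x y ∧ B (remove y xs) (suc i) j))
        ≡⟨ cong (odd (suc i) ∧_) (sym (bimatchings-∷ E X x xs (suc i) j)) ⟩
      odd (suc i) ∧ B (x ∷ xs) (suc i) j ∎
    where
    open xor-∧-Solver
    shifted : ⨁ xs (λ u → X u ∧ z·on (X x) (B (remove u xs)) i j) ≡
              z·on (X x) (λ i′ j′ → odd (suc i′) ∧ B xs (suc i′) j′) i j
    shifted = trans (z·on-⨁ xs X (B ∘ (λ u → remove u xs)) (X x) i j)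
                (z·on-cong (X x) (λ i′ j′ → go n xs i′ j′ le d) i j)
    matched : ⨁ xs (λ u → X u ∧ ⨁ (remove u xs) (λ y → E x y ∧ B (remove y (remove u xs)) i j)) ≡
              ⨁ xs (λ y → E x y ∧ (odd (suc i) ∧ B (remove y xs) (suc i) j))
    matched = trans (⨁-∧-remove-comm xs X (E x) (λ u y → B (remove y (remove u xs)) i j))
      (⨁-cong xs (λ y → cong (E x y ∧_) (trans (⨁-cong (remove y xs) (λ u → cong (λ L → X u ∧ B L i j) (remove-comm y u xs)))
        (go n (remove y xs) i j (≤-trans (length-remove y xs) le) (Distinct-filterᵇ _ d)))))
    unmatched-x : ∀ b → X x ≡ b →
      (X x ∧ B xs i j) xor z·on b (λ i′ j′ → odd (suc i′) ∧ B xs (suc i′) j′) i j ≡ odd (suc i) ∧ z·on b (B xs) (suc i) j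
    unmatched-x true e rewrite e = xor-z·-odd i (λ i′ → B xs i′ j)
    unmatched-x false e rewrite e = z·-∧ (odd (suc i)) _ j

bimatchings-balance : ∀ E X → (∀ x y → E x y ≡ true → X y ≡ not (X x)) →
  ∀ xs i j → Distinct xs → bimatchings E X xs i j ≡ true → i + count (not ∘ X) xs ≡ j + count X xs
bimatchings-balance E X bipartite xs i j d h = go (length xs) xs i j ≤-refl d h
  where
  N : ℕ → Bool
  N = not ∘ X
  +-suc-both : ∀ {i j a b} → i + b ≡ j + a → i + suc b ≡ j + suc a
  +-suc-both {i} {j} {a} {b} e = trans (+-suc i b) (trans (cong suc e) (sym (+-suc j a)))
  go : ∀ n xs i j → length xs ≤ n → Distinct xs → bimatchings E X xs i j ≡ true → i + count N xs ≡ j + count X xs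
  go n [] zero zero _ _ h = refl
  go n [] zero (suc j) _ _ h with () ← trans (sym h) (bimatchings-[] E X zero (suc j))
  go n [] (suc i) j _ _ h with () ← trans (sym h) (bimatchings-[] E X (suc i) j)
  go (suc n) (x ∷ xs) i j (s≤s le) (x∉ ∷ d) h with xor-true (trans (sym (bimatchings-∷ E X x xs i j)) h)
  ... | inj₁ unmatched = by-side (X x) refl i j unmatched
    where
    by-side : ∀ b → X x ≡ b → ∀ i j → z·on b (bimatchings E X xs) i j ≡ true → i + count N (x ∷ xs) ≡ j + count X (x ∷ xs)
    by-side true Xx (suc i) j h rewrite count-reject N xs (cong not Xx) | count-accept X xs Xx =
      trans (cong suc (go n xs i j le d h)) (sym (+-suc j _))
    by-side false Xx i (suc j) h rewrite count-accept N xs (cong not Xx) | count-reject X xs Xx =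
      trans (+-suc i _) (cong suc (go n xs i j le d h))
  ... | inj₂ matched with ⨁-true xs _ matched
  ... | y , y∈ , Exy-h with ∧-true Exy-h
  ... | Exy , h′ = by-side (X x) refl (go n (remove y xs) i j (≤-trans (length-remove y xs) le) (Distinct-filterᵇ _ d) h′)
    where
    by-side : ∀ b → X x ≡ b → i + count N (remove y xs) ≡ j + count X (remove y xs) → i + count N (x ∷ xs) ≡ j + count X (x ∷ xs)
    by-side true Xx ih
      rewrite count-reject N xs (cong not Xx) | count-accept X xs Xx
            | sym (count-remove-∈ N y xs d y∈ (cong not (trans (bipartite x y Exy) (cong not Xx))))
            | count-remove-∉ X y xs (trans (bipartite x y Exy) (cong not Xx)) = +-suc-both ih
    by-side false Xx ih
      rewrite count-accept N xs (cong not Xx) | count-reject X xs Xx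
            | count-remove-∉ N y xs (cong not (trans (bipartite x y Exy) (cong not Xx)))
            | sym (count-remove-∈ X y xs d y∈ (trans (bipartite x y Exy) (cong not Xx))) = +-suc-both ih

bimatchings-swap : ∀ E X xs i j → bimatchings E (not ∘ X) xs i j ≡ bimatchings E X xs j i
bimatchings-swap E X xs i j = go (length xs) xs i j ≤-refl
  where
  go : ∀ n xs i j → length xs ≤ n → bimatchings E (not ∘ X) xs i j ≡ bimatchings E X xs j i
  go n [] i j _ = trans (bimatchings-[] E (not ∘ X) i j) (trans (∧-comm (𝟙 i) (𝟙 j)) (sym (bimatchings-[] E X j i)))
  go (suc n) (x ∷ xs) i j (s≤s le) =
    trans (bimatchings-∷ E (not ∘ X) x xs i j)
      (trans (cong₂ _xor_ (unmatched (X x))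
                (⨁-cong xs (λ y → cong (E x y ∧_) (go n (remove y xs) i j (≤-trans (length-remove y xs) le)))))
        (sym (bimatchings-∷ E X x xs j i)))
    where
    unmatched : ∀ b → z·on (not b) (bimatchings E (not ∘ X) xs) i j ≡ z·on b (bimatchings E X xs) j i
    unmatched true = z·-cong (λ g → go n xs i g le) j
    unmatched false = z·-cong (λ g → go n xs g j le) i

module _ (E : Graph) (X : ℕ → Bool) (bipartite : ∀ x y → E x y ≡ true → X y ≡ not (X x))
         (xs : List ℕ) (d : Distinct xs) where

  private
    Y : ℕ → Bool
    Y = not ∘ X

    B : Series²
    B = bimatchings E X xs

  matchings∖₁-antidiagonal : ∀ f → matchings∖₁ E X xs f ≡ antidiagonal (λ i j → odd (suc i) ∧ B (suc i) j) f
  matchings∖₁-antidiagonal f =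
    trans (⨁-cong xs (λ u → trans (cong (X u ∧_) (matchings-antidiagonal E X (remove u xs) f)) (sym (antidiagonal-∧ (X u) _ f))))
      (trans (sym (antidiagonal-⨁ xs (λ u i j → X u ∧ bimatchings E X (remove u xs) i j) f))
        (antidiagonal-cong (λ i j → ⨁-bimatchings-remove E X xs i j d) f))

  matchings∖₁-complement-antidiagonal : ∀ f → matchings∖₁ E Y xs f ≡ antidiagonal (λ i j → odd (suc i) ∧ B j (suc i)) f
  matchings∖₁-complement-antidiagonal f =
    trans (⨁-cong xs (λ u → trans (cong (Y u ∧_) (matchings-antidiagonal E Y (remove u xs) f)) (sym (antidiagonal-∧ (Y u) _ f))))
      (trans (sym (antidiagonal-⨁ xs (λ u i j → Y u ∧ bimatchings E Y (remove u xs) i j) f))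
        (antidiagonal-cong (λ i j → trans (⨁-bimatchings-remove E Y xs i j d)
          (cong (odd (suc i) ∧_) (bimatchings-swap E X xs (suc i) j))) f))

  matchings∖₂-antidiagonal : ∀ f →
    matchings∖₂ E X Y xs f ≡ antidiagonal (λ i j → odd (suc i) ∧ (odd (suc j) ∧ B (suc j) (suc i))) f
  matchings∖₂-antidiagonal f =
    trans (⨁-cong xs (λ u → ∧-guard (X u) (λ Xu → inner u Xu)))
      (trans (⨁-cong xs (λ u → sym (antidiagonal-∧ (X u) _ f)))
        (trans (sym (antidiagonal-⨁ xs (λ u i j → X u ∧ (odd (suc i) ∧ bimatchings E X (remove u xs) j (suc i))) f))
          (antidiagonal-cong (λ i j → trans (⨁-cong xs (λ u → ∧-leftComm (X u) (odd (suc i)) _))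
            (trans (sym (∧-distribˡ-⨁ (odd (suc i)) xs _)) (cong (odd (suc i) ∧_) (⨁-bimatchings-remove E X xs j (suc i) d)))) f)))
    where
    inner : ∀ u → X u ≡ true → ⨁ xs (λ w → Y w ∧ matchings E (remove w (remove u xs)) f) ≡
                                antidiagonal (λ i j → odd (suc i) ∧ bimatchings E X (remove u xs) j (suc i)) f
    inner u Xu =
      trans (sym (trans (⨁-remove u xs _) (⨁-cong xs Y-≢)))
      (trans (⨁-cong (remove u xs) (λ w → trans (cong (Y w ∧_) (matchings-antidiagonal E Y (remove w (remove u xs)) f))
                (sym (antidiagonal-∧ (Y w) _ f))))
      (trans (sym (antidiagonal-⨁ (remove u xs) (λ w i j → Y w ∧ bimatchings E Y (remove w (remove u xs)) i j) f))
      (antidiagonal-cong (λ i j → trans (⨁-bimatchings-remove E Y (remove u xs) i j (Distinct-filterᵇ _ d))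
        (cong (odd (suc i) ∧_) (bimatchings-swap E X (remove u xs) (suc i) j))) f)))
      where
      Y-≢ : ∀ w → not (w ≡ᵇ u) ∧ (Y w ∧ matchings E (remove w (remove u xs)) f) ≡ Y w ∧ matchings E (remove w (remove u xs)) f
      Y-≢ w with w ≡ᵇ u in e
      ... | false = refl
      ... | true rewrite ≡ᵇ⇒≡ w u e | Xu = refl

  private
    off-balance : ∀ i j → (i + count Y xs ≡ j + count X xs → ⊥) → B i j ≡ false
    off-balance i j ne with B i j in e
    ... | false = refl
    ... | true = ⊥-elim (ne (bimatchings-balance E X bipartite xs i j d e))

  module Balanced (balanced : count X xs ≡ count Y xs) where

    private
      off : ∀ i j → i ≢ j → B i j ≡ false
      off i j i≢j = off-balance i j (λ e → i≢j (+-cancelʳ-≡ (count Y xs) i j (trans e (cong (j +_) balanced))))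

      matchings-2 : matchings E xs 2 ≡ B 1 1
      matchings-2 rewrite matchings-antidiagonal E X xs 2 | off 0 2 (λ ()) | off 2 0 (λ ()) = xor-identityʳ _

    matchings-1 : matchings E xs 1 ≡ false
    matchings-1 rewrite matchings-antidiagonal E X xs 1 | off 0 1 (λ ()) | off 1 0 (λ ()) = refl

    matchings∖₁-0 : matchings∖₁ E X xs 0 ≡ false
    matchings∖₁-0 rewrite matchings∖₁-antidiagonal 0 | off 1 0 (λ ()) = refl

    matchings∖₁-1 : matchings∖₁ E X xs 1 ≡ matchings E xs 2
    matchings∖₁-1 rewrite matchings∖₁-antidiagonal 1 | matchings-2 = xor-identityʳ _

    matchings∖₁-complement-0 : matchings∖₁ E Y xs 0 ≡ false
    matchings∖₁-complement-0 rewrite matchings∖₁-complement-antidiagonal 0 | off 0 1 (λ ()) = refl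

    matchings∖₂-0 : matchings∖₂ E X Y xs 0 ≡ matchings E xs 2
    matchings∖₂-0 rewrite matchings∖₂-antidiagonal 0 | matchings-2 = refl

  module Unbalanced (unbalanced : count X xs ≡ suc (count Y xs)) where

    private
      off : ∀ i j → i ≢ suc j → B i j ≡ false
      off i j i≢ = off-balance i j (λ e → i≢ (+-cancelʳ-≡ (count Y xs) i (suc j)
        (trans e (trans (cong (j +_) unbalanced) (+-suc j (count Y xs))))))

    matchings-0 : matchings E xs 0 ≡ false
    matchings-0 rewrite matchings-antidiagonal E X xs 0 | off 0 0 (λ ()) = refl

    matchings∖₁-0 : matchings∖₁ E X xs 0 ≡ matchings E xs 1
    matchings∖₁-0 rewrite matchings∖₁-antidiagonal 0 | matchings-antidiagonal E X xs 1 | off 0 1 (λ ()) = refl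

    matchings∖₁-1 : matchings∖₁ E X xs 1 ≡ false
    matchings∖₁-1 rewrite matchings∖₁-antidiagonal 1 | off 1 1 (λ ()) = refl

    matchings∖₁-complement-0 : matchings∖₁ E Y xs 0 ≡ false
    matchings∖₁-complement-0 rewrite matchings∖₁-complement-antidiagonal 0 | off 0 1 (λ ()) = refl

    matchings∖₁-complement-1 : matchings∖₁ E Y xs 1 ≡ false
    matchings∖₁-complement-1 rewrite matchings∖₁-complement-antidiagonal 1 | off 1 1 (λ ()) = refl

    matchings∖₂-0 : matchings∖₂ E X Y xs 0 ≡ false
    matchings∖₂-0 rewrite matchings∖₂-antidiagonal 0 | off 1 1 (λ ()) = refl

    matchings∖₂-1 : matchings∖₂ E X Y xs 1 ≡ false
    matchings∖₂-1 rewrite matchings∖₂-antidiagonal 1 = refl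

-- Involutions and matchings

⨁-↭ : ∀ {A : Set} {xs ys : List A} (g : A → Bool) → xs ↭ ys → ⨁ xs g ≡ ⨁ ys g
⨁-↭ g ↭.refl = refl
⨁-↭ g (↭.prep x p) = cong (g x xor_) (⨁-↭ g p)
⨁-↭ g (↭.swap {xs} {ys} x y p) =
  trans (sym (xor-assoc (g x) (g y) (⨁ xs g)))
    (trans (cong (_xor ⨁ xs g) (xor-comm (g x) (g y)))
      (trans (xor-assoc (g y) (g x) (⨁ xs g)) (cong (λ z → g y xor (g x xor z)) (⨁-↭ g p))))
⨁-↭ g (↭.trans p q) = trans (⨁-↭ g p) (⨁-↭ g q)

⨁-involution : ∀ {A : Set} (xs : List A) → Unique xs → (∀ v → v ∈ xs) →
               (τ : A → A) → (∀ v → τ (τ v) ≡ v) → (g : A → Bool) → ⨁ xs (λ v → g (τ v)) ≡ ⨁ xs g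
⨁-involution xs unique complete τ τ-τ g =
  trans (sym (⨁-map τ xs g))
    (⨁-↭ g (∼bag⇒↭ (unique∧set⇒bag (Unique-map⁺ τ-injective unique) unique
      (λ {v} → mk⇔ (λ _ → complete v) (λ _ → subst (_∈ map τ xs) (τ-τ v) (∈-map⁺ τ (complete (τ v))))))))
  where
  τ-injective : ∀ {a b} → τ a ≡ τ b → a ≡ b
  τ-injective {a} {b} e = trans (sym (τ-τ a)) (trans (cong τ e) (τ-τ b))

allVecs-cartesianProduct : ∀ {A : Set} (xs ys : List A) k →
  concatMap (λ x → map (x ∷_) (allVecs xs k)) ys ≡ cartesianProductWith _∷_ ys (allVecs xs k)
allVecs-cartesianProduct xs [] k = refl
allVecs-cartesianProduct xs (y ∷ ys) k = cong (map (y ∷_) (allVecs xs k) ++_) (allVecs-cartesianProduct xs ys k)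

allVecs-Unique : ∀ {A : Set} (xs : List A) → Unique xs → ∀ k → Unique (allVecs xs k)
allVecs-Unique xs u zero = [] ∷ []
allVecs-Unique xs u (suc k) rewrite allVecs-cartesianProduct xs xs k =
  Unique-cartesianProductWith⁺ _∷_ (λ e → ∷-injective e) u (allVecs-Unique xs u k)

allVecs-complete : ∀ {A : Set} (xs : List A) → (∀ a → a ∈ xs) → ∀ k (v : Vec A k) → v ∈ allVecs xs k
allVecs-complete xs c zero [] = here refl
allVecs-complete xs c (suc k) (a ∷ v) rewrite allVecs-cartesianProduct xs xs k =
  ∈-cartesianProductWith⁺ _∷_ (c a) (allVecs-complete xs c k v)

Endo : ℕ → Set
Endo m = Vec (Fin m) m

module _ {m : ℕ} where

  infix 4 _≡ᶠ_

  _≡ᶠ_ : Fin m → Fin m → Bool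
  a ≡ᶠ b = toℕ a ≡ᵇ toℕ b

  ≡ᶠ⇒≡ : ∀ {a b} → (a ≡ᶠ b) ≡ true → a ≡ b
  ≡ᶠ⇒≡ {a} {b} e = toℕ-injective (≡ᵇ⇒≡ (toℕ a) (toℕ b) e)

  ≡ᶠ-refl : ∀ a → (a ≡ᶠ a) ≡ true
  ≡ᶠ-refl a = ≡ᵇ-refl (toℕ a)

  ≢⇒≡ᶠ-false : ∀ {a b} → a ≢ b → (a ≡ᶠ b) ≡ false
  ≢⇒≡ᶠ-false {a} {b} a≢b = ≢⇒≡ᵇ-false (toℕ a) (toℕ b) (λ e → a≢b (toℕ-injective e))

  ≡ᶠ-false⇒≢ : ∀ {a b} → (a ≡ᶠ b) ≡ false → a ≢ b
  ≡ᶠ-false⇒≢ {a} e refl with () ← trans (sym e) (≡ᶠ-refl a)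

  Endo-ext : ∀ {v w : Endo m} → (∀ i → lookup v i ≡ lookup w i) → v ≡ w
  Endo-ext {v} {w} h = trans (sym (tabulate∘lookup v)) (trans (tabulate-cong h) (tabulate∘lookup w))

  module Exchange (x y : Fin m) (x≢y : x ≢ y) where

    transpose-x : transpose x y x ≡ y
    transpose-x rewrite dec-true (x ≟ x) refl = refl

    transpose-y : transpose x y y ≡ x
    transpose-y rewrite dec-false (y ≟ x) (λ e → x≢y (sym e)) | dec-true (y ≟ y) refl = refl

    transpose-other : ∀ i → i ≢ x → i ≢ y → transpose x y i ≡ i
    transpose-other i i≢x i≢y rewrite dec-false (i ≟ x) i≢x | dec-false (i ≟ y) i≢y = refl

    transpose-involutive : ∀ i → transpose x y (transpose x y i) ≡ i
    transpose-involutive i = by-cases (i ≟ x) (i ≟ y)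
      where
      by-cases : Dec (i ≡ x) → Dec (i ≡ y) → transpose x y (transpose x y i) ≡ i
      by-cases (yes refl) _ = trans (cong (transpose x y) transpose-x) transpose-y
      by-cases (no _) (yes refl) = trans (cong (transpose x y) transpose-y) transpose-x
      by-cases (no i≢x) (no i≢y) = trans (cong (transpose x y) (transpose-other i i≢x i≢y)) (transpose-other i i≢x i≢y)

    swapsOrFixes : Endo m → Bool
    swapsOrFixes v = ((lookup v x ≡ᶠ y) ∧ (lookup v y ≡ᶠ x)) ∨ ((lookup v x ≡ᶠ x) ∧ (lookup v y ≡ᶠ y))

    conjugate : Endo m → Endo m
    conjugate v = Vec.tabulate (λ i → lookup v (transpose x y i))

    lookup-conjugate : ∀ v i → lookup (conjugate v) i ≡ lookup v (transpose x y i)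
    lookup-conjugate v i = lookup∘tabulate _ i

    -- Composing with the transposition (x y) turns "x ↔ y" into "x, y fixed" and back.
    exchange : Endo m → Endo m
    exchange v = if swapsOrFixes v then conjugate v else v

    swapsOrFixes-conjugate : ∀ v → swapsOrFixes (conjugate v) ≡ swapsOrFixes v
    swapsOrFixes-conjugate v rewrite lookup-conjugate v x | lookup-conjugate v y | transpose-x | transpose-y
      with lookup v x ≡ᶠ y | lookup v y ≡ᶠ x | lookup v x ≡ᶠ x | lookup v y ≡ᶠ y
    ... | a | b | c | d = solve 4 (λ a b c d → (d :∧ c) :∨ (b :∧ a) := (a :∧ b) :∨ (c :∧ d)) refl a b c d
      where open ∨-∧-Solver renaming (_:+_ to _:∨_; _:*_ to _:∧_)

    conjugate-involutive : ∀ v → conjugate (conjugate v) ≡ v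
    conjugate-involutive v = Endo-ext (λ i →
      trans (lookup-conjugate (conjugate v) i) (trans (lookup-conjugate v (transpose x y i)) (cong (lookup v) (transpose-involutive i))))

    exchange-involutive : ∀ v → exchange (exchange v) ≡ v
    exchange-involutive v with swapsOrFixes v in c
    ... | true rewrite swapsOrFixes-conjugate v | c = conjugate-involutive v
    ... | false rewrite c = refl

module Counting (m : ℕ) (E : Graph) (E-sym : ∀ a b → E a b ≡ E b a) where

  codes : List (Fin m) → List ℕ
  codes = map toℕ

  infix 4 _∈ᶠ_

  _∈ᶠ_ : Fin m → List (Fin m) → Bool
  i ∈ᶠ S = toℕ i ∈ᵇ codes S

  ∈ᶠ-here : ∀ x S → (x ∈ᶠ x ∷ S) ≡ true
  ∈ᶠ-here x S = ∈ᵇ-here (toℕ x) (codes S)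

  ∈ᶠ-there : ∀ x {i} S → (i ∈ᶠ S) ≡ true → (i ∈ᶠ x ∷ S) ≡ true
  ∈ᶠ-there x S = ∈ᵇ-there (toℕ x) (codes S)

  ∈ᶠ-∉ᶠ⇒≢ : ∀ {x y} S → (x ∈ᶠ S) ≡ false → (y ∈ᶠ S) ≡ true → x ≢ y
  ∈ᶠ-∉ᶠ⇒≢ S x∉ y∈ refl with () ← trans (sym x∉) y∈

  removeᶠ : Fin m → List (Fin m) → List (Fin m)
  removeᶠ y = filterᵇ (λ i → not (i ≡ᶠ y))

  codes-removeᶠ : ∀ y S → codes (removeᶠ y S) ≡ remove (toℕ y) (codes S)
  codes-removeᶠ y [] = refl
  codes-removeᶠ y (z ∷ S) with z ≡ᶠ y
  ... | true = codes-removeᶠ y S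
  ... | false = cong (toℕ z ∷_) (codes-removeᶠ y S)

  ∈ᶠ-removeᶠ : ∀ i y S → (i ∈ᶠ removeᶠ y S) ≡ not (i ≡ᶠ y) ∧ (i ∈ᶠ S)
  ∈ᶠ-removeᶠ i y S = trans (cong (toℕ i ∈ᵇ_) (codes-removeᶠ y S)) (∈ᵇ-remove (toℕ i) (toℕ y) (codes S))

  removeᶠ-∉ᶠ : ∀ y S → (y ∈ᶠ S) ≡ false → removeᶠ y S ≡ S
  removeᶠ-∉ᶠ y [] _ = refl
  removeᶠ-∉ᶠ y (z ∷ S) y∉ with z ≡ᶠ y in e
  ... | false = cong (z ∷_) (removeᶠ-∉ᶠ y S y∉)
  ... | true with () ← y∉

  fixedIn : List (Fin m) → Endo m → ℕ
  fixedIn S v = length (filterᵇ (λ i → lookup v i ≡ᶠ i) S)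

  fixedIn-cong : ∀ S v w → (∀ i → (i ∈ᶠ S) ≡ true → (lookup v i ≡ᶠ i) ≡ (lookup w i ≡ᶠ i)) → fixedIn S v ≡ fixedIn S w
  fixedIn-cong [] v w h = refl
  fixedIn-cong (z ∷ S) v w h with lookup v z ≡ᶠ z | lookup w z ≡ᶠ z | h z (∈ᶠ-here z S)
  ... | true | .true | refl = cong suc (fixedIn-cong S v w (λ i i∈ → h i (∈ᶠ-there z S i∈)))
  ... | false | .false | refl = fixedIn-cong S v w (λ i i∈ → h i (∈ᶠ-there z S i∈))

  fixedIn-∷-fixed : ∀ z S v → (lookup v z ≡ᶠ z) ≡ true → fixedIn (z ∷ S) v ≡ suc (fixedIn S v)
  fixedIn-∷-fixed z S v e rewrite e = refl

  fixedIn-∷-moved : ∀ z S v → (lookup v z ≡ᶠ z) ≡ false → fixedIn (z ∷ S) v ≡ fixedIn S v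
  fixedIn-∷-moved z S v e rewrite e = refl

  fixedIn-removeᶠ : ∀ y S v → Distinct (codes S) → (lookup v y ≡ᶠ y) ≡ false → fixedIn (removeᶠ y S) v ≡ fixedIn S v
  fixedIn-removeᶠ y [] v d e = refl
  fixedIn-removeᶠ y (z ∷ S) v (z∉ ∷ d) e with z ≡ᶠ y in z≡y
  ... | true with ≡ᶠ⇒≡ {a = z} {b = y} z≡y
  ...   | refl = trans (cong (λ L → fixedIn L v) (removeᶠ-∉ᶠ z S z∉)) (sym (fixedIn-∷-moved z S v e))
  fixedIn-removeᶠ y (z ∷ S) v (z∉ ∷ d) e | false with lookup v z ≡ᶠ z
  ... | true = cong suc (fixedIn-removeᶠ y S v d e)
  ... | false = fixedIn-removeᶠ y S v d e

  FixesOutside : List (Fin m) → Endo m → Set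
  FixesOutside S v = ∀ i → (i ∈ᶠ S) ≡ false → lookup v i ≡ i

  EdgeCycles : Endo m → Set
  EdgeCycles v = ∀ i → lookup v i ≢ i → E (toℕ i) (toℕ (lookup v i)) ≡ true

  Supported : List (Fin m) → ℕ → Endo m → Set
  Supported S f v = IsInvolution (lookup v) × FixesOutside S v × fixedIn S v ≡ f × EdgeCycles v

  Supported? : ∀ S f v → Dec (Supported S f v)
  Supported? S f v = all? (λ i → lookup v (lookup v i) ≟ i)
    ×-dec all? (λ i → ((i ∈ᶠ S) ≟𝔹 false) →-dec (lookup v i ≟ i))
    ×-dec (fixedIn S v ≟ℕ f)
    ×-dec all? (λ i → ¬? (lookup v i ≟ i) →-dec (E (toℕ i) (toℕ (lookup v i)) ≟𝔹 true))

  supported : List (Fin m) → ℕ → Endo m → Bool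
  supported S f v = ⌊ Supported? S f v ⌋

  module Transfer (x y : Fin m) (x≢y : x ≢ y) (S : List (Fin m))
                  (x∉ : (x ∈ᶠ S) ≡ false) (y∈ : (y ∈ᶠ S) ≡ true) (d : Distinct (codes S))
                  (v w : Endo m) (vx : lookup v x ≡ y) (vy : lookup v y ≡ x)
                  (wx : lookup w x ≡ x) (wy : lookup w y ≡ y)
                  (w≡v : ∀ i → i ≢ x → i ≢ y → lookup w i ≡ lookup v i) where

    private
      σ ω : Fin m → Fin m
      σ = lookup v
      ω = lookup w

    ∈-removeᶠ⇒≢ : ∀ i → (i ∈ᶠ removeᶠ y S) ≡ true → i ≢ y × i ≢ x
    ∈-removeᶠ⇒≢ i i∈ with ∧-true (trans (sym (∈ᶠ-removeᶠ i y S)) i∈)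
    ... | i≢y , i∈S = ≡ᶠ-false⇒≢ (not≡true i≢y) , λ { refl → ∈ᶠ-∉ᶠ⇒≢ S x∉ i∈S refl }

    fixedIn-transfer : fixedIn (removeᶠ y S) w ≡ fixedIn (x ∷ S) v
    fixedIn-transfer =
      trans (fixedIn-cong (removeᶠ y S) w v (λ i i∈ → let (i≢y , i≢x) = ∈-removeᶠ⇒≢ i i∈ in cong (_≡ᶠ i) (w≡v i i≢x i≢y)))
        (trans (fixedIn-removeᶠ y S v d (trans (cong (_≡ᶠ y) vy) (≢⇒≡ᶠ-false x≢y)))
          (sym (fixedIn-∷-moved x S v (trans (cong (_≡ᶠ x) vx) (≢⇒≡ᶠ-false (λ e → x≢y (sym e)))))))

    forward : ∀ f → Supported (x ∷ S) f v → E (toℕ x) (toℕ y) ≡ true × Supported (removeᶠ y S) f w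
    forward f (inv , out , fixed , edges) = Exy , inv′ , out′ , trans fixedIn-transfer fixed , edges′
      where
      Exy : E (toℕ x) (toℕ y) ≡ true
      Exy = subst (λ z → E (toℕ x) (toℕ z) ≡ true) vx (edges x (λ e → x≢y (trans (sym e) vx)))
      inv′ : IsInvolution ω
      inv′ i with i ≟ x | i ≟ y
      ... | yes refl | _ = trans (cong ω wx) wx
      ... | no _ | yes refl = trans (cong ω wy) wy
      ... | no i≢x | no i≢y = trans (cong ω (w≡v i i≢x i≢y)) (trans (w≡v (σ i) σi≢x σi≢y) (inv i))
        where
        σi≢x : σ i ≢ x
        σi≢x e = i≢y (trans (sym (inv i)) (trans (cong σ e) vx))
        σi≢y : σ i ≢ y
        σi≢y e = i≢x (trans (sym (inv i)) (trans (cong σ e) vy))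
      out′ : FixesOutside (removeᶠ y S) w
      out′ i i∉ with i ≟ x | i ≟ y
      ... | yes refl | _ = wx
      ... | no _ | yes refl = wy
      ... | no i≢x | no i≢y = trans (w≡v i i≢x i≢y) (out i (trans (cong (_∨ (i ∈ᶠ S)) (≢⇒≡ᶠ-false (λ e → i≢x (sym e)))) i∉S))
        where
        i∉S : (i ∈ᶠ S) ≡ false
        i∉S = trans (sym (cong (λ z → not z ∧ (i ∈ᶠ S)) (≢⇒≡ᶠ-false i≢y))) (trans (sym (∈ᶠ-removeᶠ i y S)) i∉)
      edges′ : EdgeCycles w
      edges′ i moved with i ≟ x | i ≟ y
      ... | yes refl | _ = ⊥-elim (moved wx)
      ... | no _ | yes refl = ⊥-elim (moved wy)
      ... | no i≢x | no i≢y = subst (λ z → E (toℕ i) (toℕ z) ≡ true) (sym (w≡v i i≢x i≢y))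
                                (edges i (λ e → moved (trans (w≡v i i≢x i≢y) e)))

    backward : ∀ f → E (toℕ x) (toℕ y) ≡ true → Supported (removeᶠ y S) f w → Supported (x ∷ S) f v
    backward f Exy (inv , out , fixed , edges) = inv′ , out′ , trans (sym fixedIn-transfer) fixed , edges′
      where
      inv′ : IsInvolution σ
      inv′ i with i ≟ x | i ≟ y
      ... | yes refl | _ = trans (cong σ vx) vy
      ... | no _ | yes refl = trans (cong σ vy) vx
      ... | no i≢x | no i≢y = trans (cong σ (sym (w≡v i i≢x i≢y))) (trans (sym (w≡v (ω i) ωi≢x ωi≢y)) (inv i))
        where
        ωi≢x : ω i ≢ x
        ωi≢x e = i≢x (trans (sym (inv i)) (trans (cong ω e) wx))
        ωi≢y : ω i ≢ y
        ωi≢y e = i≢y (trans (sym (inv i)) (trans (cong ω e) wy))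
      out′ : FixesOutside (x ∷ S) v
      out′ i i∉ with i ≟ x | i ≟ y
      ... | yes refl | _ with () ← trans (sym i∉) (∈ᶠ-here x S)
      out′ i i∉ | no _ | yes refl with () ← trans (sym i∉) (∈ᶠ-there x S y∈)
      out′ i i∉ | no i≢x | no i≢y = trans (sym (w≡v i i≢x i≢y)) (out i i∉removeᶠ)
        where
        i∉S : (i ∈ᶠ S) ≡ false
        i∉S = trans (sym (cong (_∨ (i ∈ᶠ S)) (≢⇒≡ᶠ-false (λ e → i≢x (sym e))))) i∉
        i∉removeᶠ : (i ∈ᶠ removeᶠ y S) ≡ false
        i∉removeᶠ = trans (∈ᶠ-removeᶠ i y S) (trans (cong (not (i ≡ᶠ y) ∧_) i∉S) (∧-zeroʳ _))
      edges′ : EdgeCycles v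
      edges′ i moved with i ≟ x | i ≟ y
      ... | yes refl | _ = subst (λ z → E (toℕ x) (toℕ z) ≡ true) (sym vx) Exy
      ... | no _ | yes refl = subst (λ z → E (toℕ y) (toℕ z) ≡ true) (sym vy) (trans (E-sym (toℕ y) (toℕ x)) Exy)
      ... | no i≢x | no i≢y = subst (λ z → E (toℕ i) (toℕ z) ≡ true) (w≡v i i≢x i≢y)
                                (edges i (λ e → moved (trans (sym (w≡v i i≢x i≢y)) e)))

  -- The transposition (x y) matches the involutions sending x to y with those on S ∖ {y} fixing x and y.
  moved-step : ∀ x y (x≢y : x ≢ y) S → (x ∈ᶠ S) ≡ false → (y ∈ᶠ S) ≡ true → Distinct (codes S) → ∀ f v →
    (lookup v x ≡ᶠ y) ∧ supported (x ∷ S) f v ≡ E (toℕ x) (toℕ y) ∧ supported (removeᶠ y S) f (Exchange.exchange x y x≢y v)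
  moved-step x y x≢y S x∉ y∈ d f v = ∧-⌊⌋-cong _ (Supported? (x ∷ S) f v) _ (Supported? (removeᶠ y S) f (exchange v)) to from
    where
    open Exchange x y x≢y
    w = conjugate v
    wx : lookup v y ≡ x → lookup w x ≡ x
    wx e = trans (lookup-conjugate v x) (trans (cong (lookup v) transpose-x) e)
    wy : lookup v x ≡ y → lookup w y ≡ y
    wy e = trans (lookup-conjugate v y) (trans (cong (lookup v) transpose-y) e)
    w≡v : ∀ i → i ≢ x → i ≢ y → lookup w i ≡ lookup v i
    w≡v i i≢x i≢y = trans (lookup-conjugate v i) (cong (lookup v) (transpose-other i i≢x i≢y))
    exchange-swapped : lookup v x ≡ y → lookup v y ≡ x → exchange v ≡ w
    exchange-swapped vx vy rewrite vx | vy | ≡ᶠ-refl x | ≡ᶠ-refl y = refl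
    fixes-both : lookup v x ≡ x → lookup v y ≡ y → swapsOrFixes v ≡ true
    fixes-both vx vy rewrite vx | vy | ≡ᶠ-refl y | ≡ᶠ-refl x = ∨-zeroʳ _
    x∉removeᶠ : (x ∈ᶠ removeᶠ y S) ≡ false
    x∉removeᶠ = trans (∈ᶠ-removeᶠ x y S) (trans (cong (not (x ≡ᶠ y) ∧_) x∉) (∧-zeroʳ _))
    y∉removeᶠ : (y ∈ᶠ removeᶠ y S) ≡ false
    y∉removeᶠ = trans (∈ᶠ-removeᶠ y y S) (cong (λ z → not z ∧ (y ∈ᶠ S)) (≡ᶠ-refl y))
    to : (lookup v x ≡ᶠ y) ≡ true → Supported (x ∷ S) f v → E (toℕ x) (toℕ y) ≡ true × Supported (removeᶠ y S) f (exchange v)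
    to e s =
      let vx = ≡ᶠ⇒≡ e
          vy = trans (cong (lookup v) (sym vx)) (proj₁ s x)
          (Exy , s′) = Transfer.forward x y x≢y S x∉ y∈ d v w vx vy (wx vy) (wy vx) w≡v f s
      in Exy , subst (Supported (removeᶠ y S) f) (sym (exchange-swapped vx vy)) s′
    from : E (toℕ x) (toℕ y) ≡ true → Supported (removeᶠ y S) f (exchange v) → (lookup v x ≡ᶠ y) ≡ true × Supported (x ∷ S) f v
    from Exy s with swapsOrFixes v in c
    ... | true =
      let vy = trans (sym (trans (lookup-conjugate v x) (cong (lookup v) transpose-x))) (proj₁ (proj₂ s) x x∉removeᶠ)
          vx = trans (sym (trans (lookup-conjugate v y) (cong (lookup v) transpose-y))) (proj₁ (proj₂ s) y y∉removeᶠ)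
      in trans (cong (_≡ᶠ y) vx) (≡ᶠ-refl y) , Transfer.backward x y x≢y S x∉ y∈ d v w vx vy (wx vy) (wy vx) w≡v f Exy s
    ... | false with () ← trans (sym c) (fixes-both (proj₁ (proj₂ s) x x∉removeᶠ) (proj₁ (proj₂ s) y y∉removeᶠ))

  fixed-step : ∀ x S → (x ∈ᶠ S) ≡ false → ∀ f v → (lookup v x ≡ᶠ x) ∧ supported (x ∷ S) f v ≡ (z· (λ g → supported S g v)) f
  fixed-step x S x∉ zero v = ∧-⌊⌋-cong _ (Supported? (x ∷ S) zero v) false (no (λ ())) absurd (λ ())
    where
    absurd : (lookup v x ≡ᶠ x) ≡ true → Supported (x ∷ S) zero v → false ≡ true × ⊥
    absurd e (_ , _ , fixed , _) with () ← trans (sym (fixedIn-∷-fixed x S v e)) fixed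
  fixed-step x S x∉ (suc g) v =
    trans (∧-⌊⌋-cong _ (Supported? (x ∷ S) (suc g) v) true (Supported? S g v) to from) (∧-identityˡ _)
    where
    to : (lookup v x ≡ᶠ x) ≡ true → Supported (x ∷ S) (suc g) v → true ≡ true × Supported S g v
    to e (inv , out , fixed , edges) = refl , inv , out′ , suc-injective (trans (sym (fixedIn-∷-fixed x S v e)) fixed) , edges
      where
      out′ : FixesOutside S v
      out′ i i∉ with i ≟ x
      ... | yes refl = ≡ᶠ⇒≡ e
      ... | no i≢x = out i (trans (cong (_∨ (i ∈ᶠ S)) (≢⇒≡ᶠ-false (λ q → i≢x (sym q)))) i∉)
    from : true ≡ true → Supported S g v → (lookup v x ≡ᶠ x) ≡ true × Supported (x ∷ S) (suc g) v
    from _ (inv , out , fixed , edges) = e , inv , out′ , trans (fixedIn-∷-fixed x S v e) (cong suc fixed) , edges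
      where
      e : (lookup v x ≡ᶠ x) ≡ true
      e = trans (cong (_≡ᶠ x) (out x x∉)) (≡ᶠ-refl x)
      out′ : FixesOutside (x ∷ S) v
      out′ i i∉ = out i (∨-false (toℕ x ≡ᵇ toℕ i) i∉)
        where
        ∨-false : ∀ a {b} → a ∨ b ≡ false → b ≡ false
        ∨-false false h = h

  image-in-support : ∀ x S f v → Supported (x ∷ S) f v → (lookup v x ∈ᶠ x ∷ S) ≡ true
  image-in-support x S f v (inv , out , _ , _) with lookup v x ∈ᶠ x ∷ S in e
  ... | true = refl
  ... | false with () ← trans (sym e) (trans (cong (_∈ᶠ x ∷ S) (trans (sym (out (lookup v x) e)) (inv x))) (∈ᶠ-here x S))

  split-image : ∀ x S → Distinct (codes (x ∷ S)) → ∀ f v →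
                supported (x ∷ S) f v ≡ ⨁ (codes (x ∷ S)) (λ z → (toℕ (lookup v x) ≡ᵇ z) ∧ supported (x ∷ S) f v)
  split-image x S d f v =
    trans (image-indicator (image-in-support x S f v ∘ ⌊⌋-true (Supported? (x ∷ S) f v)))
      (trans (cong (_∧ supported (x ∷ S) f v) (sym (⨁-≡ᵇ (toℕ (lookup v x)) (codes (x ∷ S)) d)))
        (trans (∧-comm _ (supported (x ∷ S) f v))
          (trans (∧-distribˡ-⨁ (supported (x ∷ S) f v) (codes (x ∷ S)) (toℕ (lookup v x) ≡ᵇ_))
          (⨁-cong (codes (x ∷ S)) (λ z → ∧-comm (supported (x ∷ S) f v) _)))))
    where
    image-indicator : (supported (x ∷ S) f v ≡ true → (lookup v x ∈ᶠ x ∷ S) ≡ true) →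
                      supported (x ∷ S) f v ≡ (lookup v x ∈ᶠ x ∷ S) ∧ supported (x ∷ S) f v
    image-indicator h with supported (x ∷ S) f v
    ... | false = sym (∧-zeroʳ _)
    ... | true rewrite h refl = refl

  private
    ⨁-≡false : ∀ {A : Set} (xs : List A) g → (∀ v → v ∈ xs → g v ≡ false) → ⨁ xs g ≡ false
    ⨁-≡false [] g h = refl
    ⨁-≡false (x ∷ xs) g h rewrite h x (here refl) = ⨁-≡false xs g (λ v v∈ → h v (there v∈))

    ⨁-unique : ∀ {A : Set} (xs : List A) g a → Unique xs → a ∈ xs → g a ≡ true → (∀ v → g v ≡ true → v ≡ a) → ⨁ xs g ≡ true
    ⨁-unique (z ∷ xs) g a (z∉ ∷ u) (here refl) ga only rewrite ga =
      cong not (⨁-≡false xs g (λ v v∈ → ¬-not (λ gv → All-lookup z∉ v∈ (sym (only v gv)))))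
    ⨁-unique (z ∷ xs) g a (z∉ ∷ u) (there a∈) ga only with g z in gz
    ... | true = ⊥-elim (All-lookup z∉ a∈ (only z gz))
    ... | false = ⨁-unique xs g a u a∈ ga only

  Endos : List (Endo m)
  Endos = allVecs (allFin m) m

  identity : Endo m
  identity = Vec.tabulate (λ i → i)

  ⨁-supported-[] : ∀ f → ⨁ Endos (supported [] f) ≡ 𝟙 f
  ⨁-supported-[] zero = ⨁-unique Endos (supported [] zero) identity
    (allVecs-Unique (allFin m) (Unique-allFin⁺ m) m) (allVecs-complete (allFin m) ∈-allFin m identity)
    (⌊ Supported? [] zero identity ⌋-yes identity-supported) (λ v s → only-identity v (⌊⌋-true (Supported? [] zero v) s))
    where
    id-lookup : ∀ i → lookup identity i ≡ i
    id-lookup = lookup∘tabulate (λ i → i)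
    identity-supported : Supported [] zero identity
    identity-supported = (λ i → trans (cong (lookup identity) (id-lookup i)) (id-lookup i)) , (λ i _ → id-lookup i) ,
                         refl , (λ i moved → ⊥-elim (moved (id-lookup i)))
    only-identity : ∀ v → Supported [] zero v → v ≡ identity
    only-identity v (_ , out , _ , _) = Endo-ext (λ i → trans (out i refl) (sym (id-lookup i)))
  ⨁-supported-[] (suc f) = trans (⨁-cong Endos (λ v → nothing v (Supported? [] (suc f) v))) (⨁-false Endos)
    where
    nothing : ∀ v (p : Dec (Supported [] (suc f) v)) → ⌊ p ⌋ ≡ false
    nothing v (yes (_ , _ , () , _))
    nothing v (no _) = refl

  ⨁-supported : ∀ S f → Distinct (codes S) → ⨁ Endos (supported S f) ≡ matchings E (codes S) f
  ⨁-supported S f d = go (length S) S f ≤-refl d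
    where
    open ≡-Reasoning
    go : ∀ n S f → length S ≤ n → Distinct (codes S) → ⨁ Endos (supported S f) ≡ matchings E (codes S) f
    go n [] f _ _ = trans (⨁-supported-[] f) (sym (matchings-[] E f))
    go (suc n) (x ∷ S) f (s≤s le) (x∉ ∷ d) = begin
      ⨁ Endos (supported (x ∷ S) f)
        ≡⟨ ⨁-cong Endos (split-image x S (x∉ ∷ d) f) ⟩
      ⨁ Endos (λ v → ⨁ (codes (x ∷ S)) (λ z → (toℕ (lookup v x) ≡ᵇ z) ∧ supported (x ∷ S) f v))
        ≡⟨ ⨁-comm Endos (codes (x ∷ S)) (λ v z → (toℕ (lookup v x) ≡ᵇ z) ∧ supported (x ∷ S) f v) ⟩
      ⨁ Endos (λ v → (lookup v x ≡ᶠ x) ∧ supported (x ∷ S) f v) xor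
        ⨁ (codes S) (λ z → ⨁ Endos (λ v → (toℕ (lookup v x) ≡ᵇ z) ∧ supported (x ∷ S) f v))
        ≡⟨ cong₂ _xor_ x-fixed (trans (⨁-map toℕ S _) (trans (⨁-cong-∈ᶠ S x-moved) (sym (⨁-map toℕ S _)))) ⟩
      (z· matchings E (codes S)) f xor ⨁ (codes S) (λ z → E (toℕ x) z ∧ matchings E (remove z (codes S)) f)
        ≡⟨ sym (matchings-∷ E (toℕ x) (codes S) f) ⟩
      matchings E (codes (x ∷ S)) f ∎
      where
      ⨁-cong-∈ᶠ : ∀ S {g h : Fin m → Bool} → (∀ i → (i ∈ᶠ S) ≡ true → g i ≡ h i) → ⨁ S g ≡ ⨁ S h
      ⨁-cong-∈ᶠ [] e = refl
      ⨁-cong-∈ᶠ (i ∷ S) e = cong₂ _xor_ (e i (∈ᶠ-here i S)) (⨁-cong-∈ᶠ S (λ j j∈ → e j (∈ᶠ-there i S j∈)))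
      x-fixed : ⨁ Endos (λ v → (lookup v x ≡ᶠ x) ∧ supported (x ∷ S) f v) ≡ (z· matchings E (codes S)) f
      x-fixed = trans (⨁-cong Endos (fixed-step x S x∉ f))
        (trans (sym (z·-⨁ Endos (λ v g → supported S g v) f)) (z·-cong (λ g → go n S g le d) f))
      x-moved : ∀ y → (y ∈ᶠ S) ≡ true →
                ⨁ Endos (λ v → (lookup v x ≡ᶠ y) ∧ supported (x ∷ S) f v) ≡ E (toℕ x) (toℕ y) ∧ matchings E (remove (toℕ y) (codes S)) f
      x-moved y y∈ =
        trans (⨁-cong Endos (moved-step x y x≢y S x∉ y∈ d f))
          (trans (⨁-involution Endos (allVecs-Unique (allFin m) (Unique-allFin⁺ m) m) (allVecs-complete (allFin m) ∈-allFin m)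
                     (Exchange.exchange x y x≢y) (Exchange.exchange-involutive x y x≢y) (λ v → E (toℕ x) (toℕ y) ∧ supported (removeᶠ y S) f v))
            (trans (sym (∧-distribˡ-⨁ (E (toℕ x) (toℕ y)) Endos (supported (removeᶠ y S) f)))
              (cong (E (toℕ x) (toℕ y) ∧_) (trans (go n (removeᶠ y S) f length-removeᶠ d-removeᶠ)
                (cong (λ L → matchings E L f) (codes-removeᶠ y S))))))
        where
        x≢y : x ≢ y
        x≢y = ∈ᶠ-∉ᶠ⇒≢ S x∉ y∈
        length-removeᶠ : length (removeᶠ y S) ≤ n
        length-removeᶠ = ≤-trans (length-filter _ S) le
        d-removeᶠ : Distinct (codes (removeᶠ y S))
        d-removeᶠ = subst Distinct (sym (codes-removeᶠ y S)) (Distinct-filterᵇ _ d)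

-- The sets J and K and their graphs

bit : Bool → ℕ
bit true = 1
bit false = 0

odd-+ : ∀ a b → odd (a + b) ≡ odd a xor odd b
odd-+ zero b = refl
odd-+ (suc a) b rewrite odd-+ a b = not-distribˡ-xor (odd a) (odd b)

odd-double : ∀ k → odd (k + k) ≡ false
odd-double k rewrite odd-+ k k = xor-same (odd k)

%2≡bit-odd : ∀ n → n % 2 ≡ bit (odd n)
%2≡bit-odd zero = refl
%2≡bit-odd (suc zero) = refl
%2≡bit-odd (suc (suc n)) =
  trans (cong (_% 2) (+-comm 2 n)) (trans ([m+n]%n≡m%n n 2) (trans (%2≡bit-odd n) (cong bit (sym (not-involutive (odd n))))))

odd⇒%2≡1 : ∀ n → odd n ≡ true → n % 2 ≡ 1
odd⇒%2≡1 n o = trans (%2≡bit-odd n) (cong bit o)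

%2≡1⇒odd : ∀ n → n % 2 ≡ 1 → odd n ≡ true
%2≡1⇒odd n e = bit≡1 (trans (sym (%2≡bit-odd n)) e)
  where
  bit≡1 : ∀ {c} → bit c ≡ 1 → c ≡ true
  bit≡1 {true} _ = refl

⌊suc/2⌋ : ∀ n → ⌊ suc n /2⌋ ≡ ⌊ n /2⌋ + bit (odd n)
⌊suc/2⌋ zero = refl
⌊suc/2⌋ (suc zero) = refl
⌊suc/2⌋ (suc (suc n)) rewrite ⌊suc/2⌋ n | not-involutive (odd n) = refl

halves : ∀ n → n ≡ ⌊ n /2⌋ + ⌊ n /2⌋ + bit (odd n)
halves zero = refl
halves (suc zero) = refl
halves (suc (suc n)) rewrite not-involutive (odd n) =
  cong suc (trans (cong suc (halves n)) (cong (_+ bit (odd n)) (sym (+-suc ⌊ n /2⌋ ⌊ n /2⌋))))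

even⇒≡double : ∀ n → odd n ≡ false → n ≡ ⌊ n /2⌋ + ⌊ n /2⌋
even⇒≡double n e = trans (halves n) (trans (cong (λ b → ⌊ n /2⌋ + ⌊ n /2⌋ + bit b) e) (+-identityʳ _))

odd⇒≡suc-double : ∀ n → odd n ≡ true → n ≡ suc (⌊ n /2⌋ + ⌊ n /2⌋)
odd⇒≡suc-double n e = trans (halves n) (trans (cong (λ b → ⌊ n /2⌋ + ⌊ n /2⌋ + bit b) e) (+-comm _ 1))

⌊+/2⌋ : ∀ a b → ⌊ a + b /2⌋ ≡ ⌊ a /2⌋ + ⌊ b /2⌋ + bit (odd a ∧ odd b)
⌊+/2⌋ zero b = sym (+-identityʳ ⌊ b /2⌋)
⌊+/2⌋ (suc zero) b = ⌊suc/2⌋ b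
⌊+/2⌋ (suc (suc a)) b rewrite ⌊+/2⌋ a b | not-involutive (odd a) = refl

⌊+/2⌋-opposite : ∀ a b → odd a xor odd b ≡ true → ⌊ a + b /2⌋ ≡ ⌊ a /2⌋ + ⌊ b /2⌋
⌊+/2⌋-opposite a b e = trans (⌊+/2⌋ a b) (trans (cong (λ z → ⌊ a /2⌋ + ⌊ b /2⌋ + bit z) (both-odd (odd a) (odd b) e)) (+-identityʳ _))
  where
  both-odd : ∀ x y → x xor y ≡ true → x ∧ y ≡ false
  both-odd true false _ = refl
  both-odd false y _ = refl

⌊double/2⌋ : ∀ y → ⌊ y + y /2⌋ ≡ y
⌊double/2⌋ y = sym (n≡⌊n+n/2⌋ y)

⌊suc-double/2⌋ : ∀ y → ⌊ suc (y + y) /2⌋ ≡ y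
⌊suc-double/2⌋ y = trans (⌊suc/2⌋ (y + y)) (trans (cong (λ b → ⌊ y + y /2⌋ + bit b) (odd-double y)) (trans (+-identityʳ _) (⌊double/2⌋ y)))

double-injective : ∀ a b → a + a ≡ b + b → a ≡ b
double-injective a b e = trans (sym (⌊double/2⌋ a)) (trans (cong ⌊_/2⌋ e) (⌊double/2⌋ b))

suc-double≡2n+1 : ∀ n → suc (n + n) ≡ 2 * n + 1
suc-double≡2n+1 = solve-∀

odd-2n+1 : ∀ n → odd (2 * n + 1) ≡ true
odd-2n+1 n = subst (λ z → odd z ≡ true) (suc-double≡2n+1 n) (cong not (odd-double n))

*2^suc : ∀ x e → x * 2 ^ suc e ≡ x * 2 ^ e + x * 2 ^ e
*2^suc x e = trans (cong (x *_) (cong (2 ^ e +_) (+-identityʳ (2 ^ e)))) (*-distribˡ-+ x (2 ^ e) (2 ^ e))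

double+1 : ∀ k → suc (k + k) + 1 ≡ (k + 1) + (k + 1)
double+1 = solve-∀

odd-*2^suc : ∀ x e → odd (x * 2 ^ suc e) ≡ false
odd-*2^suc x e = subst (λ z → odd z ≡ false) (sym (*2^suc x e)) (odd-double (x * 2 ^ e))

J-double : ∀ k → J (k + k)
J-double k = k , 0 , trans (trans (+-comm (k + k) 1) (suc-double≡2n+1 k)) (sym (*-identityʳ _))

K-double : ∀ k → K (k + k) → ⊥
K-double k (n , e , eq) with () ← trans (sym (cong not (odd-double k)))
  (trans (cong odd (trans (+-comm 1 (k + k)) eq)) (trans (cong (λ z → odd ((2 * n + 1) * 2 ^ z)) (+-comm (2 * e) 1)) (odd-*2^suc (2 * n + 1) (2 * e))))

J-suc-double→K : ∀ k → J (suc (k + k)) → K k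
J-suc-double→K k (n , zero , eq) with () ← trans (sym (odd-double (k + 1)))
  (trans (cong odd (trans (sym (double+1 k)) eq)) (trans (cong odd (*-identityʳ (2 * n + 1))) (odd-2n+1 n)))
J-suc-double→K k (n , suc e , eq) = n , e , double-injective (k + 1) _ (trans (sym (double+1 k)) (trans eq
  (trans (cong (λ z → (2 * n + 1) * 2 ^ z) (trans (*-suc 2 e) (cong suc (+-comm 1 (2 * e)))))
    (*2^suc (2 * n + 1) (2 * e + 1)))))

K→J-suc-double : ∀ k → K k → J (suc (k + k))
K→J-suc-double k (n , e , eq) = n , suc e , trans (double+1 k) (trans (cong₂ _+_ eq eq)
  (trans (sym (*2^suc (2 * n + 1) (2 * e + 1)))
    (cong (λ z → (2 * n + 1) * 2 ^ z) (sym (trans (*-suc 2 e) (cong suc (+-comm 1 (2 * e))))))))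

K-suc-double→J : ∀ k → K (suc (k + k)) → J k
K-suc-double→J k (n , e , eq) = n , e , double-injective (k + 1) _ (trans (sym (double+1 k)) (trans eq
  (trans (cong (λ z → (2 * n + 1) * 2 ^ z) (+-comm (2 * e) 1)) (*2^suc (2 * n + 1) (2 * e)))))

J→K-suc-double : ∀ k → J k → K (suc (k + k))
J→K-suc-double k (n , e , eq) = n , e , trans (double+1 k) (trans (cong₂ _+_ eq eq)
  (trans (sym (*2^suc (2 * n + 1) (2 * e))) (cong (λ z → (2 * n + 1) * 2 ^ z) (+-comm 1 (2 * e)))))

-- Kept opaque so that the bounded searches J? and K? are never unfolded.
opaque
  jᵇ kᵇ : ℕ → Bool
  jᵇ n = ⌊ J? n ⌋
  kᵇ n = ⌊ K? n ⌋

  jᵇ-def : ∀ n → jᵇ n ≡ ⌊ J? n ⌋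
  jᵇ-def n = refl

  kᵇ-def : ∀ n → kᵇ n ≡ ⌊ K? n ⌋
  kᵇ-def n = refl

  kᵇ-double : ∀ k → kᵇ (k + k) ≡ false
  kᵇ-double k = ⌊ K? (k + k) ⌋-no (K-double k)

  kᵇ-suc-double : ∀ k → kᵇ (suc (k + k)) ≡ jᵇ k
  kᵇ-suc-double k = ⌊⌋-cong (K? (suc (k + k))) (J? k) (K-suc-double→J k) (J→K-suc-double k)

  jᵇ-double : ∀ k → jᵇ (k + k) ≡ true
  jᵇ-double k = ⌊ J? (k + k) ⌋-yes (J-double k)

  jᵇ-suc-double : ∀ k → jᵇ (suc (k + k)) ≡ kᵇ k
  jᵇ-suc-double k = ⌊⌋-cong (J? (suc (k + k))) (K? k) (J-suc-double→K k) (K→J-suc-double k)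

kᵇ-half : ∀ n → kᵇ n ≡ odd n ∧ jᵇ ⌊ n /2⌋
kᵇ-half n with odd n in e
... | true = trans (cong kᵇ (odd⇒≡suc-double n e)) (kᵇ-suc-double ⌊ n /2⌋)
... | false = trans (cong kᵇ (even⇒≡double n e)) (kᵇ-double ⌊ n /2⌋)

jᵇ-half : ∀ n → jᵇ n ≡ not (odd n) ∨ kᵇ ⌊ n /2⌋
jᵇ-half n with odd n in e
... | true = trans (cong jᵇ (odd⇒≡suc-double n e)) (jᵇ-suc-double ⌊ n /2⌋)
... | false = trans (cong jᵇ (even⇒≡double n e)) (jᵇ-double ⌊ n /2⌋)

sumGraph : (ℕ → Bool) → Graph
sumGraph b x y = b (x + y) ∧ odd (x + y)

sumGraph-sym : ∀ b x y → sumGraph b x y ≡ sumGraph b y x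
sumGraph-sym b x y rewrite +-comm x y = refl

even : ℕ → Bool
even n = not (odd n)

sumGraph-bipartite : ∀ b x y → sumGraph b x y ≡ true → even y ≡ not (even x)
sumGraph-bipartite b x y h with b (x + y) | odd x in ox | odd y in oy
... | false | _ | _ with () ← h
... | true | true | true with () ← trans (sym h) (trans (odd-+ x y) (cong₂ _xor_ ox oy))
... | true | false | false with () ← trans (sym h) (trans (odd-+ x y) (cong₂ _xor_ ox oy))
... | true | true | false = refl
... | true | false | true = refl

Jgraph Kgraph : Graph
Jgraph = sumGraph jᵇ
Kgraph = sumGraph kᵇ

Jgraph-half : ∀ x y → Jgraph x y ≡ (odd x xor odd y) ∧ kᵇ (⌊ x /2⌋ + ⌊ y /2⌋)
Jgraph-half x y rewrite odd-+ x y with odd x xor odd y in e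
... | false = ∧-zeroʳ _
... | true rewrite jᵇ-half (x + y) | odd-+ x y | e | ⌊+/2⌋-opposite x y e = ∧-identityʳ _

Kgraph-half : ∀ x y → Kgraph x y ≡ (odd x xor odd y) ∧ jᵇ (⌊ x /2⌋ + ⌊ y /2⌋)
Kgraph-half x y rewrite odd-+ x y with odd x xor odd y in e
... | false = ∧-zeroʳ _
... | true rewrite kᵇ-half (x + y) | odd-+ x y | e | ⌊+/2⌋-opposite x y e = ∧-identityʳ _

-- The residues 0 and 3 modulo 4, read off the two lowest binary digits.
class03 : ℕ → Bool
class03 u = not (odd u xor odd ⌊ u /2⌋)

same-class⇒xor : ∀ x y → class03 x ≡ class03 y → odd x xor odd y ≡ odd ⌊ x /2⌋ xor odd ⌊ y /2⌋
same-class⇒xor x y h = xor-exchange (odd x) (odd ⌊ x /2⌋) (odd y) (odd ⌊ y /2⌋) (not-injective h)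

other-class⇒xor : ∀ x y → class03 x ≡ not (class03 y) → odd x xor odd y ≡ not (odd ⌊ x /2⌋ xor odd ⌊ y /2⌋)
other-class⇒xor x y h = trans (xor-exchange (odd x) (odd ⌊ x /2⌋) (odd y) (not (odd ⌊ y /2⌋))
  (trans (not-injective h) (not-distribʳ-xor (odd y) (odd ⌊ y /2⌋))))
  (sym (not-distribʳ-xor (odd ⌊ x /2⌋) (odd ⌊ y /2⌋)))

Jgraph-within : ∀ x y → class03 x ≡ class03 y → Jgraph x y ≡ Kgraph ⌊ x /2⌋ ⌊ y /2⌋
Jgraph-within x y h = begin
  Jgraph x y                                          ≡⟨ Jgraph-half x y ⟩
  (odd x xor odd y) ∧ kᵇ (hx + hy)                    ≡⟨ cong (_∧ kᵇ (hx + hy)) (same-class⇒xor x y h) ⟩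
  (odd hx xor odd hy) ∧ kᵇ (hx + hy)                  ≡⟨ ∧-guard (odd hx xor odd hy) halve ⟩
  (odd hx xor odd hy) ∧ jᵇ (⌊ hx /2⌋ + ⌊ hy /2⌋)      ≡⟨ sym (Kgraph-half hx hy) ⟩
  Kgraph hx hy                                        ∎
  where
  open ≡-Reasoning
  hx = ⌊ x /2⌋
  hy = ⌊ y /2⌋
  halve : odd hx xor odd hy ≡ true → kᵇ (hx + hy) ≡ jᵇ (⌊ hx /2⌋ + ⌊ hy /2⌋)
  halve o = trans (kᵇ-half (hx + hy)) (cong₂ _∧_ (trans (odd-+ hx hy) o) (cong jᵇ (⌊+/2⌋-opposite hx hy o)))

Kgraph-within : ∀ x y → class03 x ≡ class03 y → Kgraph x y ≡ Jgraph ⌊ x /2⌋ ⌊ y /2⌋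
Kgraph-within x y h = begin
  Kgraph x y                                          ≡⟨ Kgraph-half x y ⟩
  (odd x xor odd y) ∧ jᵇ (hx + hy)                    ≡⟨ cong (_∧ jᵇ (hx + hy)) (same-class⇒xor x y h) ⟩
  (odd hx xor odd hy) ∧ jᵇ (hx + hy)                  ≡⟨ ∧-guard (odd hx xor odd hy) halve ⟩
  (odd hx xor odd hy) ∧ kᵇ (⌊ hx /2⌋ + ⌊ hy /2⌋)      ≡⟨ sym (Jgraph-half hx hy) ⟩
  Jgraph hx hy                                        ∎
  where
  open ≡-Reasoning
  hx = ⌊ x /2⌋
  hy = ⌊ y /2⌋
  halve : odd hx xor odd hy ≡ true → jᵇ (hx + hy) ≡ kᵇ (⌊ hx /2⌋ + ⌊ hy /2⌋)
  halve o = trans (jᵇ-half (hx + hy)) (cong₂ _∨_ (cong not (trans (odd-+ hx hy) o)) (cong kᵇ (⌊+/2⌋-opposite hx hy o)))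

Jgraph-across : ∀ x y → class03 x ≡ not (class03 y) → Jgraph x y ≡ false
Jgraph-across x y h =
  trans (Jgraph-half x y)
    (trans (cong₂ _∧_ (other-class⇒xor x y h) (trans (kᵇ-half (hx + hy)) (cong (_∧ jᵇ ⌊ hx + hy /2⌋) (odd-+ hx hy))))
      (contradiction (odd hx xor odd hy)))
  where
  hx = ⌊ x /2⌋
  hy = ⌊ y /2⌋
  contradiction : ∀ a {b} → not a ∧ (a ∧ b) ≡ false
  contradiction true = refl
  contradiction false = refl

Kgraph-across : ∀ x y → class03 x ≡ not (class03 y) → Kgraph x y ≡ odd x xor odd y
Kgraph-across x y h =
  trans (Kgraph-half x y)
    (trans (cong₂ _∧_ (other-class⇒xor x y h) (trans (jᵇ-half (hx + hy)) (cong (λ o → not o ∨ kᵇ ⌊ hx + hy /2⌋) (odd-+ hx hy))))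
      (trans (∧-abs-∨ (not (odd hx xor odd hy)) _) (sym (other-class⇒xor x y h))))
  where
  hx = ⌊ x /2⌋
  hy = ⌊ y /2⌋

≡0mod4 ≡1mod4 ≡2mod4 ≡3mod4 : ℕ → Bool
≡0mod4 u = not (odd u) ∧ not (odd ⌊ u /2⌋)
≡1mod4 u = odd u ∧ not (odd ⌊ u /2⌋)
≡2mod4 u = not (odd u) ∧ odd ⌊ u /2⌋
≡3mod4 u = odd u ∧ odd ⌊ u /2⌋

Kgraph₀ : Graph
Kgraph₀ x y = not (class03 x xor class03 y) ∧ Kgraph x y

within-class : ∀ k → k ≡ (k xor false) xor false
within-class k = sym (trans (xor-identityʳ _) (xor-identityʳ k))

-- a b are the two lowest binary digits of x, c d those of y, and k the K-edge between them.
residue-decomposition : ∀ a b c d k → (not (a xor b) ≡ not (not (c xor d)) → k ≡ a xor c) →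
  k ≡ ((not (not (a xor b) xor not (c xor d)) ∧ k) xor
        (((not a ∧ not b) ∧ (c ∧ not d)) xor ((a ∧ not b) ∧ (not c ∧ not d)))) xor
      (((not a ∧ b) ∧ (c ∧ d)) xor ((a ∧ b) ∧ (not c ∧ d)))
residue-decomposition false false false false k _ = within-class k
residue-decomposition false false true true k _ = within-class k
residue-decomposition false true false true k _ = within-class k
residue-decomposition false true true false k _ = within-class k
residue-decomposition true false false true k _ = within-class k
residue-decomposition true false true false k _ = within-class k
residue-decomposition true true false false k _ = within-class k
residue-decomposition true true true true k _ = within-class k
residue-decomposition false false false true k across = across refl
residue-decomposition false false true false k across = across refl
residue-decomposition false true false false k across = across refl
residue-decomposition false true true true k across = across refl
residue-decomposition true false false false k across = across refl
residue-decomposition true false true true k across = across refl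
residue-decomposition true true false true k across = across refl
residue-decomposition true true true false k across = across refl

-- Between the two classes x + y ≡ 1 (mod 4), so every odd sum lies in K: these edges form two bicliques.
Kgraph-decomposition : ∀ x y →
  Kgraph x y ≡ (Kgraph₀ x y xor biclique ≡0mod4 ≡1mod4 x y) xor biclique ≡2mod4 ≡3mod4 x y
Kgraph-decomposition x y =
  residue-decomposition (odd x) (odd ⌊ x /2⌋) (odd y) (odd ⌊ y /2⌋) (Kgraph x y) (Kgraph-across x y)

-- Graphs with two sides joined by two bicliques

⨁-restrict : ∀ (p P : ℕ → Bool) → (∀ u → P u ≡ true → p u ≡ true) → ∀ xs (g : ℕ → Bool) →
             ⨁ xs (λ u → P u ∧ g u) ≡ ⨁ (filterᵇ p xs) (λ u → P u ∧ g u)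
⨁-restrict p P P⊆p xs g = trans (⨁-cong xs inside) (sym (⨁-filterᵇ p xs _))
  where
  inside : ∀ u → P u ∧ g u ≡ p u ∧ (P u ∧ g u)
  inside u with P u in Pu
  ... | false = sym (∧-zeroʳ (p u))
  ... | true rewrite P⊆p u Pu = refl

⨁²-⊛ : ∀ (p P Q : ℕ → Bool) → (∀ u → P u ≡ true → p u ≡ true) → (∀ w → Q w ≡ true → not (p w) ≡ true) →
        ∀ xs (F G : ℕ → Series) f →
        ⨁ xs (λ u → P u ∧ ⨁ xs (λ w → Q w ∧ (F u ⊛ G w) f)) ≡
        ((λ k → ⨁ (filterᵇ p xs) (λ u → P u ∧ F u k)) ⊛ (λ k → ⨁ (filterᵇ (not ∘ p) xs) (λ w → Q w ∧ G w k))) f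
⨁²-⊛ p P Q P⊆p Q⊆¬p xs F G f =
  trans (⨁-restrict p P P⊆p xs _)
    (trans (⨁-cong (filterᵇ p xs) (λ u → cong (P u ∧_) (⨁-restrict (not ∘ p) Q Q⊆¬p xs _)))
      (sym (trans (⨁-⊛ˡ (filterᵇ p xs) (λ u k → P u ∧ F u k) G′ f)
        (⨁-cong (filterᵇ p xs) (λ u → trans (∧-⊛ˡ (P u) (F u) G′ f) (cong (P u ∧_)
          (trans (⨁-⊛ʳ (filterᵇ (not ∘ p) xs) (F u) (λ w k → Q w ∧ G w k) f)
            (⨁-cong (filterᵇ (not ∘ p) xs) (λ w → ∧-⊛ʳ (Q w) (F u) (G w) f)))))))))
  where
  G′ : Series
  G′ k = ⨁ (filterᵇ (not ∘ p) xs) (λ w → Q w ∧ G w k)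

filterᵇ-remove : ∀ p a xs → filterᵇ p (remove a xs) ≡ remove a (filterᵇ p xs)
filterᵇ-remove p a xs = filterᵇ-comm p _ xs

remove-rejected : ∀ p a xs → p a ≡ false → remove a (filterᵇ p xs) ≡ filterᵇ p xs
remove-rejected p a xs pa = remove-∉ᵇ a (filterᵇ p xs) (∉ᵇ-filterᵇ-rejected p xs pa)

⨁-matchings∖₁ : ∀ E (P Q : ℕ → Bool) → (∀ u → P u ∧ Q u ≡ false) → ∀ xs f →
                ⨁ xs (λ w → Q w ∧ matchings∖₁ E P (remove w xs) f) ≡ matchings∖₂ E P Q xs f
⨁-matchings∖₁ E P Q disjoint xs f =
  trans (⨁-∧-remove-comm xs Q P (λ w u → matchings E (remove u (remove w xs)) f))
    (⨁-cong xs (λ u → ∧-guard (P u) (λ Pu → trans (⨁-remove u xs _) (⨁-cong xs (λ w → same w Pu)))))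
  where
  same : ∀ {u} w → P u ≡ true →
         not (w ≡ᵇ u) ∧ (Q w ∧ matchings E (remove u (remove w xs)) f) ≡ Q w ∧ matchings E (remove w (remove u xs)) f
  same {u} w Pu with w ≡ᵇ u in e
  ... | false = cong (λ L → Q w ∧ matchings E L f) (remove-comm u w xs)
  ... | true rewrite ≡ᵇ⇒≡ w u e with Q u in Qu
  ...   | false = refl
  ...   | true with () ← trans (sym (cong₂ _∧_ Pu Qu)) (disjoint u)

module _ (E₀ : Graph) (p : ℕ → Bool) (across : ∀ x y → p x ≡ not (p y) → E₀ x y ≡ false)
         (P₀ P₁ P₂ P₃ : ℕ → Bool)
         (P₀⊆p : ∀ u → P₀ u ≡ true → p u ≡ true) (P₁⊆¬p : ∀ u → P₁ u ≡ true → not (p u) ≡ true)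
         (P₂⊆¬p : ∀ u → P₂ u ≡ true → not (p u) ≡ true) (P₃⊆p : ∀ u → P₃ u ≡ true → p u ≡ true)
         (P₀∩P₃ : ∀ u → P₀ u ∧ P₃ u ≡ false) (P₁∩P₂ : ∀ u → P₁ u ∧ P₂ u ≡ false) where

  private
    M : List ℕ → Series
    M = matchings E₀

    L⁺ L⁻ : List ℕ → List ℕ
    L⁺ = filterᵇ p
    L⁻ = filterᵇ (not ∘ p)

    disjoint : ∀ (P Q : ℕ → Bool) → (∀ u → P u ≡ true → p u ≡ true) → (∀ u → Q u ≡ true → not (p u) ≡ true) →
               ∀ u → P u ∧ Q u ≡ false
    disjoint P Q P⊆p Q⊆¬p u with P u in Pu | Q u in Qu
    ... | false | _ = refl
    ... | true | false = refl
    ... | true | true with () ← trans (cong not (sym (P⊆p u Pu))) (Q⊆¬p u Qu)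

    P₀∩P₁ : ∀ u → P₀ u ∧ P₁ u ≡ false
    P₀∩P₁ = disjoint P₀ P₁ P₀⊆p P₁⊆¬p

    P₂∩P₃ : ∀ u → P₂ u ∧ P₃ u ≡ false
    P₂∩P₃ u = trans (∧-comm (P₂ u) (P₃ u)) (disjoint P₃ P₂ P₃⊆p P₂⊆¬p u)

    ¬p⇒false : ∀ {u} → not (p u) ≡ true → p u ≡ false
    ¬p⇒false = not≡true

    M-split : ∀ xs f → M xs f ≡ (M (L⁺ xs) ⊛ M (L⁻ xs)) f
    M-split = matchings-split E₀ p across

  matchings-remove-across : ∀ xs u w f → p u ≡ true → p w ≡ false →
    M (remove w (remove u xs)) f ≡ (M (remove u (L⁺ xs)) ⊛ M (remove w (L⁻ xs))) f
  matchings-remove-across xs u w f pu pw = trans (M-split (remove w (remove u xs)) f)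
    (cong₂ (λ L L′ → (M L ⊛ M L′) f)
      (trans (filterᵇ-remove p w (remove u xs)) (trans (cong (remove w) (filterᵇ-remove p u xs)) (remove-rejected′ pw)))
      (trans (filterᵇ-remove (not ∘ p) w (remove u xs)) (cong (remove w)
        (trans (filterᵇ-remove (not ∘ p) u xs) (remove-rejected (not ∘ p) u xs (cong not pu))))))
    where
    remove-rejected′ : p w ≡ false → remove w (remove u (L⁺ xs)) ≡ remove u (L⁺ xs)
    remove-rejected′ pw = remove-∉ᵇ w (remove u (L⁺ xs)) (∉ᵇ-filterᵇ _ (L⁺ xs) (∉ᵇ-filterᵇ-rejected p xs pw))

  matchings∖₂-⊛ : ∀ (P Q : ℕ → Bool) → (∀ u → P u ≡ true → p u ≡ true) → (∀ u → Q u ≡ true → not (p u) ≡ true) →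
                  ∀ xs f → matchings∖₂ E₀ P Q xs f ≡ (matchings∖₁ E₀ P (L⁺ xs) ⊛ matchings∖₁ E₀ Q (L⁻ xs)) f
  matchings∖₂-⊛ P Q P⊆p Q⊆¬p xs f =
    trans (⨁-cong xs (λ u → ∧-guard (P u) (λ Pu → ⨁-cong xs (λ w → ∧-guard (Q w) (λ Qw →
             matchings-remove-across xs u w f (P⊆p u Pu) (¬p⇒false (Q⊆¬p w Qw)))))))
      (⨁²-⊛ p P Q P⊆p Q⊆¬p xs (λ u k → M (remove u (L⁺ xs)) k) (λ w k → M (remove w (L⁻ xs)) k) f)

  matchings-two-bicliques : ∀ xs f → Distinct xs →
    matchings (λ x y → (E₀ x y xor biclique P₀ P₁ x y) xor biclique P₂ P₃ x y) xs f ≡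
      ((M (L⁺ xs) ⊛ M (L⁻ xs)) f xor (matchings∖₁ E₀ P₀ (L⁺ xs) ⊛ matchings∖₁ E₀ P₁ (L⁻ xs)) f) xor
      ((matchings∖₁ E₀ P₃ (L⁺ xs) ⊛ matchings∖₁ E₀ P₂ (L⁻ xs)) f xor
       (matchings∖₂ E₀ P₀ P₃ (L⁺ xs) ⊛ matchings∖₂ E₀ P₁ P₂ (L⁻ xs)) f)
  matchings-two-bicliques xs f d = begin
    matchings E xs f
      ≡⟨ matchings-biclique E₁ P₂ P₃ P₂∩P₃ xs f d ⟩
    matchings E₁ xs f xor matchings∖₂ E₁ P₂ P₃ xs f
      ≡⟨ cong₂ _xor_ (trans (matchings-biclique E₀ P₀ P₁ P₀∩P₁ xs f d)
                        (cong₂ _xor_ (M-split xs f) (matchings∖₂-⊛ P₀ P₁ P₀⊆p P₁⊆¬p xs f)))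
           (trans (⨁-cong xs (λ u → cong (P₂ u ∧_) (⨁-cong-∈ᵇ xs (λ w w∈ → cong (P₃ w ∧_) (inner u w)))))
             (⨁²-distrib-xor _ _)) ⟩
    ((M (L⁺ xs) ⊛ M (L⁻ xs)) f xor (matchings∖₁ E₀ P₀ (L⁺ xs) ⊛ matchings∖₁ E₀ P₁ (L⁻ xs)) f) xor
      (matchings∖₂ E₀ P₂ P₃ xs f xor ⨁ xs (λ u → P₂ u ∧ ⨁ xs (λ w → P₃ w ∧ R₀₁ (remove w (remove u xs)) f)))
      ≡⟨ cong (((M (L⁺ xs) ⊛ M (L⁻ xs)) f xor (matchings∖₁ E₀ P₀ (L⁺ xs) ⊛ matchings∖₁ E₀ P₁ (L⁻ xs)) f) xor_)
           (cong₂ _xor_ (trans (matchings∖₂-comm E₀ P₂ P₃ xs f) (matchings∖₂-⊛ P₃ P₂ P₃⊆p P₂⊆¬p xs f))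
                                      double-deletion) ⟩
    ((M (L⁺ xs) ⊛ M (L⁻ xs)) f xor (matchings∖₁ E₀ P₀ (L⁺ xs) ⊛ matchings∖₁ E₀ P₁ (L⁻ xs)) f) xor
      ((matchings∖₁ E₀ P₃ (L⁺ xs) ⊛ matchings∖₁ E₀ P₂ (L⁻ xs)) f xor
       (matchings∖₂ E₀ P₀ P₃ (L⁺ xs) ⊛ matchings∖₂ E₀ P₁ P₂ (L⁻ xs)) f) ∎
    where
    open ≡-Reasoning
    E₁ E : Graph
    E₁ x y = E₀ x y xor biclique P₀ P₁ x y
    E x y = E₁ x y xor biclique P₂ P₃ x y
    R₀₁ : List ℕ → Series
    R₀₁ = matchings∖₂ E₀ P₀ P₁
    inner : ∀ u w → matchings E₁ (remove w (remove u xs)) f ≡ M (remove w (remove u xs)) f xor R₀₁ (remove w (remove u xs)) f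
    inner u w = matchings-biclique E₀ P₀ P₁ P₀∩P₁ (remove w (remove u xs)) f (Distinct-filterᵇ _ (Distinct-filterᵇ _ d))
    ⨁²-distrib-xor : ∀ (g h : ℕ → ℕ → Bool) →
      ⨁ xs (λ u → P₂ u ∧ ⨁ xs (λ w → P₃ w ∧ (g u w xor h u w))) ≡
      ⨁ xs (λ u → P₂ u ∧ ⨁ xs (λ w → P₃ w ∧ g u w)) xor ⨁ xs (λ u → P₂ u ∧ ⨁ xs (λ w → P₃ w ∧ h u w))
    ⨁²-distrib-xor g h =
      trans (⨁-cong xs (λ u → trans (cong (P₂ u ∧_) (trans (⨁-cong xs (λ w → ∧-distribˡ-xor (P₃ w) _ _)) (⨁-xor xs _ _)))
                                (∧-distribˡ-xor (P₂ u) _ _)))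
        (⨁-xor xs _ _)
    double-deletion : ⨁ xs (λ u → P₂ u ∧ ⨁ xs (λ w → P₃ w ∧ R₀₁ (remove w (remove u xs)) f)) ≡
                      (matchings∖₂ E₀ P₀ P₃ (L⁺ xs) ⊛ matchings∖₂ E₀ P₁ P₂ (L⁻ xs)) f
    double-deletion =
      trans (⨁-cong xs (λ u → ∧-guard (P₂ u) (λ P₂u → ⨁-cong xs (λ w → ∧-guard (P₃ w) (λ P₃w →
               trans (matchings∖₂-⊛ P₀ P₁ P₀⊆p P₁⊆¬p (remove w (remove u xs)) f)
                 (cong₂ (λ L L′ → (matchings∖₁ E₀ P₀ L ⊛ matchings∖₁ E₀ P₁ L′) f)
                    (trans (filterᵇ-remove p w (remove u xs)) (cong (remove w)
                      (trans (filterᵇ-remove p u xs) (remove-rejected p u xs (¬p⇒false (P₂⊆¬p u P₂u))))))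
                    (trans (filterᵇ-remove (not ∘ p) w (remove u xs))
                      (trans (cong (remove w) (filterᵇ-remove (not ∘ p) u xs))
                        (remove-∉ᵇ w (remove u (L⁻ xs)) (∉ᵇ-filterᵇ _ (L⁻ xs)
                          (∉ᵇ-filterᵇ-rejected (not ∘ p) xs (cong not (P₃⊆p w P₃w)))))))))))))
      (trans (⨁²-swap xs P₂ P₃ (λ u w → (matchings∖₁ E₀ P₀ (remove w (L⁺ xs)) ⊛ matchings∖₁ E₀ P₁ (remove u (L⁻ xs))) f))
      (trans (⨁²-⊛ p P₃ P₂ P₃⊆p P₂⊆¬p xs (λ w k → matchings∖₁ E₀ P₀ (remove w (L⁺ xs)) k) (λ u k → matchings∖₁ E₀ P₁ (remove u (L⁻ xs)) k) f)
        (⊛-cong (λ k → ⨁-matchings∖₁ E₀ P₀ P₃ P₀∩P₃ (L⁺ xs) k) (λ k → ⨁-matchings∖₁ E₀ P₁ P₂ P₁∩P₂ (L⁻ xs) k) f)))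

-- Halving the J- and K-graphs

filterᵇ-upTo-suc : ∀ p n → filterᵇ p (upTo (suc n)) ≡ filterᵇ p (upTo n) ++ filterᵇ p [ n ]
filterᵇ-upTo-suc p n = trans (cong (filterᵇ p) (sym (upTo-∷ʳ n))) (filter-++ (T? ∘ p) (upTo n) [ n ])

count-upTo-suc : ∀ p n → count p (upTo (suc n)) ≡ count p (upTo n) + bit (p n)
count-upTo-suc p n = trans (cong length (filterᵇ-upTo-suc p n)) (trans (length-++ (filterᵇ p (upTo n))) (cong (count p (upTo n) +_) (singleton (p n) refl)))
  where
  singleton : ∀ b → p n ≡ b → length (filterᵇ p [ n ]) ≡ bit (p n)
  singleton true e rewrite e = refl
  singleton false e rewrite e = refl

odd-⌊suc/2⌋ : ∀ n → odd ⌊ suc n /2⌋ ≡ odd ⌊ n /2⌋ xor odd n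
odd-⌊suc/2⌋ n rewrite ⌊suc/2⌋ n | odd-+ ⌊ n /2⌋ (bit (odd n)) with odd n
... | true = refl
... | false = refl

n₀₃ n₁₂ : ℕ → ℕ
n₀₃ n = count class03 (upTo n)
n₁₂ n = count (not ∘ class03) (upTo n)

regroup : ∀ h {a b c d} → a + b ≡ c + d → h + a + b ≡ h + c + d
regroup h {a} {b} {c} {d} e = trans (+-assoc h a b) (trans (cong (h +_) e) (sym (+-assoc h c d)))

n₀₃-formula : ∀ n → n₀₃ n ≡ ⌊ n /2⌋ + bit (odd n ∧ not (odd ⌊ n /2⌋))
n₀₃-formula zero = refl
n₀₃-formula (suc n) rewrite count-upTo-suc class03 n | n₀₃-formula n | odd-⌊suc/2⌋ n | ⌊suc/2⌋ n
  with odd n | odd ⌊ n /2⌋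
... | true | true = regroup ⌊ n /2⌋ refl
... | true | false = regroup ⌊ n /2⌋ refl
... | false | true = regroup ⌊ n /2⌋ refl
... | false | false = regroup ⌊ n /2⌋ refl

n₁₂-formula : ∀ n → n₁₂ n ≡ ⌊ n /2⌋ + bit (odd n ∧ odd ⌊ n /2⌋)
n₁₂-formula zero = refl
n₁₂-formula (suc n) rewrite count-upTo-suc (not ∘ class03) n | n₁₂-formula n | odd-⌊suc/2⌋ n | ⌊suc/2⌋ n
  with odd n | odd ⌊ n /2⌋
... | true | true = regroup ⌊ n /2⌋ refl
... | true | false = regroup ⌊ n /2⌋ refl
... | false | true = regroup ⌊ n /2⌋ refl
... | false | false = regroup ⌊ n /2⌋ refl

halves-upTo : ∀ p → (∀ n → p n ≡ true → ⌊ n /2⌋ ≡ count p (upTo n)) →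
              ∀ n → map ⌊_/2⌋ (filterᵇ p (upTo n)) ≡ upTo (count p (upTo n))
halves-upTo p next zero = refl
halves-upTo p next (suc n) =
  trans (cong (map ⌊_/2⌋) (filterᵇ-upTo-suc p n))
    (trans (map-++ ⌊_/2⌋ (filterᵇ p (upTo n)) _) (trans (cong (_++ map ⌊_/2⌋ (filterᵇ p [ n ])) (halves-upTo p next n)) (last (p n) refl)))
  where
  last : ∀ b → p n ≡ b → upTo (count p (upTo n)) ++ map ⌊_/2⌋ (filterᵇ p [ n ]) ≡ upTo (count p (upTo (suc n)))
  last true e rewrite count-upTo-suc p n | e | next n e | +-comm (count p (upTo n)) 1 = upTo-∷ʳ (count p (upTo n))
  last false e rewrite count-upTo-suc p n | e | +-identityʳ (count p (upTo n)) = ++-identityʳ _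

halves-upTo₀₃ : ∀ n → map ⌊_/2⌋ (filterᵇ class03 (upTo n)) ≡ upTo (n₀₃ n)
halves-upTo₀₃ = halves-upTo class03 λ n c → sym (trans (n₀₃-formula n) (trans (cong (λ b → ⌊ n /2⌋ + bit b) (vanish (odd n) (odd ⌊ n /2⌋) c)) (+-identityʳ _)))
  where
  vanish : ∀ a b → not (a xor b) ≡ true → a ∧ not b ≡ false
  vanish true true _ = refl
  vanish false b _ = refl

halves-upTo₁₂ : ∀ n → map ⌊_/2⌋ (filterᵇ (not ∘ class03) (upTo n)) ≡ upTo (n₁₂ n)
halves-upTo₁₂ = halves-upTo (not ∘ class03) λ n c → sym (trans (n₁₂-formula n) (trans (cong (λ b → ⌊ n /2⌋ + bit b) (vanish (odd n) (odd ⌊ n /2⌋) c)) (+-identityʳ _)))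
  where
  vanish : ∀ a b → not (not (a xor b)) ≡ true → a ∧ b ≡ false
  vanish true false _ = refl
  vanish false b _ = refl

-- Within a class the parity of u is determined by that of ⌊ u /2⌋.
⌊/2⌋-injective-on-class : ∀ a b → class03 a ≡ class03 b → ⌊ a /2⌋ ≡ ⌊ b /2⌋ → a ≡ b
⌊/2⌋-injective-on-class a b same e = trans (halves a) (trans (cong₂ (λ h o → h + h + bit o) e odd-eq) (sym (halves b)))
  where
  odd-eq : odd a ≡ odd b
  odd-eq = xor≡false⇒≡ (trans (same-class⇒xor a b same) (trans (cong (λ h → h xor odd ⌊ b /2⌋) (cong odd e)) (xor-same (odd ⌊ b /2⌋))))

private
  same-class₀₃ : ∀ x y → class03 x ≡ true → class03 y ≡ true → class03 x ≡ class03 y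
  same-class₀₃ x y cx cy = trans cx (sym cy)

  same-class₁₂ : ∀ x y → not (class03 x) ≡ true → not (class03 y) ≡ true → class03 x ≡ class03 y
  same-class₁₂ x y cx cy = not-injective (trans cx (sym cy))

-- A J-edge joins two vertices of the same class and is a K-edge between their halves.
Jgraph-split : ∀ n f → matchings Jgraph (upTo n) f ≡ (matchings Kgraph (upTo (n₀₃ n)) ⊛ matchings Kgraph (upTo (n₁₂ n))) f
Jgraph-split n f = trans (matchings-split Jgraph class03 Jgraph-across (upTo n) f)
  (⊛-cong (λ k → trans (matchings-relabel class03 ⌊_/2⌋ (λ a b ca cb → ⌊/2⌋-injective-on-class a b (same-class₀₃ a b ca cb))
                          Jgraph Kgraph (λ x y cx cy → Jgraph-within x y (same-class₀₃ x y cx cy)) _ k (Allᵇ-filterᵇ-self class03 (upTo n)))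
                   (cong (λ L → matchings Kgraph L k) (halves-upTo₀₃ n)))
          (λ k → trans (matchings-relabel (not ∘ class03) ⌊_/2⌋ (λ a b ca cb → ⌊/2⌋-injective-on-class a b (same-class₁₂ a b ca cb))
                          Jgraph Kgraph (λ x y cx cy → Jgraph-within x y (same-class₁₂ x y cx cy)) _ k (Allᵇ-filterᵇ-self (not ∘ class03) (upTo n)))
                   (cong (λ L → matchings Kgraph L k) (halves-upTo₁₂ n))) f)

≡0mod4⇒class03 : ∀ u → ≡0mod4 u ≡ true → class03 u ≡ true
≡0mod4⇒class03 u h with odd u | odd ⌊ u /2⌋
... | false | false = refl
... | false | true with () ← h
... | true | _ with () ← h

≡3mod4⇒class03 : ∀ u → ≡3mod4 u ≡ true → class03 u ≡ true
≡3mod4⇒class03 u h with odd u | odd ⌊ u /2⌋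
... | true | true = refl
... | true | false with () ← h
... | false | _ with () ← h

≡1mod4⇒class12 : ∀ u → ≡1mod4 u ≡ true → not (class03 u) ≡ true
≡1mod4⇒class12 u h with odd u | odd ⌊ u /2⌋
... | true | false = refl
... | true | true with () ← h
... | false | _ with () ← h

≡2mod4⇒class12 : ∀ u → ≡2mod4 u ≡ true → not (class03 u) ≡ true
≡2mod4⇒class12 u h with odd u | odd ⌊ u /2⌋
... | false | true = refl
... | false | false with () ← h
... | true | _ with () ← h

≡0mod4∩≡3mod4 : ∀ u → ≡0mod4 u ∧ ≡3mod4 u ≡ false
≡0mod4∩≡3mod4 u with odd u | odd ⌊ u /2⌋
... | true | _ = refl
... | false | true = refl
... | false | false = refl

≡1mod4∩≡2mod4 : ∀ u → ≡1mod4 u ∧ ≡2mod4 u ≡ false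
≡1mod4∩≡2mod4 u with odd u | odd ⌊ u /2⌋
... | true | true = refl
... | true | false = refl
... | false | _ = refl

≡0mod4-on-class03 : ∀ u → class03 u ≡ true → ≡0mod4 u ≡ even ⌊ u /2⌋
≡0mod4-on-class03 u h with odd u | odd ⌊ u /2⌋
... | false | b = refl
... | true | true = refl
... | true | false with () ← h

≡3mod4-on-class03 : ∀ u → class03 u ≡ true → ≡3mod4 u ≡ not (even ⌊ u /2⌋)
≡3mod4-on-class03 u h with odd u | odd ⌊ u /2⌋
... | true | b = sym (not-involutive b)
... | false | false = refl
... | false | true with () ← h

≡1mod4-on-class12 : ∀ u → not (class03 u) ≡ true → ≡1mod4 u ≡ even ⌊ u /2⌋
≡1mod4-on-class12 u h with odd u | odd ⌊ u /2⌋
... | true | b = refl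
... | false | true = refl
... | false | false with () ← h

≡2mod4-on-class12 : ∀ u → not (class03 u) ≡ true → ≡2mod4 u ≡ not (even ⌊ u /2⌋)
≡2mod4-on-class12 u h with odd u | odd ⌊ u /2⌋
... | false | b = sym (not-involutive b)
... | true | false = refl
... | true | true with () ← h

Kgraph-split : ∀ n f → let a = n₀₃ n ; b = n₁₂ n in
  matchings Kgraph (upTo n) f ≡
    ((matchings Jgraph (upTo a) ⊛ matchings Jgraph (upTo b)) f xor
     (matchings∖₁ Jgraph even (upTo a) ⊛ matchings∖₁ Jgraph even (upTo b)) f) xor
    ((matchings∖₁ Jgraph (not ∘ even) (upTo a) ⊛ matchings∖₁ Jgraph (not ∘ even) (upTo b)) f xor
     (matchings∖₂ Jgraph even (not ∘ even) (upTo a) ⊛ matchings∖₂ Jgraph even (not ∘ even) (upTo b)) f)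
Kgraph-split n f =
  trans (matchings-cong Kgraph-decomposition (upTo n) f)
    (trans (matchings-two-bicliques Kgraph₀ class03 Kgraph₀-across ≡0mod4 ≡1mod4 ≡2mod4 ≡3mod4
              ≡0mod4⇒class03 ≡1mod4⇒class12 ≡2mod4⇒class12 ≡3mod4⇒class03 ≡0mod4∩≡3mod4 ≡1mod4∩≡2mod4
              (upTo n) f (Distinct-upTo n))
      (cong₂ _xor_ (cong₂ _xor_ (⊛-cong (λ k → M₀₃ k) (λ k → M₁₂ k) f)
                                (⊛-cong (λ k → ρ₀₃ ≡0mod4 even ≡0mod4-on-class03 k) (λ k → ρ₁₂ ≡1mod4 even ≡1mod4-on-class12 k) f))
                   (cong₂ _xor_ (⊛-cong (λ k → ρ₀₃ ≡3mod4 (not ∘ even) ≡3mod4-on-class03 k) (λ k → ρ₁₂ ≡2mod4 (not ∘ even) ≡2mod4-on-class12 k) f)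
                                (⊛-cong (λ k → μ₀₃ k) (λ k → μ₁₂ k) f))))
  where
  A B : List ℕ
  A = filterᵇ class03 (upTo n)
  B = filterᵇ (not ∘ class03) (upTo n)
  Kgraph₀-across : ∀ x y → class03 x ≡ not (class03 y) → Kgraph₀ x y ≡ false
  Kgraph₀-across x y h rewrite h with class03 y
  ... | true = refl
  ... | false = refl
  Kgraph₀-within : ∀ x y → class03 x ≡ class03 y → Kgraph₀ x y ≡ Jgraph ⌊ x /2⌋ ⌊ y /2⌋
  Kgraph₀-within x y h rewrite h | xor-same (class03 y) = Kgraph-within x y h
  inj₀₃ : ∀ a b → class03 a ≡ true → class03 b ≡ true → ⌊ a /2⌋ ≡ ⌊ b /2⌋ → a ≡ b
  inj₀₃ a b ca cb = ⌊/2⌋-injective-on-class a b (same-class₀₃ a b ca cb)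
  inj₁₂ : ∀ a b → not (class03 a) ≡ true → not (class03 b) ≡ true → ⌊ a /2⌋ ≡ ⌊ b /2⌋ → a ≡ b
  inj₁₂ a b ca cb = ⌊/2⌋-injective-on-class a b (same-class₁₂ a b ca cb)
  edges₀₃ : ∀ x y → class03 x ≡ true → class03 y ≡ true → Kgraph₀ x y ≡ Jgraph ⌊ x /2⌋ ⌊ y /2⌋
  edges₀₃ x y cx cy = Kgraph₀-within x y (same-class₀₃ x y cx cy)
  edges₁₂ : ∀ x y → not (class03 x) ≡ true → not (class03 y) ≡ true → Kgraph₀ x y ≡ Jgraph ⌊ x /2⌋ ⌊ y /2⌋
  edges₁₂ x y cx cy = Kgraph₀-within x y (same-class₁₂ x y cx cy)
  all₀₃ : Allᵇ class03 A
  all₀₃ = Allᵇ-filterᵇ-self class03 (upTo n)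
  all₁₂ : Allᵇ (not ∘ class03) B
  all₁₂ = Allᵇ-filterᵇ-self (not ∘ class03) (upTo n)
  M₀₃ : ∀ k → matchings Kgraph₀ A k ≡ matchings Jgraph (upTo (n₀₃ n)) k
  M₀₃ k = trans (matchings-relabel class03 ⌊_/2⌋ inj₀₃ Kgraph₀ Jgraph edges₀₃ A k all₀₃) (cong (λ L → matchings Jgraph L k) (halves-upTo₀₃ n))
  M₁₂ : ∀ k → matchings Kgraph₀ B k ≡ matchings Jgraph (upTo (n₁₂ n)) k
  M₁₂ k = trans (matchings-relabel (not ∘ class03) ⌊_/2⌋ inj₁₂ Kgraph₀ Jgraph edges₁₂ B k all₁₂) (cong (λ L → matchings Jgraph L k) (halves-upTo₁₂ n))
  ρ₀₃ : ∀ P P′ → (∀ u → class03 u ≡ true → P u ≡ P′ ⌊ u /2⌋) → ∀ k →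
        matchings∖₁ Kgraph₀ P A k ≡ matchings∖₁ Jgraph P′ (upTo (n₀₃ n)) k
  ρ₀₃ P P′ h k = trans (matchings∖₁-relabel class03 ⌊_/2⌋ inj₀₃ Kgraph₀ Jgraph edges₀₃ A P P′ k all₀₃ h) (cong (λ L → matchings∖₁ Jgraph P′ L k) (halves-upTo₀₃ n))
  ρ₁₂ : ∀ P P′ → (∀ u → not (class03 u) ≡ true → P u ≡ P′ ⌊ u /2⌋) → ∀ k →
        matchings∖₁ Kgraph₀ P B k ≡ matchings∖₁ Jgraph P′ (upTo (n₁₂ n)) k
  ρ₁₂ P P′ h k = trans (matchings∖₁-relabel (not ∘ class03) ⌊_/2⌋ inj₁₂ Kgraph₀ Jgraph edges₁₂ B P P′ k all₁₂ h) (cong (λ L → matchings∖₁ Jgraph P′ L k) (halves-upTo₁₂ n))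
  μ₀₃ : ∀ k → matchings∖₂ Kgraph₀ ≡0mod4 ≡3mod4 A k ≡ matchings∖₂ Jgraph even (not ∘ even) (upTo (n₀₃ n)) k
  μ₀₃ k = trans (matchings∖₂-relabel class03 ⌊_/2⌋ inj₀₃ Kgraph₀ Jgraph edges₀₃ A ≡0mod4 even ≡3mod4 (not ∘ even) k all₀₃ ≡0mod4-on-class03 ≡3mod4-on-class03)
                (cong (λ L → matchings∖₂ Jgraph even (not ∘ even) L k) (halves-upTo₀₃ n))
  μ₁₂ : ∀ k → matchings∖₂ Kgraph₀ ≡1mod4 ≡2mod4 B k ≡ matchings∖₂ Jgraph even (not ∘ even) (upTo (n₁₂ n)) k
  μ₁₂ k = trans (matchings∖₂-relabel (not ∘ class03) ⌊_/2⌋ inj₁₂ Kgraph₀ Jgraph edges₁₂ B ≡1mod4 even ≡2mod4 (not ∘ even) k all₁₂ ≡1mod4-on-class12 ≡2mod4-on-class12)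
                (cong (λ L → matchings∖₂ Jgraph even (not ∘ even) L k) (halves-upTo₁₂ n))

-- Induction on the number of vertices

count-upTo-suc₂ : ∀ p n → count p (upTo (suc (suc n))) ≡ count p (upTo n) + bit (p n) + bit (p (suc n))
count-upTo-suc₂ p n = trans (count-upTo-suc p (suc n)) (cong (_+ bit (p (suc n))) (count-upTo-suc p n))

count-upTo-double : ∀ k → count even (upTo (k + k)) ≡ k × count (not ∘ even) (upTo (k + k)) ≡ k
count-upTo-double zero = refl , refl
count-upTo-double (suc k) =
  step even (proj₁ (count-upTo-double k)) (cong (λ o → not o xor not (not o)) (odd-double k)) ,
  step (not ∘ even) (proj₂ (count-upTo-double k)) (cong (λ o → not (not o) xor not (not (not o))) (odd-double k))
  where
  exactly-one : ∀ a b → a xor b ≡ true → k + bit a + bit b ≡ suc k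
  exactly-one true false _ = trans (cong (_+ 0) (+-comm k 1)) (+-identityʳ (suc k))
  exactly-one false true _ = trans (cong (_+ 1) (+-identityʳ k)) (+-comm k 1)
  step : ∀ p → count p (upTo (k + k)) ≡ k → p (k + k) xor p (suc (k + k)) ≡ true → count p (upTo (suc k + suc k)) ≡ suc k
  step p ih one = trans (cong (λ m → count p (upTo (suc m))) (+-suc k k))
    (trans (count-upTo-suc₂ p (k + k))
      (trans (cong (λ c → c + bit (p (k + k)) + bit (p (suc (k + k)))) ih) (exactly-one _ _ one)))

balanced : ∀ s → odd s ≡ false → count even (upTo s) ≡ count (not ∘ even) (upTo s)
balanced s e rewrite even⇒≡double s e =
  trans (proj₁ (count-upTo-double ⌊ s /2⌋)) (sym (proj₂ (count-upTo-double ⌊ s /2⌋)))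

unbalanced : ∀ s → odd s ≡ true → count even (upTo s) ≡ suc (count (not ∘ even) (upTo s))
unbalanced s o rewrite odd⇒≡suc-double s o | count-upTo-suc even (⌊ s /2⌋ + ⌊ s /2⌋)
  | count-upTo-suc (not ∘ even) (⌊ s /2⌋ + ⌊ s /2⌋) | odd-double ⌊ s /2⌋
  | proj₁ (count-upTo-double ⌊ s /2⌋) | proj₂ (count-upTo-double ⌊ s /2⌋) =
  trans (+-comm ⌊ s /2⌋ 1) (cong suc (sym (+-identityʳ ⌊ s /2⌋)))

module EvenSize (b : ℕ → Bool) (s : ℕ) (e : odd s ≡ false) =
  Balanced (sumGraph b) even (sumGraph-bipartite b) (upTo s) (Distinct-upTo s) (balanced s e)

module OddSize (b : ℕ → Bool) (s : ℕ) (o : odd s ≡ true) =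
  Unbalanced (sumGraph b) even (sumGraph-bipartite b) (upTo s) (Distinct-upTo s) (unbalanced s o)

⊛-square-0 : ∀ F → (F ⊛ F) 0 ≡ F 0
⊛-square-0 F = ∧-idem (F 0)

-- Over GF(2) the cross terms of a square cancel.
⊛-square-2 : ∀ F → (F ⊛ F) 2 ≡ F 1
⊛-square-2 F =
  trans (solve 3 (λ a b c → a :* c :+ (b :* b :+ c :* a) := b :* b) refl (F 0) (F 1) (F 2)) (∧-idem (F 1))
  where open xor-∧-Solver

odd-bit : ∀ b → odd (bit b) ≡ b
odd-bit true = refl
odd-bit false = refl

n₀₃-double : ∀ y → n₀₃ (y + y) ≡ y
n₀₃-double y = trans (n₀₃-formula (y + y))
  (trans (cong₂ (λ h o → h + bit (o ∧ not (odd h))) (⌊double/2⌋ y) (odd-double y)) (+-identityʳ y))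

n₁₂-double : ∀ y → n₁₂ (y + y) ≡ y
n₁₂-double y = trans (n₁₂-formula (y + y))
  (trans (cong₂ (λ h o → h + bit (o ∧ odd h)) (⌊double/2⌋ y) (odd-double y)) (+-identityʳ y))

n₀₃-suc-double : ∀ y → n₀₃ (suc (y + y)) ≡ y + bit (even y)
n₀₃-suc-double y = trans (n₀₃-formula (suc (y + y)))
  (cong₂ (λ h o → h + bit (o ∧ not (odd h))) (⌊suc-double/2⌋ y) (cong not (odd-double y)))

n₁₂-suc-double : ∀ y → n₁₂ (suc (y + y)) ≡ y + bit (odd y)
n₁₂-suc-double y = trans (n₁₂-formula (suc (y + y)))
  (cong₂ (λ h o → h + bit (o ∧ odd h)) (⌊suc-double/2⌋ y) (cong not (odd-double y)))

odd-n₀₃-suc-double : ∀ y → odd (n₀₃ (suc (y + y))) ≡ true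
odd-n₀₃-suc-double y = trans (cong odd (n₀₃-suc-double y))
  (trans (odd-+ y (bit (even y))) (trans (cong (odd y xor_) (odd-bit (even y))) (xor-inverseʳ (odd y))))

odd-n₁₂-suc-double : ∀ y → odd (n₁₂ (suc (y + y))) ≡ false
odd-n₁₂-suc-double y = trans (cong odd (n₁₂-suc-double y))
  (trans (odd-+ y (bit (odd y))) (trans (cong (odd y xor_) (odd-bit (odd y))) (xor-same (odd y))))

K-invariant J-invariant : ℕ → Bool
K-invariant n = matchings Kgraph (upTo n) (bit (odd n))
J-invariant n = if odd n then matchings Jgraph (upTo n) 1 else (matchings Jgraph (upTo n) 0 xor matchings Jgraph (upTo n) 2)

K-invariant-even : ∀ n → odd n ≡ false → K-invariant n ≡ matchings Kgraph (upTo n) 0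
K-invariant-even n e rewrite e = refl

K-invariant-odd : ∀ n → odd n ≡ true → K-invariant n ≡ matchings Kgraph (upTo n) 1
K-invariant-odd n o rewrite o = refl

J-invariant-even : ∀ n → odd n ≡ false → J-invariant n ≡ (matchings Jgraph (upTo n) 0 xor matchings Jgraph (upTo n) 2)
J-invariant-even n e rewrite e = refl

J-invariant-odd : ∀ n → odd n ≡ true → J-invariant n ≡ matchings Jgraph (upTo n) 1
J-invariant-odd n o rewrite o = refl

MJ MK ρJ ρ̄J μJ : ℕ → Series
MJ s = matchings Jgraph (upTo s)
MK s = matchings Kgraph (upTo s)
ρJ s = matchings∖₁ Jgraph even (upTo s)
ρ̄J s = matchings∖₁ Jgraph (not ∘ even) (upTo s)
μJ s = matchings∖₂ Jgraph even (not ∘ even) (upTo s)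

Jgraph-split-at : ∀ n a b f → n₀₃ n ≡ a → n₁₂ n ≡ b → MJ n f ≡ (MK a ⊛ MK b) f
Jgraph-split-at n _ _ f refl refl = Jgraph-split n f

Kgraph-split-at : ∀ n a b f → n₀₃ n ≡ a → n₁₂ n ≡ b →
  MK n f ≡ ((MJ a ⊛ MJ b) f xor (ρJ a ⊛ ρJ b) f) xor ((ρ̄J a ⊛ ρ̄J b) f xor (μJ a ⊛ μJ b) f)
Kgraph-split-at n _ _ f refl refl = Kgraph-split n f

invariants-double : ∀ y → K-invariant y ≡ true → J-invariant y ≡ true →
                    K-invariant (y + y) ≡ true × J-invariant (y + y) ≡ true
invariants-double y Ky Jy = by-parity (odd y) refl
  where
  by-parity : ∀ b → odd y ≡ b → K-invariant (y + y) ≡ true × J-invariant (y + y) ≡ true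
  by-parity false oy = K-holds , J-holds
    where
    open ≡-Reasoning
    open EvenSize jᵇ y oy using () renaming (matchings∖₁-0 to ρ0; matchings∖₁-complement-0 to ρ̄0; matchings∖₂-0 to μ0)
    open EvenSize kᵇ y oy using () renaming (matchings-1 to K1)
    K-holds : K-invariant (y + y) ≡ true
    K-holds = begin
      K-invariant (y + y)                                      ≡⟨ K-invariant-even (y + y) (odd-double y) ⟩
      MK (y + y) 0                                             ≡⟨ Kgraph-split-at (y + y) y y 0 (n₀₃-double y) (n₁₂-double y) ⟩
      ((MJ y 0 ∧ MJ y 0) xor (ρJ y 0 ∧ ρJ y 0)) xor ((ρ̄J y 0 ∧ ρ̄J y 0) xor (μJ y 0 ∧ μJ y 0))
        ≡⟨ cong₂ (λ a b → (MJ y 0 ∧ MJ y 0 xor a) xor b) (cong₂ _∧_ ρ0 ρ0) (cong₂ _xor_ (cong₂ _∧_ ρ̄0 ρ̄0) (cong₂ _∧_ μ0 μ0)) ⟩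
      ((MJ y 0 ∧ MJ y 0) xor false) xor (false xor (MJ y 2 ∧ MJ y 2))
        ≡⟨ cong₂ _xor_ (trans (xor-identityʳ _) (∧-idem (MJ y 0))) (∧-idem (MJ y 2)) ⟩
      MJ y 0 xor MJ y 2                                        ≡⟨ sym (J-invariant-even y oy) ⟩
      J-invariant y                                            ≡⟨ Jy ⟩
      true ∎
    J-holds : J-invariant (y + y) ≡ true
    J-holds = begin
      J-invariant (y + y)                                      ≡⟨ J-invariant-even (y + y) (odd-double y) ⟩
      MJ (y + y) 0 xor MJ (y + y) 2
        ≡⟨ cong₂ _xor_ (Jgraph-split-at (y + y) y y 0 (n₀₃-double y) (n₁₂-double y)) (Jgraph-split-at (y + y) y y 2 (n₀₃-double y) (n₁₂-double y)) ⟩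
      (MK y ⊛ MK y) 0 xor (MK y ⊛ MK y) 2                      ≡⟨ cong₂ _xor_ (⊛-square-0 (MK y)) (trans (⊛-square-2 (MK y)) K1) ⟩
      MK y 0 xor false                                         ≡⟨ xor-identityʳ _ ⟩
      MK y 0                                                   ≡⟨ sym (K-invariant-even y oy) ⟩
      K-invariant y                                            ≡⟨ Ky ⟩
      true ∎
  by-parity true oy = K-holds , J-holds
    where
    open ≡-Reasoning
    open OddSize jᵇ y oy using () renaming (matchings-0 to J0; matchings∖₁-0 to ρ0; matchings∖₁-complement-0 to ρ̄0; matchings∖₂-0 to μ0)
    open OddSize kᵇ y oy using () renaming (matchings-0 to K0)
    K-holds : K-invariant (y + y) ≡ true
    K-holds = begin
      K-invariant (y + y)                                      ≡⟨ K-invariant-even (y + y) (odd-double y) ⟩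
      MK (y + y) 0                                             ≡⟨ Kgraph-split-at (y + y) y y 0 (n₀₃-double y) (n₁₂-double y) ⟩
      ((MJ y 0 ∧ MJ y 0) xor (ρJ y 0 ∧ ρJ y 0)) xor ((ρ̄J y 0 ∧ ρ̄J y 0) xor (μJ y 0 ∧ μJ y 0))
        ≡⟨ cong₂ _xor_ (cong₂ _xor_ (cong₂ _∧_ J0 J0) (cong₂ _∧_ ρ0 ρ0)) (cong₂ _xor_ (cong₂ _∧_ ρ̄0 ρ̄0) (cong₂ _∧_ μ0 μ0)) ⟩
      (MJ y 1 ∧ MJ y 1) xor false                              ≡⟨ trans (xor-identityʳ _) (∧-idem (MJ y 1)) ⟩
      MJ y 1                                                   ≡⟨ sym (J-invariant-odd y oy) ⟩
      J-invariant y                                            ≡⟨ Jy ⟩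
      true ∎
    J-holds : J-invariant (y + y) ≡ true
    J-holds = begin
      J-invariant (y + y)                                      ≡⟨ J-invariant-even (y + y) (odd-double y) ⟩
      MJ (y + y) 0 xor MJ (y + y) 2
        ≡⟨ cong₂ _xor_ (Jgraph-split-at (y + y) y y 0 (n₀₃-double y) (n₁₂-double y)) (Jgraph-split-at (y + y) y y 2 (n₀₃-double y) (n₁₂-double y)) ⟩
      (MK y ⊛ MK y) 0 xor (MK y ⊛ MK y) 2                      ≡⟨ cong₂ _xor_ (trans (⊛-square-0 (MK y)) K0) (⊛-square-2 (MK y)) ⟩
      MK y 1                                                   ≡⟨ sym (K-invariant-odd y oy) ⟩
      K-invariant y                                            ≡⟨ Ky ⟩
      true ∎

Kgraph-split-value-1 : ∀ a b → odd a ≡ true → odd b ≡ false →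
  ((MJ a ⊛ MJ b) 1 xor (ρJ a ⊛ ρJ b) 1) xor ((ρ̄J a ⊛ ρ̄J b) 1 xor (μJ a ⊛ μJ b) 1) ≡ MJ a 1 ∧ (MJ b 0 xor MJ b 2)
Kgraph-split-value-1 a b oa eb
  rewrite OddSize.matchings-0 jᵇ a oa | OddSize.matchings∖₁-0 jᵇ a oa | OddSize.matchings∖₁-1 jᵇ a oa
        | OddSize.matchings∖₁-complement-0 jᵇ a oa | OddSize.matchings∖₁-complement-1 jᵇ a oa
        | OddSize.matchings∖₂-0 jᵇ a oa | OddSize.matchings∖₂-1 jᵇ a oa
        | EvenSize.matchings∖₁-1 jᵇ b eb =
  solve 3 (λ a1 b0 b2 → (a1 :* b0) :+ ((a1 :* b2) :+ con false) :+ con false := a1 :* (b0 :+ b2)) refl (MJ a 1) (MJ b 0) (MJ b 2)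
  where open xor-∧-Solver

Jgraph-split-value-1 : ∀ a b → odd a ≡ true → (MK a ⊛ MK b) 1 ≡ MK a 1 ∧ MK b 0
Jgraph-split-value-1 a b oa rewrite OddSize.matchings-0 kᵇ a oa = refl

invariants-suc-double : ∀ y → let a = n₀₃ (suc (y + y)) ; b = n₁₂ (suc (y + y)) in
  K-invariant a ≡ true → J-invariant a ≡ true → K-invariant b ≡ true → J-invariant b ≡ true →
  K-invariant (suc (y + y)) ≡ true × J-invariant (suc (y + y)) ≡ true
invariants-suc-double y Ka Ja Kb Jb = K-holds , J-holds
  where
  open ≡-Reasoning
  n a b : ℕ
  n = suc (y + y)
  a = n₀₃ n
  b = n₁₂ n
  on : odd n ≡ true
  on = cong not (odd-double y)
  oa : odd a ≡ true
  oa = odd-n₀₃-suc-double y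
  eb : odd b ≡ false
  eb = odd-n₁₂-suc-double y
  K-holds : K-invariant n ≡ true
  K-holds = begin
    K-invariant n                                             ≡⟨ K-invariant-odd n on ⟩
    MK n 1                                                    ≡⟨ Kgraph-split-at n a b 1 refl refl ⟩
    ((MJ a ⊛ MJ b) 1 xor (ρJ a ⊛ ρJ b) 1) xor ((ρ̄J a ⊛ ρ̄J b) 1 xor (μJ a ⊛ μJ b) 1)
                                                              ≡⟨ Kgraph-split-value-1 a b oa eb ⟩
    MJ a 1 ∧ (MJ b 0 xor MJ b 2)                              ≡⟨ cong₂ _∧_ (trans (sym (J-invariant-odd a oa)) Ja)
                                                                           (trans (sym (J-invariant-even b eb)) Jb) ⟩
    true ∎
  J-holds : J-invariant n ≡ true
  J-holds = begin
    J-invariant n                                             ≡⟨ J-invariant-odd n on ⟩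
    MJ n 1                                                    ≡⟨ Jgraph-split-at n a b 1 refl refl ⟩
    (MK a ⊛ MK b) 1                                           ≡⟨ Jgraph-split-value-1 a b oa ⟩
    MK a 1 ∧ MK b 0                                           ≡⟨ cong₂ _∧_ (trans (sym (K-invariant-odd a oa)) Ka)
                                                                           (trans (sym (K-invariant-even b eb)) Kb) ⟩
    true ∎

-- The recursion passes from n ≥ 2 vertices to the class sizes n₀₃ n, n₁₂ n ≤ ⌈ n /2⌉ < n.
invariants : ∀ n → K-invariant n ≡ true × J-invariant n ≡ true
invariants = <-rec _ step
  where
  step : ∀ n → (∀ {m} → m < n → K-invariant m ≡ true × J-invariant m ≡ true) → K-invariant n ≡ true × J-invariant n ≡ true
  step zero _ = matchings-[] Kgraph 0 , cong₂ _xor_ (matchings-[] Jgraph 0) (matchings-[] Jgraph 2)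
  step (suc zero) _ = single Kgraph , single Jgraph
    where
    single : ∀ E → matchings E (upTo 1) 1 ≡ true
    single E = trans (matchings-∷ E 0 [] 1) (trans (xor-identityʳ _) (matchings-[] E 0))
  step n@(suc (suc m)) ih = by-parity (odd n) refl
    where
    y = ⌊ n /2⌋
    by-parity : ∀ b → odd n ≡ b → K-invariant n ≡ true × J-invariant n ≡ true
    by-parity false on = subst (λ k → K-invariant k ≡ true × J-invariant k ≡ true) (sym (even⇒≡double n on))
                           (invariants-double y (proj₁ (ih y<n)) (proj₂ (ih y<n)))
      where
      y<n : y < n
      y<n = ⌊n/2⌋<n (suc m)
    by-parity true on = subst (λ k → K-invariant k ≡ true × J-invariant k ≡ true) (sym (odd⇒≡suc-double n on))
                          (invariants-suc-double y (proj₁ (ih a<n)) (proj₂ (ih a<n)) (proj₁ (ih b<n)) (proj₂ (ih b<n)))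
      where
      smaller : ∀ {k c} → k ≡ y + bit c → k < n
      smaller {k} {c} k≡ = subst (k <_) (sym (odd⇒≡suc-double n on)) (s≤s (≤-trans (≤-reflexive k≡) (+-monoʳ-≤ y (bit≤y c))))
        where
        bit≤y : ∀ c → bit c ≤ y
        bit≤y true = s≤s z≤n
        bit≤y false = z≤n
      a<n : n₀₃ (suc (y + y)) < n
      a<n = smaller (n₀₃-suc-double y)
      b<n : n₁₂ (suc (y + y)) < n
      b<n = smaller (n₁₂-suc-double y)

K-invariant≡xor : ∀ n → K-invariant n ≡ MK n 0 xor MK n 1
K-invariant≡xor n = by-parity (odd n) refl
  where
  by-parity : ∀ b → odd n ≡ b → K-invariant n ≡ MK n 0 xor MK n 1
  by-parity false e = trans (K-invariant-even n e)
    (sym (trans (cong (MK n 0 xor_) (EvenSize.matchings-1 kᵇ n e)) (xor-identityʳ _)))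
  by-parity true o = trans (K-invariant-odd n o) (sym (cong (_xor MK n 1) (OddSize.matchings-0 kᵇ n o)))

-- Parities of ν

odd-length-filter : ∀ {A : Set} {P : A → Set} (P? : Decidable P) xs → odd (length (filter P? xs)) ≡ ⨁ xs (λ v → ⌊ P? v ⌋)
odd-length-filter P? [] = refl
odd-length-filter P? (x ∷ xs) with P? x
... | yes _ = cong not (odd-length-filter P? xs)
... | no _ = odd-length-filter P? xs

module _ (B : ℕ → Set) (B? : Decidable B) (b : ℕ → Bool) (b≡B? : ∀ n → b n ≡ ⌊ B? n ⌋) (m : ℕ) where

  open Counting m (sumGraph b) (sumGraph-sym b)

  fixedPoints≡fixedIn : ∀ v S → length (filter (λ i → lookup v i ≟ i) S) ≡ fixedIn S v
  fixedPoints≡fixedIn v [] = refl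
  fixedPoints≡fixedIn v (i ∷ S) with lookup v i ≟ i
  ... | yes e rewrite e | ≡ᶠ-refl i = cong suc (fixedPoints≡fixedIn v S)
  ... | no ne rewrite ≢⇒≡ᶠ-false ne = fixedPoints≡fixedIn v S

  Good≡supported : ∀ f v → ⌊ Good? B B? f v ⌋ ≡ supported (allFin m) f v
  Good≡supported f v = ⌊⌋-cong (Good? B B? f v) (Supported? (allFin m) f v) to from
    where
    σ = lookup v
    nothing-outside : FixesOutside (allFin m) v
    nothing-outside i i∉ with () ← trans (sym i∉) (∈⇒∈ᵇ (∈-map⁺ toℕ (∈-allFin i)))
    to : Good B B? f v → Supported (allFin m) f v
    to (inv , fixed , transpositions) =
      inv , nothing-outside , trans (sym (fixedPoints≡fixedIn v (allFin m))) fixed , edges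
      where
      edges : EdgeCycles v
      edges i moved = let (B-sum , odd-sum) = transpositions i moved in
        cong₂ _∧_ (trans (b≡B? _) (⌊ B? _ ⌋-yes B-sum)) (%2≡1⇒odd (toℕ i + toℕ (σ i)) odd-sum)
    from : Supported (allFin m) f v → Good B B? f v
    from (inv , _ , fixed , edges) = inv , trans (fixedPoints≡fixedIn v (allFin m)) fixed , transpositions
      where
      transpositions : AllBTransp σ B
      transpositions i moved with ∧-true (edges i moved)
      ... | b-sum , odd-sum = ⌊⌋-true (B? _) (trans (sym (b≡B? _)) b-sum) , odd⇒%2≡1 (toℕ i + toℕ (σ i)) odd-sum
  odd-ν : ∀ f → odd (ν m f B B?) ≡ matchings (sumGraph b) (upTo m) f
  odd-ν f =
    trans (odd-length-filter (Good? B B? f) Endos)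
      (trans (⨁-cong Endos (Good≡supported f))
        (trans (⨁-supported (allFin m) f (subst Distinct (sym (map-toℕ-allFin m)) (Distinct-upTo m)))
          (cong (λ L → matchings (sumGraph b) L f) (map-toℕ-allFin m))))

odd-νK : ∀ n f → odd (ν n f K K?) ≡ MK n f
odd-νK = odd-ν K K? kᵇ kᵇ-def

odd-νJ : ∀ n f → odd (ν n f J J?) ≡ MJ n f
odd-νJ = odd-ν J J? jᵇ jᵇ-def

odd-+⇒%2≡1 : ∀ a b → odd a xor odd b ≡ true → (a + b) % 2 ≡ 1
odd-+⇒%2≡1 a b o = odd⇒%2≡1 (a + b) (trans (odd-+ a b) o)

lemmaN : ∀ (m : ℕ) → 1 ≤ m →
    (ν m 0 K K? + ν m 1 K K?) % 2 ≡ 1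
    × ν (2 * m ∸ 1) 1 J J? % 2 ≡ 1
    × (ν (2 * m) 0 J J? + ν (2 * m) 2 J J?) % 2 ≡ 1
lemmaN m@(suc k) _ = K-claim , J-claim-odd , J-claim-even
  where
  2m≡m+m : 2 * m ≡ m + m
  2m≡m+m = cong (m +_) (+-identityʳ m)
  K-claim : (ν m 0 K K? + ν m 1 K K?) % 2 ≡ 1
  K-claim = odd-+⇒%2≡1 (ν m 0 K K?) (ν m 1 K K?)
    (trans (cong₂ _xor_ (odd-νK m 0) (odd-νK m 1)) (trans (sym (K-invariant≡xor m)) (proj₁ (invariants m))))
  J-claim-odd : ν (2 * m ∸ 1) 1 J J? % 2 ≡ 1
  J-claim-odd = subst (λ n → ν n 1 J J? % 2 ≡ 1) (sym (cong (_∸ 1) (trans 2m≡m+m (cong suc (+-suc k k)))))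
    (odd⇒%2≡1 (ν (suc (k + k)) 1 J J?) (trans (odd-νJ (suc (k + k)) 1)
      (trans (sym (J-invariant-odd (suc (k + k)) (cong not (odd-double k)))) (proj₂ (invariants (suc (k + k)))))))
  J-claim-even : (ν (2 * m) 0 J J? + ν (2 * m) 2 J J?) % 2 ≡ 1
  J-claim-even = subst (λ n → (ν n 0 J J? + ν n 2 J J?) % 2 ≡ 1) (sym 2m≡m+m)
    (odd-+⇒%2≡1 (ν (m + m) 0 J J?) (ν (m + m) 2 J J?) (trans (cong₂ _xor_ (odd-νJ (m + m) 0) (odd-νJ (m + m) 2))
      (trans (sym (J-invariant-even (m + m) (odd-double m))) (proj₂ (invariants (m + m))))))
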